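{- Every strongly normalising term $M\in\Lambda_{\circledR}$ is typeable in $\lambda_{\circledR}\cap$: there exist a basis $\Gamma$ and a strict type $\sigma$ such that $\Gamma\vdash M:\sigma$.
   Context: Terms. Fix a countably infinite set of variables. The set $\Lambda_{\circledR}$ of terms and the set $Fv(M)$ of free variables are defined simultaneously: every variable $x$ is a term with $Fv(x)=\{x\}$; $\lambda x.M$ is a term if $M$ is a term and $x\in Fv(M)$ (then $Fv=Fv(M)\setminus\{x\}$); $MN$ is a term if $M,N$ are terms and $Fv(M)\cap Fv(N)=\emptyset$ (then $Fv=Fv(M)\cup Fv(N)$); the erasure $x\odot M$ is a term if $M$ is a term and $x\notin Fv(M)$ (then $Fv=\{x\}\cup Fv(M)$); the duplication $x<^{x_1}_{x_2}M$ is a term if $M$ is a term, $x_1,x_2\in Fv(M)$, $x_1\ne x_2$, $x\notin Fv(M)\setminus\{x_1,x_2\}$ (then $Fv=\{x\}\cup(Fv(M)\setminus\{x_1,x_2\})$). $\lambda x$ binds $x$, the duplication binds $x_1,x_2$; terms are taken up to $\alpha$-conversion with Barendregt's variable convention. $Fv[M]$ is the ordered list of free variables (for $MN$: $Fv[M]$ followed by $Fv[N]$; for erasure/duplication the introduced $x$ is put first). For lists $X=[x_1,\dots,x_n]$, $Y,Z$ of equal length, $X\odot M$ abbreviates $x_1\odot\cdots x_n\odot M$ and $X<^{Y}_{Z}M$ abbreviates $x_1<^{y_1}_{z_1}\cdots x_n<^{y_n}_{z_n}M$ (both equal $M$ if $n=0$). Substitution. $M\langle N/x\rangle$ (for $M,N\in\Lambda_{\circledR}$,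 $x\in Fv(M)$, $(Fv(M)\setminus\{x\})\cap Fv(N)=\emptyset$) is the unique normal form, which lies in $\Lambda_{\circledR}$, of the explicit-substitution term $M[N/x]$ under the rewriting rules: $x[N/x]\to N$; $(\lambda y.M)[N/x]\to\lambda y.M[N/x]$ ($y\ne x$); $(MP)[N/x]\to M[N/x]P$ if $x\in Fv(M)$; $(MP)[N/x]\to M\,P[N/x]$ if $x\in Fv(P)$; $(y\odot M)[N/x]\to y\odot M[N/x]$ ($y\neq x$); $(x\odot M)[N/x]\to Fv(N)\odot M$; $(y<^{y_1}_{y_2}M)[N/x]\to y<^{y_1}_{y_2}M[N/x]$ ($y\ne x$); $(x<^{x_1}_{x_2}M)[N/x]\to Fv[N]<^{Fv[N_1]}_{Fv[N_2]}M[N_1/x_1][N_2/x_2]$, where $N_1,N_2$ are obtained from $N$ by renaming all its free variables to fresh variables. Reduction. $\rightarrow$ is the contextual closure, modulo structural equivalence, of: $(\lambda x.M)N\to M\langle N/x\rangle$; $x<^{x_1}_{x_2}(\lambda y.M)\to\lambda y.x<^{x_1}_{x_2}M$; $x<^{x_1}_{x_2}(MN)\to(x<^{x_1}_{x_2}M)N$ if $x_1,x_2\notin Fv(N)$; $x<^{x_1}_{x_2}(MN)\to M(x<^{x_1}_{x_2}N)$ if $x_1,x_2\notin Fv(M)$; $\lambda x.(y\odot M)\to y\odot(\lambda x.M)$ ($x\neq y$); $(x\odot M)N\to x\odot(MN)$; $M(x\odot N)\to x\odot(MN)$; $x<^{x_1}_{x_2}(y\odot M)\to y\odot(x<^{x_1}_{x_2}M)$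 ($y\ne x_1,x_2$); $x<^{x_1}_{x_2}(x_1\odot M)\to M\langle x/x_2\rangle$. Structural equivalence is the least equivalence closed under $\alpha$-conversion containing $x\odot(y\odot M)\equiv y\odot(x\odot M)$; $x<^{x_1}_{x_2}M\equiv x<^{x_2}_{x_1}M$; $x<^{y}_{z}(y<^{u}_{v}M)\equiv x<^{y}_{u}(y<^{z}_{v}M)$; $x<^{x_1}_{x_2}(y<^{y_1}_{y_2}M)\equiv y<^{y_1}_{y_2}(x<^{x_1}_{x_2}M)$ if $x\ne y_1,y_2$, $y\ne x_1,x_2$. A term is strongly normalising if it admits no infinite reduction sequence. Types. Strict types $\sigma::=p\mid\alpha\to\sigma$ ($p$ ranging over type atoms); types $\alpha::=\cap_{i=1}^n\sigma_i$, which is $\sigma_1\cap\dots\cap\sigma_n$ for $n>0$ and $\top$ for $n=0$; $\cap$ is commutative and associative with neutral element $\top$. A basis $\Gamma$ is a map from a finite set $Dom(\Gamma)$ of variables to types; $\Gamma,x:\alpha$ is its extension by $x\notin Dom(\Gamma)$; for $Dom(\Gamma)=Dom(\Delta)$, $(\Gamma\sqcap\Delta)(x)=\Gamma(x)\cap\Delta(x)$; $\Gamma^{\top}$ maps every variable of $Dom(\Gamma)$ to $\top$. The system $\lambda_{\circledR}\cap$ has rules: (Ax) $x:\sigma\vdash x:\sigma$; ($\to_I$) from $\Gamma,x:\alpha\vdash M:\sigma$ infer $\Gamma\vdash\lambda x.M:\alpha\to\sigma$; ($\to_E$) from $\Gamma\vdash M:\cap_{i=1}^n\tau_i\to\sigma$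 and $\Delta_0\vdash N:\tau_0,\dots,\Delta_n\vdash N:\tau_n$ infer $\Gamma,\Delta_0^{\top}\sqcap\Delta_1\sqcap\dots\sqcap\Delta_n\vdash MN:\sigma$; (Cont) from $\Gamma,x:\alpha,y:\beta\vdash M:\sigma$ infer $\Gamma,z:\alpha\cap\beta\vdash z<^{x}_{y}M:\sigma$; (Thin) from $\Gamma\vdash M:\sigma$ infer $\Gamma,x:\top\vdash x\odot M:\sigma$. -}

module Defs where

open import Data.Nat using (ℕ; _≟_)
open import Data.List using (List; []; _∷_; _++_; [_]; map; zipWith; length)
open import Data.List.Membership.Propositional using (_∈_; _∉_)
open import Data.List.Relation.Unary.Unique.Propositional using (Unique)
open import Data.List.Relation.Binary.Disjoint.Propositional using (Disjoint)
open import Data.List.Relation.Binary.Permutation.Propositional using (_↭_)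
open import Data.List.Relation.Binary.Pointwise using (Pointwise)
open import Data.Product using (_×_; _,_; proj₁; proj₂; ∃-syntax)
open import Relation.Binary.PropositionalEquality using (_≡_; _≢_)
open import Relation.Nullary using (yes; no)

Var : Set
Var = ℕ

data Term : Set where
  var : Var → Term
  lam : Var → Term → Term
  app : Term → Term → Term
  era : Var → Term → Term                 -- x ⊙ M
  dup : Var → Var → Var → Term → Term     -- x <^{x1}_{x2} M

_─_ : List Var → Var → List Var
[] ─ x = []
(y ∷ ys) ─ x with y ≟ x
... | yes _ = ys ─ x
... | no _ = y ∷ (ys ─ x)

fv : Term → List Var
fv (var x) = [ x ]
fv (lam x M) = fv M ─ x
fv (app M N) = fv M ++ fv N
fv (era x M) = x ∷ fv M
fv (dup x x1 x2 M) = x ∷ ((fv M ─ x1) ─ x2)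

-- membership in Λ_® (well-formedness conditions of the definition)
data WF : Term → Set where
  var : ∀ {x} → WF (var x)
  lam : ∀ {x M} → WF M → x ∈ fv M → WF (lam x M)
  app : ∀ {M N} → WF M → WF N → Disjoint (fv M) (fv N) → WF (app M N)
  era : ∀ {x M} → WF M → x ∉ fv M → WF (era x M)
  dup : ∀ {x x1 x2 M} → WF M → x1 ∈ fv M → x2 ∈ fv M → x1 ≢ x2 →
        x ∉ ((fv M ─ x1) ─ x2) → WF (dup x x1 x2 M)

vars : Term → List Var
vars (var x) = [ x ]
vars (lam x M) = x ∷ vars M
vars (app M N) = vars M ++ vars N
vars (era x M) = x ∷ vars M
vars (dup x y z M) = x ∷ y ∷ z ∷ vars M

swapV : Var → Var → Var → Var
swapV a b v with v ≟ a | v ≟ b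
... | yes _ | _ = b
... | no _ | yes _ = a
... | no _ | no _ = v

swap : Var → Var → Term → Term
swap a b (var x) = var (swapV a b x)
swap a b (lam x M) = lam (swapV a b x) (swap a b M)
swap a b (app M N) = app (swap a b M) (swap a b N)
swap a b (era x M) = era (swapV a b x) (swap a b M)
swap a b (dup x y z M) = dup (swapV a b x) (swapV a b y) (swapV a b z) (swap a b M)

swaps : List Var → List Var → Term → Term
swaps (v ∷ vs) (w ∷ ws) N = swaps vs ws (swap v w N)
swaps _ _ N = N

eras : List Var → Term → Term
eras [] M = M
eras (x ∷ xs) M = era x (eras xs M)

dups : List Var → List Var → List Var → Term → Term
dups (x ∷ xs) (y ∷ ys) (z ∷ zs) M = dup x y z (dups xs ys zs M)
dups _ _ _ M = M

data _=α_ : Term → Term → Set where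
  var : ∀ {x} → var x =α var x
  lam : ∀ {x y z M N} → z ∉ vars (lam x M) → z ∉ vars (lam y N) →
        swap z x M =α swap z y N → lam x M =α lam y N
  app : ∀ {M M' N N'} → M =α M' → N =α N' → app M N =α app M' N'
  era : ∀ {x M N} → M =α N → era x M =α era x N
  dup : ∀ {x x1 x2 y1 y2 z1 z2 M N} → z1 ≢ z2 →
        z1 ∉ vars (dup x x1 x2 M) → z1 ∉ vars (dup x y1 y2 N) →
        z2 ∉ vars (dup x x1 x2 M) → z2 ∉ vars (dup x y1 y2 N) →
        swap z1 x1 (swap z2 x2 M) =α swap z1 y1 (swap z2 y2 N) →
        dup x x1 x2 M =α dup x y1 y2 N

-- Substitution M⟨N/x⟩: R is the normal form of M[N/x]
-- (structural rendering of the rewriting rules; Barendregt's convention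
--  is made explicit as side conditions, alpha-renaming being available
--  in the reduction through structural equivalence)

data _⟨_/_⟩⇒_ : Term → Term → Var → Term → Set where
  s-var : ∀ {N x} → var x ⟨ N / x ⟩⇒ N
  s-lam : ∀ {y M N x R} → y ≢ x → y ∉ fv N → M ⟨ N / x ⟩⇒ R →
          lam y M ⟨ N / x ⟩⇒ lam y R
  s-appL : ∀ {M P N x R} → x ∈ fv M → M ⟨ N / x ⟩⇒ R →
           app M P ⟨ N / x ⟩⇒ app R P
  s-appR : ∀ {M P N x R} → x ∈ fv P → P ⟨ N / x ⟩⇒ R →
           app M P ⟨ N / x ⟩⇒ app M R
  s-era : ∀ {y M N x R} → y ≢ x → M ⟨ N / x ⟩⇒ R →
          era y M ⟨ N / x ⟩⇒ era y R
  s-eraHit : ∀ {M N x} → era x M ⟨ N / x ⟩⇒ eras (fv N) M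
  s-dup : ∀ {y y1 y2 M N x R} → y ≢ x → y1 ∉ fv N → y2 ∉ fv N →
          M ⟨ N / x ⟩⇒ R → dup y y1 y2 M ⟨ N / x ⟩⇒ dup y y1 y2 R
  s-dupHit : ∀ {x x1 x2 M N R1 R2} (W1 W2 : List Var) →
             length W1 ≡ length (fv N) → length W2 ≡ length (fv N) →
             Unique (W1 ++ W2) →
             Disjoint (W1 ++ W2) (x ∷ x1 ∷ x2 ∷ (vars M ++ vars N)) →
             M ⟨ swaps (fv N) W1 N / x1 ⟩⇒ R1 →
             R1 ⟨ swaps (fv N) W2 N / x2 ⟩⇒ R2 →
             dup x x1 x2 M ⟨ N / x ⟩⇒
               dups (fv N) (fv (swaps (fv N) W1 N)) (fv (swaps (fv N) W2 N)) R2

data _≡ₛ_ : Term → Term → Set where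
  α≡ : ∀ {M N} → M =α N → M ≡ₛ N
  era-comm : ∀ {x y M} → era x (era y M) ≡ₛ era y (era x M)
  dup-comm : ∀ {x x1 x2 M} → dup x x1 x2 M ≡ₛ dup x x2 x1 M
  dup-assoc : ∀ {x y z u v M} →
              dup x y z (dup y u v M) ≡ₛ dup x y u (dup y z v M)
  dup-perm : ∀ {x x1 x2 y y1 y2 M} → x ≢ y1 → x ≢ y2 → y ≢ x1 → y ≢ x2 →
             dup x x1 x2 (dup y y1 y2 M) ≡ₛ dup y y1 y2 (dup x x1 x2 M)
  c-lam : ∀ {x M N} → M ≡ₛ N → lam x M ≡ₛ lam x N
  c-appL : ∀ {M M' N} → M ≡ₛ M' → app M N ≡ₛ app M' N
  c-appR : ∀ {M N N'} → N ≡ₛ N' → app M N ≡ₛ app M N'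
  c-era : ∀ {x M N} → M ≡ₛ N → era x M ≡ₛ era x N
  c-dup : ∀ {x y z M N} → M ≡ₛ N → dup x y z M ≡ₛ dup x y z N
  refl≡ : ∀ {M} → M ≡ₛ M
  sym≡ : ∀ {M N} → M ≡ₛ N → N ≡ₛ M
  trans≡ : ∀ {M N P} → M ≡ₛ N → N ≡ₛ P → M ≡ₛ P

data _⟶_ : Term → Term → Set where
  β : ∀ {x M N R} → M ⟨ N / x ⟩⇒ R → app (lam x M) N ⟶ R
  γ-lam : ∀ {x x1 x2 y M} → y ≢ x →
          dup x x1 x2 (lam y M) ⟶ lam y (dup x x1 x2 M)
  γ-appL : ∀ {x x1 x2 M N} → x1 ∉ fv N → x2 ∉ fv N →
           dup x x1 x2 (app M N) ⟶ app (dup x x1 x2 M) N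
  γ-appR : ∀ {x x1 x2 M N} → x1 ∉ fv M → x2 ∉ fv M →
           dup x x1 x2 (app M N) ⟶ app M (dup x x1 x2 N)
  ω-lam : ∀ {x y M} → x ≢ y → lam x (era y M) ⟶ era y (lam x M)
  ω-appL : ∀ {x M N} → app (era x M) N ⟶ era x (app M N)
  ω-appR : ∀ {x M N} → app M (era x N) ⟶ era x (app M N)
  γω : ∀ {x x1 x2 y M} → y ≢ x1 → y ≢ x2 →
       dup x x1 x2 (era y M) ⟶ era y (dup x x1 x2 M)
  γω-hit : ∀ {x x1 x2 M R} → M ⟨ var x / x2 ⟩⇒ R →
           dup x x1 x2 (era x1 M) ⟶ R
  c-lam : ∀ {x M N} → M ⟶ N → lam x M ⟶ lam x N
  c-appL : ∀ {M M' N} → M ⟶ M' → app M N ⟶ app M' N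
  c-appR : ∀ {M N N'} → N ⟶ N' → app M N ⟶ app M N'
  c-era : ∀ {x M N} → M ⟶ N → era x M ⟶ era x N
  c-dup : ∀ {x y z M N} → M ⟶ N → dup x y z M ⟶ dup x y z N
  equiv : ∀ {M M' N' N} → M ≡ₛ M' → M' ⟶ N' → N' ≡ₛ N → M ⟶ N

data SN (M : Term) : Set where
  sn : (∀ {N} → M ⟶ N → SN N) → SN M

-- Intersection types; a type is a list of strict types (⊤ = [])

Atom : Set
Atom = ℕ

data Strict : Set where
  atom : Atom → Strict
  _⇒_ : List Strict → Strict → Strict

Type : Set
Type = List Strict

-- equality of types modulo commutativity/associativity of ∩ (unit ⊤)
data _≈ˢ_ : Strict → Strict → Set
data _≈ᵗ_ : Type → Type → Set

data _≈ˢ_ where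
  atom : ∀ {p} → atom p ≈ˢ atom p
  arr : ∀ {α β σ τ} → α ≈ᵗ β → σ ≈ˢ τ → (α ⇒ σ) ≈ˢ (β ⇒ τ)

data _≈ᵗ_ where
  nil : [] ≈ᵗ []
  cons : ∀ {σ τ α β} → σ ≈ˢ τ → α ≈ᵗ β → (σ ∷ α) ≈ᵗ (τ ∷ β)
  swp : ∀ {σ τ α} → (σ ∷ τ ∷ α) ≈ᵗ (τ ∷ σ ∷ α)
  trn : ∀ {α β γ} → α ≈ᵗ β → β ≈ᵗ γ → α ≈ᵗ γ

-- bases (finite maps, as association lists taken up to reordering)
Basis : Set
Basis = List (Var × Type)

dom : Basis → List Var
dom = map proj₁

_≈ᴮ_ : Basis → Basis → Set
Γ ≈ᴮ Δ = ∃[ Θ ] (Γ ↭ Θ ×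
  Pointwise (λ p q → proj₁ p ≡ proj₁ q × proj₂ p ≈ᵗ proj₂ q) Θ Δ)

-- Γ ⊓ Δ (used only when dom Γ ≡ dom Δ)
_⊓_ : Basis → Basis → Basis
_⊓_ = zipWith (λ p q → proj₁ p , proj₂ p ++ proj₂ q)

top : List Var → Basis
top = map (λ x → x , [])

data _⊢_∶_ : Basis → Term → Strict → Set
-- Args D N α Θ : Θ = D^⊤ ⊓ Δ₁ ⊓ … ⊓ Δₙ with Δᵢ ⊢ N : τᵢ, dom Δᵢ = D,
-- α = τ₁ ∩ … ∩ τₙ
data Args (D : List Var) (N : Term) : Type → Basis → Set

data _⊢_∶_ where
  ax : ∀ {x σ} → ((x , σ ∷ []) ∷ []) ⊢ var x ∶ σ
  →I : ∀ {Γ x α M σ} → ((x , α) ∷ Γ) ⊢ M ∶ σ → x ∉ dom Γ →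
       Γ ⊢ lam x M ∶ (α ⇒ σ)
  →E : ∀ {Γ Δ₀ Θ M N α σ τ₀} → Γ ⊢ M ∶ (α ⇒ σ) → Δ₀ ⊢ N ∶ τ₀ →
       Args (dom Δ₀) N α Θ → Disjoint (dom Γ) (dom Δ₀) →
       (Γ ++ Θ) ⊢ app M N ∶ σ
  cont : ∀ {Γ x y z α β M σ} → ((x , α) ∷ (y , β) ∷ Γ) ⊢ M ∶ σ →
         x ≢ y → x ∉ dom Γ → y ∉ dom Γ → z ∉ dom Γ →
         ((z , α ++ β) ∷ Γ) ⊢ dup z x y M ∶ σ
  thin : ∀ {Γ x M σ} → Γ ⊢ M ∶ σ → x ∉ dom Γ →
         ((x , []) ∷ Γ) ⊢ era x M ∶ σ
  -- types and bases are taken modulo AC of ∩ and reordering of the map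
  conv : ∀ {Γ Γ' M σ σ'} → Γ ≈ᴮ Γ' → σ ≈ˢ σ' → Γ ⊢ M ∶ σ → Γ' ⊢ M ∶ σ'

data Args D N where
  none : Args D N [] (top D)
  more : ∀ {Δ τ α Θ} → Δ ⊢ N ∶ τ → dom Δ ≡ D → Args D N α Θ →
         Args D N (τ ∷ α) (Δ ⊓ Θ)

module Submission where

-- The proof is by induction on strong normalisation, using subject
-- expansion for head steps.  Every subterm P of an SN term M is typeable:
-- abstractions, erasures and duplications inherit a typing from their body;
-- an application P Q whose head is a variable is typed by giving the head an
-- arrow type; an application whose head is an abstraction has a head step
-- P Q → T', which is a step of M in context, so T' is typeable by induction,
-- and the typing expands back from T' to P Q.  The expansion steps are β,
-- whose expansion is the substitution lemma, ω (erasure moving out of an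
-- application), γ (duplication moving into an abstraction), γω (erasure
-- moving out of a duplication) and the γω-hit step, again by substitution.

open import Defs
open import Data.Nat using (ℕ; zero; suc; _≟_; _+_; _≤_; _<_; _⊔_; z≤n; s≤s)
open import Data.Nat.Properties using (≤-refl; ≤-reflexive; ≤-trans; ≤-pred; suc-injective; m≤m⊔n; m≤n⊔m; <-irrefl; m≤m+n; m≤n+m; +-suc; <-≤-trans; n≤1+n; +-mono-≤; +-monoˡ-≤; +-monoʳ-≤)
open import Data.List using (List; []; _∷_; _++_; map; length)
open import Data.List.Properties using (map-++; ++-identityʳ)
open import Data.List.Membership.Propositional using (_∈_; _∉_)
open import Data.List.Membership.Propositional.Properties using (∈-++⁺ˡ; ∈-++⁺ʳ; ∈-++⁻; ∈-map⁺; ∈-map⁻)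
open import Data.List.Membership.DecPropositional _≟_ using (_∈?_)
open import Data.List.Relation.Unary.Any using (here; there)
open import Data.List.Relation.Unary.All using (All; []; _∷_)
open import Data.List.Relation.Unary.AllPairs using ([]; _∷_)
open import Data.List.Relation.Unary.All.Properties using (¬Any⇒All¬)
open import Data.List.Relation.Unary.Unique.Propositional using (Unique)
open import Data.List.Relation.Binary.Disjoint.Propositional using (Disjoint)
open import Data.List.Relation.Binary.Pointwise using (Pointwise; []; _∷_) renaming (++⁺ to pw++)
open import Data.List.Relation.Binary.Permutation.Propositional using (_↭_; ↭-refl; ↭-sym; ↭-trans; ↭-reflexive; ↭-prep; ↭-swap)
open import Data.Product using (Σ; _×_; _,_; proj₁; proj₂; ∃-syntax)
open import Data.Sum using (_⊎_; inj₁; inj₂; [_,_]′)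
open import Data.Empty using (⊥; ⊥-elim)
open import Relation.Nullary using (¬_; yes; no; Dec)
open import Relation.Binary.PropositionalEquality
open import Data.List.Relation.Binary.Permutation.Propositional.Properties using (↭-empty-inv)
import Data.List.Relation.Unary.Unique.Propositional.Properties
module Perm = Data.List.Relation.Binary.Permutation.Propositional
module PP = Data.List.Relation.Binary.Permutation.Propositional.Properties
module UP = Data.List.Relation.Unary.Unique.Propositional.Properties

module NameLists where

  ─-⊆ : ∀ {y x} l → y ∈ l ─ x → y ∈ l
  ─-⊆ {y} {x} (z ∷ zs) p with z ≟ x
  ... | yes _ = there (─-⊆ zs p)
  ... | no _ with p
  ... | here eq = here eq
  ... | there q = there (─-⊆ zs q)

  ─-≢ : ∀ {y x} l → y ∈ l ─ x → y ≢ x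
  ─-≢ {y} {x} (z ∷ zs) p with z ≟ x
  ... | yes _ = ─-≢ zs p
  ... | no z≢x with p
  ... | here refl = z≢x
  ... | there q = ─-≢ zs q

  ─-⁺ : ∀ {y x} l → y ∈ l → y ≢ x → y ∈ l ─ x
  ─-⁺ {y} {x} (z ∷ zs) p y≢x with z ≟ x
  ─-⁺ {y} {x} (z ∷ zs) (here refl) y≢x | yes z≡x = ⊥-elim (y≢x z≡x)
  ─-⁺ {y} {x} (z ∷ zs) (there p) y≢x | yes z≡x = ─-⁺ zs p y≢x
  ─-⁺ {y} {x} (z ∷ zs) (here refl) y≢x | no _ = here refl
  ─-⁺ {y} {x} (z ∷ zs) (there p) y≢x | no _ = there (─-⁺ zs p y≢x)

  ─⊆⊆ : ∀ {a b} l l' → (∀ {z} → z ∈ l → z ∈ l') → ∀ {z} → z ∈ (l ─ a) ─ b → z ∈ (l' ─ a) ─ b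
  ─⊆⊆ {a} {b} l l' h q = ─-⁺ (l' ─ a) (─-⁺ l' (h (─-⊆ l (─-⊆ (l ─ a) q))) (─-≢ l (─-⊆ (l ─ a) q)))
      (─-≢ (l ─ a) q)

  x∉─x : ∀ x l → x ∉ l ─ x
  x∉─x x l p = ─-≢ l p refl

  ∉-─ : ∀ {y x} l → y ∉ l → y ∉ l ─ x
  ∉-─ l y∉ p = y∉ (─-⊆ l p)

  All-─ : ∀ {P : Var → Set} {x} l → All P l → All P (l ─ x)
  All-─ [] [] = []
  All-─ {x = x} (z ∷ zs) (pz ∷ ps) with z ≟ x
  ... | yes _ = All-─ zs ps
  ... | no _ = pz ∷ All-─ zs ps

  unique-─ : ∀ {x} l → Unique l → Unique (l ─ x)
  unique-─ [] u = u
  unique-─ {x} (z ∷ zs) (a ∷ u) with z ≟ x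
  ... | yes _ = unique-─ zs u
  ... | no _ = All-─ zs a ∷ unique-─ zs u

  ucons : ∀ {z : Var} {zs} → z ∉ zs → Unique zs → Unique (z ∷ zs)
  ucons {zs = zs} p u = ¬Any⇒All¬ zs p ∷ u

  uhead : ∀ {z : Var} {zs} → Unique (z ∷ zs) → z ∉ zs
  uhead = UP.Unique[x∷xs]⇒x∉xs

  utail : ∀ {z : Var} {zs} → Unique (z ∷ zs) → Unique zs
  utail (_ ∷ u) = u

  unique-++ˡ : ∀ (xs : List Var) {ys} → Unique (xs ++ ys) → Unique xs
  unique-++ˡ [] u = []
  unique-++ˡ (x ∷ xs) u = ucons (λ q → uhead u (∈-++⁺ˡ q)) (unique-++ˡ xs (utail u))

  unique-++ʳ : ∀ (xs : List Var) {ys} → Unique (xs ++ ys) → Unique ys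
  unique-++ʳ [] u = u
  unique-++ʳ (x ∷ xs) u = unique-++ʳ xs (utail u)

  unique-++-disjoint : ∀ (xs : List Var) {ys} → Unique (xs ++ ys) → Disjoint xs ys
  unique-++-disjoint (x ∷ xs) u (here refl , q) = uhead u (∈-++⁺ʳ xs q)
  unique-++-disjoint (x ∷ xs) u (there p , q) = unique-++-disjoint xs (utail u) (p , q)

  ─-yes : ∀ {z x} zs → z ≡ x → (z ∷ zs) ─ x ≡ zs ─ x
  ─-yes {z} {x} zs eq with z ≟ x
  ... | yes _ = refl
  ... | no ne = ⊥-elim (ne eq)

  ─-no : ∀ {z x} zs → z ≢ x → (z ∷ zs) ─ x ≡ z ∷ (zs ─ x)
  ─-no {z} {x} zs ne with z ≟ x
  ... | yes eq = ⊥-elim (ne eq)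
  ... | no _ = refl

  ─-comm : ∀ x y l → (l ─ x) ─ y ≡ (l ─ y) ─ x
  ─-comm x y [] = refl
  ─-comm x y (z ∷ zs) = cases (z ≟ x) (z ≟ y)
    where
    cases : Dec (z ≡ x) → Dec (z ≡ y) → ((z ∷ zs) ─ x) ─ y ≡ ((z ∷ zs) ─ y) ─ x
    cases (yes p) (yes q) rewrite ─-yes zs p | ─-yes zs q = ─-comm x y zs
    cases (yes p) (no q) rewrite ─-yes zs p | ─-no zs q | ─-yes (zs ─ y) p = ─-comm x y zs
    cases (no p) (yes q) rewrite ─-no zs p | ─-yes zs q | ─-yes (zs ─ x) q = ─-comm x y zs
    cases (no p) (no q) rewrite ─-no zs p | ─-no zs q | ─-no (zs ─ x) q | ─-no (zs ─ y) p =
      cong (z ∷_) (─-comm x y zs)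

  ─-notin : ∀ x l → x ∉ l → l ─ x ≡ l
  ─-notin x [] _ = refl
  ─-notin x (z ∷ zs) p with z ≟ x
  ... | yes refl = ⊥-elim (p (here refl))
  ... | no _ = cong (z ∷_) (─-notin x zs (λ q → p (there q)))

  maxOf : List ℕ → ℕ
  maxOf [] = 0
  maxOf (x ∷ xs) = x ⊔ maxOf xs

  ≤-maxOf : ∀ {x} l → x ∈ l → x ≤ maxOf l
  ≤-maxOf (y ∷ ys) (here refl) = m≤m⊔n y (maxOf ys)
  ≤-maxOf (y ∷ ys) (there p) = ≤-trans (≤-maxOf ys p) (m≤n⊔m y (maxOf ys))

  above-maxOf-∉ : ∀ {v} l → maxOf l < v → v ∉ l
  above-maxOf-∉ l lt p = <-irrefl refl (≤-trans (s≤s (≤-maxOf l p)) lt)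

  fresh : List ℕ → ℕ
  fresh l = suc (maxOf l)

  fresh-∉ : ∀ l → fresh l ∉ l
  fresh-∉ l = above-maxOf-∉ l ≤-refl

  fresh-≢ : ∀ l {v} → v ∈ l → fresh l ≢ v
  fresh-≢ l p eq = fresh-∉ l (subst (_∈ l) (sym eq) p)

  by-cases : ∀ {a p} {P : Set p} {A : Set a} → Dec P → (P → A) → (¬ P → A) → A
  by-cases (yes p) f g = f p
  by-cases (no p) f g = g p

module Renaming where
  open NameLists

  swapV-a : ∀ a b → swapV a b a ≡ b
  swapV-a a b with a ≟ a | a ≟ b
  ... | yes _ | _ = refl
  ... | no ne | _ = ⊥-elim (ne refl)

  swapV-b : ∀ a b → swapV a b b ≡ a
  swapV-b a b with b ≟ a | b ≟ b
  ... | yes eq | _ = eq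
  ... | no _ | yes _ = refl
  ... | no _ | no ne = ⊥-elim (ne refl)

  swapV-o : ∀ {a b v} → v ≢ a → v ≢ b → swapV a b v ≡ v
  swapV-o {a} {b} {v} na nb with v ≟ a | v ≟ b
  ... | yes eq | _ = ⊥-elim (na eq)
  ... | no _ | yes eq = ⊥-elim (nb eq)
  ... | no _ | no _ = refl

  swapV-inv : ∀ a b v → swapV a b (swapV a b v) ≡ v
  swapV-inv a b v with v ≟ a | v ≟ b
  ... | yes refl | _ = swapV-b a b
  ... | no _ | yes refl = swapV-a a b
  ... | no na | no nb = swapV-o na nb

  Inj : (Var → Var) → Set
  Inj f = ∀ {a b} → f a ≡ f b → a ≡ b

  swapV-inj : ∀ a b → Inj (swapV a b)
  swapV-inj a b {u} {v} eq = trans (sym (swapV-inv a b u)) (trans (cong (swapV a b) eq) (swapV-inv a b v))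

  mapV : (Var → Var) → Term → Term
  mapV f (var x) = var (f x)
  mapV f (lam x M) = lam (f x) (mapV f M)
  mapV f (app M N) = app (mapV f M) (mapV f N)
  mapV f (era x M) = era (f x) (mapV f M)
  mapV f (dup x y z M) = dup (f x) (f y) (f z) (mapV f M)

  swap≡ : ∀ a b M → swap a b M ≡ mapV (swapV a b) M
  swap≡ a b (var x) = refl
  swap≡ a b (lam x M) = cong (lam _) (swap≡ a b M)
  swap≡ a b (app M N) = cong₂ app (swap≡ a b M) (swap≡ a b N)
  swap≡ a b (era x M) = cong (era _) (swap≡ a b M)
  swap≡ a b (dup x y z M) = cong (dup _ _ _) (swap≡ a b M)

  mapV-∘ : ∀ f g M → mapV f (mapV g M) ≡ mapV (λ v → f (g v)) M
  mapV-∘ f g (var x) = refl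
  mapV-∘ f g (lam x M) = cong (lam _) (mapV-∘ f g M)
  mapV-∘ f g (app M N) = cong₂ app (mapV-∘ f g M) (mapV-∘ f g N)
  mapV-∘ f g (era x M) = cong (era _) (mapV-∘ f g M)
  mapV-∘ f g (dup x y z M) = cong (dup _ _ _) (mapV-∘ f g M)

  mapV-ext : ∀ {f g} M → (∀ v → v ∈ vars M → f v ≡ g v) → mapV f M ≡ mapV g M
  mapV-ext (var x) h = cong var (h x (here refl))
  mapV-ext (lam x M) h = cong₂ lam (h x (here refl)) (mapV-ext M (λ v p → h v (there p)))
  mapV-ext (app M N) h = cong₂ app (mapV-ext M (λ v p → h v (∈-++⁺ˡ p)))
      (mapV-ext N (λ v p → h v (∈-++⁺ʳ (vars M) p)))
  mapV-ext (era x M) h = cong₂ era (h x (here refl)) (mapV-ext M (λ v p → h v (there p)))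
  mapV-ext (dup x y z M) h
    rewrite h x (here refl) | h y (there (here refl)) | h z (there (there (here refl)))
    = cong (dup _ _ _) (mapV-ext M (λ v p → h v (there (there (there p)))))

  mapV-id : ∀ {f} M → (∀ v → v ∈ vars M → f v ≡ v) → mapV f M ≡ M
  mapV-id (var x) h = cong var (h x (here refl))
  mapV-id (lam x M) h = cong₂ lam (h x (here refl)) (mapV-id M (λ v p → h v (there p)))
  mapV-id (app M N) h = cong₂ app (mapV-id M (λ v p → h v (∈-++⁺ˡ p)))
      (mapV-id N (λ v p → h v (∈-++⁺ʳ (vars M) p)))
  mapV-id (era x M) h = cong₂ era (h x (here refl)) (mapV-id M (λ v p → h v (there p)))
  mapV-id (dup x y z M) h
    rewrite h x (here refl) | h y (there (here refl)) | h z (there (there (here refl)))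
    = cong (dup _ _ _) (mapV-id M (λ v p → h v (there (there (there p)))))

  map-─ : ∀ {f} → Inj f → ∀ l x → map f (l ─ x) ≡ map f l ─ f x
  map-─ inj [] x = refl
  map-─ {f} inj (z ∷ zs) x = cases (z ≟ x)
    where
    cases : Dec (z ≡ x) → map f ((z ∷ zs) ─ x) ≡ map f (z ∷ zs) ─ f x
    cases (yes p) rewrite ─-yes zs p | ─-yes {f z} {f x} (map f zs) (cong f p) = map-─ inj zs x
    cases (no p) rewrite ─-no zs p | ─-no {f z} {f x} (map f zs) (λ q → p (inj q)) = cong (f z ∷_)
        (map-─ inj zs x)

  fv-mapV : ∀ {f} → Inj f → ∀ M → fv (mapV f M) ≡ map f (fv M)
  fv-mapV inj (var x) = refl
  fv-mapV {f} inj (lam x M) rewrite fv-mapV inj M = sym (map-─ inj (fv M) x)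
  fv-mapV {f} inj (app M N) rewrite fv-mapV inj M | fv-mapV inj N = sym (map-++ f (fv M) (fv N))
  fv-mapV inj (era x M) = cong (_ ∷_) (fv-mapV inj M)
  fv-mapV {f} inj (dup x y z M) rewrite fv-mapV inj M | map-─ inj (fv M ─ y) z | map-─ inj (fv M) y = refl

  vars-mapV : ∀ f M → vars (mapV f M) ≡ map f (vars M)
  vars-mapV f (var x) = refl
  vars-mapV f (lam x M) = cong (_ ∷_) (vars-mapV f M)
  vars-mapV f (app M N) rewrite vars-mapV f M | vars-mapV f N = sym (map-++ f (vars M) (vars N))
  vars-mapV f (era x M) = cong (_ ∷_) (vars-mapV f M)
  vars-mapV f (dup x y z M) = cong (λ l → _ ∷ _ ∷ _ ∷ l) (vars-mapV f M)

  ∈-inj : ∀ {f} → Inj f → ∀ {x} l → f x ∈ map f l → x ∈ l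
  ∈-inj {f} inj l p with ∈-map⁻ f p
  ... | (a , a∈ , eq) rewrite inj eq = a∈

  ∉-map : ∀ {f} → Inj f → ∀ {x} l → x ∉ l → f x ∉ map f l
  ∉-map inj l x∉ p = x∉ (∈-inj inj l p)

  disj-map : ∀ {f} → Inj f → ∀ {l1 l2} → Disjoint l1 l2 → Disjoint (map f l1) (map f l2)
  disj-map {f} inj {l1} {l2} d (p , q) with ∈-map⁻ f p | ∈-map⁻ f q
  ... | (a , a∈ , refl) | (b , b∈ , eq) rewrite inj eq = d (a∈ , b∈)

  WF-mapV : ∀ {f} → Inj f → ∀ {M} → WF M → WF (mapV f M)
  WF-mapV inj var = var
  WF-mapV {f} inj {lam x M} (lam w p) = lam (WF-mapV inj w)
      (subst (f x ∈_) (sym (fv-mapV inj M)) (∈-map⁺ f p))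
  WF-mapV {f} inj {app M N} (app w1 w2 d) =
    app (WF-mapV inj w1) (WF-mapV inj w2)
        (subst₂ Disjoint (sym (fv-mapV inj M)) (sym (fv-mapV inj N)) (disj-map inj d))
  WF-mapV {f} inj {era x M} (era w p) = era (WF-mapV inj w)
      (subst (f x ∉_) (sym (fv-mapV inj M)) (∉-map inj (fv M) p))
  WF-mapV {f} inj {dup x y z M} (dup w p1 p2 ne p) =
    dup (WF-mapV inj w) (subst (f y ∈_) (sym (fv-mapV inj M)) (∈-map⁺ f p1))
        (subst (f z ∈_) (sym (fv-mapV inj M)) (∈-map⁺ f p2)) (λ eq → ne (inj eq))
        (subst (f x ∉_) (trans (map-─ inj (fv M ─ y) z)
            (cong (_─ f z) (trans (map-─ inj (fv M) y) (cong (_─ f y) (sym (fv-mapV inj M))))))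
          (∉-map inj ((fv M ─ y) ─ z) p))

  swapV-a' : ∀ {a b v} → v ≡ a → swapV a b v ≡ b
  swapV-a' {a} {b} refl = swapV-a a b

  swapV-b' : ∀ {a b v} → v ≡ b → swapV a b v ≡ a
  swapV-b' {a} {b} refl = swapV-b a b

module FunctionalTyping where
  open NameLists

  -- An auxiliary presentation of λ_® ∩ in which a basis is a total function
  -- Ctx = Var → Type (empty type ⊤ = [] outside the domain) and every rule
  -- carries an explicit side condition "G ≋ …" up to permutation of the
  -- intersections.  This makes bases easy to split and merge; derivations
  -- are translated back into the official system in ToOfficialSystem.

  Ctx : Set
  Ctx = Var → Type

  infix 4 _≋_
  _≋_ : Ctx → Ctx → Set
  G ≋ H = ∀ v → G v ↭ H v

  ≋-refl : ∀ {G} → G ≋ G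
  ≋-refl v = ↭-refl

  ≋-sym : ∀ {G H} → G ≋ H → H ≋ G
  ≋-sym p v = ↭-sym (p v)

  ≋-trans : ∀ {G H K} → G ≋ H → H ≋ K → G ≋ K
  ≋-trans p q v = ↭-trans (p v) (q v)

  ε : Ctx
  ε _ = []

  infixl 6 _⊕_
  _⊕_ : Ctx → Ctx → Ctx
  (G ⊕ H) v = G v ++ H v

  single : Var → Strict → Ctx
  single x σ v with v ≟ x
  ... | yes _ = σ ∷ []
  ... | no _ = []

  del : Var → Ctx → Ctx
  del x H v with v ≟ x
  ... | yes _ = []
  ... | no _ = H v

  upd : Var → Type → Ctx → Ctx
  upd z t H v with v ≟ z
  ... | yes _ = t
  ... | no _ = H v

  contract : Var → Var → Var → Ctx → Ctx
  contract z x y H = upd z (H x ++ H y) (del y (del x H))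

  single-yes : ∀ {x σ v} → v ≡ x → single x σ v ≡ σ ∷ []
  single-yes {x} {σ} {v} eq with v ≟ x
  ... | yes _ = refl
  ... | no ne = ⊥-elim (ne eq)

  single-no : ∀ {x σ v} → v ≢ x → single x σ v ≡ []
  single-no {x} {σ} {v} ne with v ≟ x
  ... | yes eq = ⊥-elim (ne eq)
  ... | no _ = refl

  del-yes : ∀ {x H v} → v ≡ x → del x H v ≡ []
  del-yes {x} {H} {v} eq with v ≟ x
  ... | yes _ = refl
  ... | no ne = ⊥-elim (ne eq)

  del-no : ∀ {x H v} → v ≢ x → del x H v ≡ H v
  del-no {x} {H} {v} ne with v ≟ x
  ... | yes eq = ⊥-elim (ne eq)
  ... | no _ = refl

  upd-yes : ∀ {z t H v} → v ≡ z → upd z t H v ≡ t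
  upd-yes {z} {t} {H} {v} eq with v ≟ z
  ... | yes _ = refl
  ... | no ne = ⊥-elim (ne eq)

  upd-no : ∀ {z t H v} → v ≢ z → upd z t H v ≡ H v
  upd-no {z} {t} {H} {v} ne with v ≟ z
  ... | yes eq = ⊥-elim (ne eq)
  ... | no _ = refl

  del-at : ∀ x H → del x H x ≡ []
  del-at x H = del-yes {x} {H} {x} refl

  contract-at : ∀ z x y H → contract z x y H z ≡ H x ++ H y
  contract-at z x y H = upd-yes {z} {H x ++ H y} {del y (del x H)} {z} refl

  del-≋ : ∀ {x H H'} → H ≋ H' → del x H ≋ del x H'
  del-≋ {x} e v = by-cases (v ≟ x)
    (λ v≡x → ↭-reflexive (trans (del-yes v≡x) (sym (del-yes v≡x))))
    (λ v≢x → subst₂ _↭_ (sym (del-no v≢x)) (sym (del-no v≢x)) (e v))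

  contract-≋ : ∀ {z x y H H'} → H ≋ H' → contract z x y H ≋ contract z x y H'
  contract-≋ {z} {x} {y} e v = by-cases (v ≟ z)
    (λ v≡z → subst₂ _↭_ (sym (upd-yes v≡z)) (sym (upd-yes v≡z)) (PP.++⁺ (e x) (e y)))
    (λ v≢z → subst₂ _↭_ (sym (upd-no v≢z)) (sym (upd-no v≢z)) (del-≋ (del-≋ e) v))

  del-contract : ∀ {w y y1 y2} H → y ≢ w → y1 ≢ w → y2 ≢ w →
                 ∀ v → del w (contract y y1 y2 H) v ≡ contract y y1 y2 (del w H) v
  del-contract {w} {y} {y1} {y2} H y≢w y1≢w y2≢w v = by-cases (v ≟ w) at-w
      (λ v≢w → by-cases (v ≟ y) (at-y v≢w) (elsewhere v≢w))
    where
    at-w : v ≡ w → del w (contract y y1 y2 H) v ≡ contract y y1 y2 (del w H) v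
    at-w refl = trans (del-at w _)
      (sym (trans (upd-no (λ e → y≢w (sym e)))
          (trans (del-no (λ e → y2≢w (sym e))) (trans (del-no (λ e → y1≢w (sym e))) (del-at w H)))))
    at-y : v ≢ w → v ≡ y → del w (contract y y1 y2 H) v ≡ contract y y1 y2 (del w H) v
    at-y v≢w refl = trans (del-no v≢w) (trans (contract-at y y1 y2 H)
      (sym (trans (contract-at y y1 y2 (del w H)) (cong₂ _++_ (del-no y1≢w) (del-no y2≢w)))))
    elsewhere : v ≢ w → v ≢ y → del w (contract y y1 y2 H) v ≡ contract y y1 y2 (del w H) v
    elsewhere v≢w v≢y = trans (del-no v≢w)
        (trans (upd-no v≢y) (trans (below (v ≟ y2) (v ≟ y1)) (sym (upd-no v≢y))))
      where
      below : Dec (v ≡ y2) → Dec (v ≡ y1) → del y2 (del y1 H) v ≡ del y2 (del y1 (del w H)) v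
      below (yes e) _ = trans (del-yes e) (sym (del-yes e))
      below (no n2) (yes e) = trans (del-no n2) (trans (del-yes e) (sym (trans (del-no n2) (del-yes e))))
      below (no n2) (no n1) = trans (del-no n2)
          (trans (del-no n1) (sym (trans (del-no n2) (trans (del-no n1) (del-no v≢w)))))

  -- Arg N α K collects the n derivations
  -- N : τᵢ of (→E), with K the intersection of their contexts.
  infix 3 _⊩_∶_
  data _⊩_∶_ : Ctx → Term → Strict → Set
  data Arg (N : Term) : Type → Ctx → Set

  data _⊩_∶_ where
    tv : ∀ {G x σ} → G ≋ single x σ → G ⊩ var x ∶ σ
    tl : ∀ {G H x M α σ} → H ⊩ M ∶ σ → α ↭ H x → G ≋ del x H → G ⊩ lam x M ∶ (α ⇒ σ)
    ta : ∀ {G H K D M N α σ τ} → H ⊩ M ∶ (α ⇒ σ) → Arg N α K → D ⊩ N ∶ τ → G ≋ H ⊕ K → G ⊩ app M N ∶ σ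
    te : ∀ {G H x M σ} → H ⊩ M ∶ σ → G ≋ H → G ⊩ era x M ∶ σ
    td : ∀ {G H z x y M σ} → H ⊩ M ∶ σ → G ≋ contract z x y H → G ⊩ dup z x y M ∶ σ

  data Arg N where
    an : ∀ {K} → K ≋ ε → Arg N [] K
    ac : ∀ {D τ α K K'} → D ⊩ N ∶ τ → Arg N α K → K' ≋ D ⊕ K → Arg N (τ ∷ α) K'

  ⊩-resp-≋ : ∀ {G G' M σ} → G ≋ G' → G ⊩ M ∶ σ → G' ⊩ M ∶ σ
  ⊩-resp-≋ e (tv p) = tv (≋-trans (≋-sym e) p)
  ⊩-resp-≋ e (tl d a p) = tl d a (≋-trans (≋-sym e) p)
  ⊩-resp-≋ e (ta d a d0 p) = ta d a d0 (≋-trans (≋-sym e) p)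
  ⊩-resp-≋ e (te d p) = te d (≋-trans (≋-sym e) p)
  ⊩-resp-≋ e (td d p) = td d (≋-trans (≋-sym e) p)

  Arg-resp-≋ : ∀ {N α K K'} → K ≋ K' → Arg N α K → Arg N α K'
  Arg-resp-≋ e (an p) = an (≋-trans (≋-sym e) p)
  Arg-resp-≋ e (ac d a p) = ac d a (≋-trans (≋-sym e) p)

  ⊩-support : ∀ {G M σ} → G ⊩ M ∶ σ → ∀ y → y ∉ fv M → G y ≡ []
  Arg-support : ∀ {N α K} → Arg N α K → ∀ y → y ∉ fv N → K y ≡ []
  ⊩-support {G} {var x} (tv p) y y∉ = ↭-empty-inv
      (↭-trans (p y) (↭-reflexive (single-no (λ eq → y∉ (here eq)))))
  ⊩-support {G} {lam x M} (tl {H = H} d a p) y y∉ with y ≟ x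
  ... | yes eq = ↭-empty-inv (↭-trans (p y) (↭-reflexive (del-yes eq)))
  ... | no ne = ↭-empty-inv (↭-trans (p y)
      (↭-reflexive (trans (del-no ne) (⊩-support d y (λ q → y∉ (─-⁺ (fv M) q ne))))))
  ⊩-support {G} {app M N} (ta d a d0 p) y y∉ =
    ↭-empty-inv (↭-trans (p y) (↭-reflexive
        (cong₂ _++_ (⊩-support d y (λ q → y∉ (∈-++⁺ˡ q))) (Arg-support a y (λ q → y∉ (∈-++⁺ʳ (fv M) q))))))
  ⊩-support {G} {era x M} (te d p) y y∉ = ↭-empty-inv
      (↭-trans (p y) (↭-reflexive (⊩-support d y (λ q → y∉ (there q)))))
  ⊩-support {G} {dup z x w M} (td {H = H} d p) y y∉ =
    ↭-empty-inv (↭-trans (p y) (↭-reflexive (trans (upd-no (λ eq → y∉ (here eq))) (removed (y ≟ w) (y ≟ x)))))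
    where
    removed : Dec (y ≡ w) → Dec (y ≡ x) → del w (del x H) y ≡ []
    removed (yes eq) _ = del-yes eq
    removed (no nw) (yes ex) = trans (del-no nw) (del-yes ex)
    removed (no nw) (no nx) = trans (del-no nw)
        (trans (del-no nx) (⊩-support d y (λ q → y∉ (there (─-⁺ (fv M ─ x) (─-⁺ (fv M) q nx) nw)))))
  Arg-support (an p) y y∉ = ↭-empty-inv (p y)
  Arg-support (ac d a p) y y∉ = ↭-empty-inv
      (↭-trans (p y) (↭-reflexive (cong₂ _++_ (⊩-support d y y∉) (Arg-support a y y∉))))

module TypingUnderRenaming where
  open NameLists
  open Renaming
  open FunctionalTyping

  record Bij : Set where
    field
      to : Var → Var
      from : Var → Var
      tf : ∀ v → to (from v) ≡ v
      ft : ∀ v → from (to v) ≡ v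

  module Renamed (π : Bij) where
    open Bij π

    from-≡ : ∀ {v x} → v ≡ to x → from v ≡ x
    from-≡ refl = ft _

    from-≢ : ∀ {v x} → v ≢ to x → from v ≢ x
    from-≢ ne eq = ne (trans (sym (tf _)) (cong to eq))

    single-ren : ∀ x σ v → single x σ (from v) ≡ single (to x) σ v
    single-ren x σ v = by-cases (v ≟ to x) (λ e → trans (single-yes (from-≡ e)) (sym (single-yes e)))
        (λ n → trans (single-no (from-≢ n)) (sym (single-no n)))

    del-ren : ∀ x H v → del x H (from v) ≡ del (to x) (λ u → H (from u)) v
    del-ren x H v = by-cases (v ≟ to x) (λ e → trans (del-yes (from-≡ e)) (sym (del-yes e)))
        (λ n → trans (del-no (from-≢ n)) (sym (del-no n)))

    upd-ren : ∀ z t H v → upd z t H (from v) ≡ upd (to z) t (λ u → H (from u)) v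
    upd-ren z t H v = by-cases (v ≟ to z) (λ e → trans (upd-yes (from-≡ e)) (sym (upd-yes e)))
        (λ n → trans (upd-no (from-≢ n)) (sym (upd-no n)))

    upd-cong : ∀ z t A B → (∀ u → A u ≡ B u) → ∀ v → upd z t A v ≡ upd z t B v
    upd-cong z t A B h v = by-cases (v ≟ z) (λ e → trans (upd-yes e) (sym (upd-yes e)))
        (λ n → trans (upd-no n) (trans (h v) (sym (upd-no n))))

    del-cong : ∀ z A B → (∀ u → A u ≡ B u) → ∀ v → del z A v ≡ del z B v
    del-cong z A B h v = by-cases (v ≟ z) (λ e → trans (del-yes e) (sym (del-yes e)))
        (λ n → trans (del-no n) (trans (h v) (sym (del-no n))))

    contract-ren : ∀ z x y H v → contract z x y H (from v) ≡ contract (to z) (to x) (to y) (λ u → H (from u))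
        v
    contract-ren z x y H v =
      trans (upd-ren z (H x ++ H y) (del y (del x H)) v)
        (trans (upd-cong (to z) (H x ++ H y) _ _
            (λ u → trans (del-ren y (del x H) u) (del-cong (to y) _ _ (λ u' → del-ren x H u') u)) v)
          (cong (λ t → upd (to z) t (del (to y) (del (to x) (λ u → H (from u)))) v)
              (sym (cong₂ _++_ (cong H (ft x)) (cong H (ft y))))))

    ⊩-rename : ∀ {G M σ} → G ⊩ M ∶ σ → (λ v → G (from v)) ⊩ mapV to M ∶ σ
    Arg-rename : ∀ {N α K} → Arg N α K → Arg (mapV to N) α (λ v → K (from v))
    ⊩-rename {M = var x} {σ} (tv p) = tv (λ v → ↭-trans (p (from v)) (↭-reflexive (single-ren x σ v)))
    ⊩-rename {M = lam x M} (tl {H = H} d a p) =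
      tl (⊩-rename d) (subst (_ ↭_) (sym (cong H (ft x))) a)
          (λ v → ↭-trans (p (from v)) (↭-reflexive (del-ren x H v)))
    ⊩-rename (ta d a d0 p) = ta (⊩-rename d) (Arg-rename a) (⊩-rename d0) (λ v → p (from v))
    ⊩-rename (te d p) = te (⊩-rename d) (λ v → p (from v))
    ⊩-rename {M = dup z x y M} (td {H = H} d p) = td (⊩-rename d)
        (λ v → ↭-trans (p (from v)) (↭-reflexive (contract-ren z x y H v)))
    Arg-rename (an p) = an (λ v → p (from v))
    Arg-rename (ac d a p) = ac (⊩-rename d) (Arg-rename a) (λ v → p (from v))

  swapBij : Var → Var → Bij
  swapBij a b = record { to = swapV a b ; from = swapV a b ; tf = swapV-inv a b ; ft = swapV-inv a b }

module ToOfficialSystem where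
  open NameLists
  open FunctionalTyping

  ≈ˢ-refl : ∀ σ → σ ≈ˢ σ
  ≈ᵗ-refl : ∀ α → α ≈ᵗ α
  ≈ˢ-refl (atom p) = atom
  ≈ˢ-refl (α ⇒ σ) = arr (≈ᵗ-refl α) (≈ˢ-refl σ)
  ≈ᵗ-refl [] = nil
  ≈ᵗ-refl (σ ∷ α) = cons (≈ˢ-refl σ) (≈ᵗ-refl α)

  perm→≈ : ∀ {α β} → α ↭ β → α ≈ᵗ β
  perm→≈ {α} Perm.refl = ≈ᵗ-refl α
  perm→≈ (Perm.prep x p) = cons (≈ˢ-refl x) (perm→≈ p)
  perm→≈ (Perm.swap x y p) = trn swp (cons (≈ˢ-refl y) (cons (≈ˢ-refl x) (perm→≈ p)))
  perm→≈ (Perm.trans p q) = trn (perm→≈ p) (perm→≈ q)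

  unique-fv : ∀ {M} → WF M → Unique (fv M)
  unique-fv {var x} var = ucons {x} {[]} (λ ()) ([])
  unique-fv {lam x M} (lam w _) = unique-─ (fv M) (unique-fv w)
  unique-fv (app w1 w2 d) = UP.++⁺ (unique-fv w1) (unique-fv w2) d
  unique-fv (era w p) = ucons p (unique-fv w)
  unique-fv {dup x y z M} (dup w _ _ _ p) = ucons p (unique-─ (fv M ─ y) (unique-─ (fv M) (unique-fv w)))

  basisOn : Ctx → List Var → Basis
  basisOn G l = map (λ y → y , G y) l

  dom-basisOn : ∀ G l → dom (basisOn G l) ≡ l
  dom-basisOn G [] = refl
  dom-basisOn G (x ∷ l) = cong (x ∷_) (dom-basisOn G l)

  basisOn-⊓ : ∀ A B l → basisOn A l ⊓ basisOn B l ≡ basisOn (A ⊕ B) l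
  basisOn-⊓ A B [] = refl
  basisOn-⊓ A B (x ∷ l) = cong (_ ∷_) (basisOn-⊓ A B l)

  SameEntry : (Var × Type) → (Var × Type) → Set
  SameEntry p q = proj₁ p ≡ proj₁ q × proj₂ p ≈ᵗ proj₂ q

  basisOn-pointwise : ∀ {A B} l → (∀ y → y ∈ l → A y ↭ B y) → Pointwise SameEntry (basisOn A l) (basisOn B l)
  basisOn-pointwise [] h = []
  basisOn-pointwise (x ∷ l) h = (refl , perm→≈ (h x (here refl))) ∷ basisOn-pointwise l
      (λ y p → h y (there p))

  SameEntry-refl : ∀ Γ → Pointwise SameEntry Γ Γ
  SameEntry-refl [] = []
  SameEntry-refl ((x , α) ∷ Γ) = (refl , ≈ᵗ-refl α) ∷ SameEntry-refl Γ

  basisOn-pick : ∀ H x l → Unique l → x ∈ l → basisOn H l ↭ (x , H x) ∷ basisOn H (l ─ x)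
  basisOn-pick H x (z ∷ zs) u (here refl) rewrite ─-yes {z} {z} zs refl | ─-notin z zs (uhead u) = ↭-refl
  basisOn-pick H x (z ∷ zs) u (there p) rewrite ─-no {z} {x} zs (λ eq → uhead u (subst (_∈ zs) (sym eq) p)) =
    ↭-trans (↭-prep _ (basisOn-pick H x zs (utail u) p)) (↭-swap _ _ ↭-refl)

  -- The translation, by induction on the derivation; (→I) and (Cont) need the
  -- bound names moved to the front of the basis, (→E) the merge of bases.
  ⊩⇒⊢ : ∀ {G M σ} → WF M → G ⊩ M ∶ σ → basisOn G (fv M) ⊢ M ∶ σ
  Arg⇒Args : ∀ {N α K} → WF N → Arg N α K → Σ Ctx λ K'' → (K'' ≋ K) × Args (fv N) N α (basisOn K'' (fv N))

  ⊩⇒⊢ {G} {var x} {σ} var (tv p) =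
    conv (((x , σ ∷ []) ∷ []) , ↭-refl ,
        ((refl , perm→≈ (↭-sym (↭-trans (p x) (↭-reflexive (single-yes refl))))) ∷ [])) (≈ˢ-refl σ) ax
  ⊩⇒⊢ {G} {lam x M} {.(α ⇒ σ)} (lam w x∈) (tl {H = H} {α = α} {σ = σ} d a p) =
    conv (_ , ↭-refl , SameEntry-refl _) (arr (perm→≈ (↭-sym a)) (≈ˢ-refl σ))
      (→I (conv (_ , basisOn-pick H x (fv M) (unique-fv w) x∈ ,
                 ((refl , ≈ᵗ-refl (H x)) ∷ basisOn-pointwise (fv M ─ x)
                     (λ y q → ↭-sym (↭-trans (p y) (↭-reflexive (del-no (─-≢ (fv M) q)))))))
                (≈ˢ-refl σ) (⊩⇒⊢ w d))
          (subst (x ∉_) (sym (dom-basisOn G (fv M ─ x))) (x∉─x x (fv M))))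
  ⊩⇒⊢ {G} {app M N} {σ} (app w1 w2 dj) (ta {H = H} {K = K} {D = D} d a d0 p) with Arg⇒Args w2 a
  ... | (K'' , e , args) =
    conv (_ , ↭-refl , subst (Pointwise SameEntry (basisOn H (fv M) ++ basisOn K'' (fv N)))
        (sym (map-++ _ (fv M) (fv N)))
            (pw++ (basisOn-pointwise (fv M) λ y q → ↭-sym (↭-trans (p y) (↭-reflexive
                       (trans (cong (H y ++_) (Arg-support a y (λ r → dj (q , r)))) (++-identityʳ (H y))))))
                  (basisOn-pointwise (fv N) λ y q → ↭-trans (e y) (↭-sym (↭-trans (p y) (↭-reflexive
                       (cong (_++ K y) (⊩-support d y (λ r → dj (r , q))))))))))
         (≈ˢ-refl σ)
         (→E (⊩⇒⊢ w1 d) (⊩⇒⊢ w2 d0) (subst (λ l → Args l N _ _) (sym (dom-basisOn D (fv N))) args)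
              (subst₂ Disjoint (sym (dom-basisOn H (fv M))) (sym (dom-basisOn D (fv N))) dj))
  ⊩⇒⊢ {G} {era x M} {σ} (era w x∉) (te {H = H} d p) =
    conv (_ , ↭-refl , (refl , perm→≈ (↭-sym (↭-trans (p x) (↭-reflexive (⊩-support d x x∉))))) ∷
        basisOn-pointwise (fv M) (λ y q → ↭-sym (p y)))
         (≈ˢ-refl σ) (thin (⊩⇒⊢ w d) (subst (x ∉_) (sym (dom-basisOn H (fv M))) x∉))
  ⊩⇒⊢ {G} {dup z x y M} {σ} (dup w x∈ y∈ x≢y z∉) (td {H = H} d p) =
    conv (_ , ↭-refl , (refl , perm→≈ (↭-sym (↭-trans (p z) (↭-reflexive (contract-at z x y H)))))
                       ∷ basisOn-pointwise ((fv M ─ x) ─ y) (λ v q → ↭-sym (↭-trans (p v) (↭-reflexive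
                            (trans (upd-no (λ eq → z∉ (subst (_∈ ((fv M ─ x) ─ y)) eq q)))
                              (trans (del-no (─-≢ (fv M ─ x) q))
                                  (del-no (─-≢ (fv M) (─-⊆ (fv M ─ x) q)))))))))
         (≈ˢ-refl σ)
         (cont (conv (_ , ↭-trans (basisOn-pick H x (fv M) (unique-fv w) x∈)
                          (↭-prep _ (basisOn-pick H y (fv M ─ x) (unique-─ (fv M) (unique-fv w))
                              (─-⁺ (fv M) y∈ (λ eq → x≢y (sym eq))))) ,
                      SameEntry-refl _) (≈ˢ-refl σ) (⊩⇒⊢ w d))
               x≢y
               (subst (x ∉_) (sym (dom-basisOn H ((fv M ─ x) ─ y))) (∉-─ (fv M ─ x) (x∉─x x (fv M))))
               (subst (y ∉_) (sym (dom-basisOn H ((fv M ─ x) ─ y))) (x∉─x y (fv M ─ x)))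
               (subst (z ∉_) (sym (dom-basisOn H ((fv M ─ x) ─ y))) z∉))

  Arg⇒Args w (an p) = ε , ≋-sym p , none
  Arg⇒Args {N} w (ac {D = D} {K = K} d a p) with Arg⇒Args w a
  ... | (K'' , e , args) =
    D ⊕ K'' , (λ v → ↭-sym (↭-trans (p v) (PP++ˡ (D v) (↭-sym (e v))))) ,
    subst (Args (fv N) N _) (basisOn-⊓ D K'' (fv N)) (more (⊩⇒⊢ w d) (dom-basisOn D (fv N)) args)
    where PP++ˡ = PP.++⁺ˡ

module AlphaConversion where
  open NameLists
  open Renaming
  open FunctionalTyping
  open TypingUnderRenaming

  -- From this we build freshen S T, which renames all
  -- binders of T away from S: it is structurally equivalent to T, has the same
  -- free variables, and typings of freshen S T give typings of T.  This is
  -- how Barendregt's convention is realised in the reduction steps below.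

  fv⊆vars : ∀ M {x} → x ∈ fv M → x ∈ vars M
  fv⊆vars (var x) p = p
  fv⊆vars (lam y M) p = there (fv⊆vars M (─-⊆ (fv M) p))
  fv⊆vars (app M N) p with ∈-++⁻ (fv M) p
  ... | inj₁ q = ∈-++⁺ˡ (fv⊆vars M q)
  ... | inj₂ q = ∈-++⁺ʳ (vars M) (fv⊆vars N q)
  fv⊆vars (era y M) (here eq) = here eq
  fv⊆vars (era y M) (there p) = there (fv⊆vars M p)
  fv⊆vars (dup y a b M) (here eq) = here eq
  fv⊆vars (dup y a b M) (there p) = there (there (there (fv⊆vars M (─-⊆ (fv M) (─-⊆ (fv M ─ a) p)))))

  binders : Term → List Var
  binders (var x) = []
  binders (lam x M) = x ∷ binders M
  binders (app M N) = binders M ++ binders N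
  binders (era x M) = binders M
  binders (dup x y z M) = y ∷ z ∷ binders M

  binders⊆vars : ∀ M {x} → x ∈ binders M → x ∈ vars M
  binders⊆vars (lam y M) (here eq) = here eq
  binders⊆vars (lam y M) (there p) = there (binders⊆vars M p)
  binders⊆vars (app M N) p with ∈-++⁻ (binders M) p
  ... | inj₁ q = ∈-++⁺ˡ (binders⊆vars M q)
  ... | inj₂ q = ∈-++⁺ʳ (vars M) (binders⊆vars N q)
  binders⊆vars (era y M) p = there (binders⊆vars M p)
  binders⊆vars (dup y a b M) (here eq) = there (here eq)
  binders⊆vars (dup y a b M) (there (here eq)) = there (there (here eq))
  binders⊆vars (dup y a b M) (there (there p)) = there (there (there (binders⊆vars M p)))

  binders-mapV : ∀ f M → binders (mapV f M) ≡ map f (binders M)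
  binders-mapV f (var x) = refl
  binders-mapV f (lam x M) = cong (_ ∷_) (binders-mapV f M)
  binders-mapV f (app M N) rewrite binders-mapV f M | binders-mapV f N = sym
      (map-++ f (binders M) (binders N))
  binders-mapV f (era x M) = binders-mapV f M
  binders-mapV f (dup x y z M) = cong (λ l → _ ∷ _ ∷ l) (binders-mapV f M)

  -- Reflexivity of =α, generalised over a renaming so that the induction
  -- hypothesis applies to the swapped bodies.
  αrefl' : ∀ M (f : Var → Var) → mapV f M =α mapV f M
  αrefl' (var x) f = var
  αrefl' (lam x M) f =
    lam {z = z} (fresh-∉ l) (fresh-∉ l) (subst₂ _=α_ (sym e) (sym e) (αrefl' M (λ v → swapV z (f x) (f v))))
    where
    l : List Var
    l = vars (lam (f x) (mapV f M))
    z : Var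
    z = fresh l
    e : swap z (f x) (mapV f M) ≡ mapV (λ v → swapV z (f x) (f v)) M
    e = trans (swap≡ z (f x) (mapV f M)) (mapV-∘ _ _ M)
  αrefl' (app M N) f = app (αrefl' M f) (αrefl' N f)
  αrefl' (era x M) f = era (αrefl' M f)
  αrefl' (dup x y w M) f =
    dup {z1 = z1} {z2 = z2} (λ eq → fresh-≢ (z1 ∷ l) (here refl) (sym eq)) (fresh-∉ l) (fresh-∉ l)
        (λ p → fresh-∉ (z1 ∷ l) (there p)) (λ p → fresh-∉ (z1 ∷ l) (there p))
        (subst₂ _=α_ (sym e) (sym e) (αrefl' M (λ v → swapV z1 (f y) (swapV z2 (f w) (f v)))))
    where
    l : List Var
    l = vars (dup (f x) (f y) (f w) (mapV f M))
    z1 z2 : Var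
    z1 = fresh l
    z2 = fresh (z1 ∷ l)
    e : swap z1 (f y) (swap z2 (f w) (mapV f M)) ≡ mapV (λ v → swapV z1 (f y) (swapV z2 (f w) (f v))) M
    e = trans (cong (swap z1 (f y)) (trans (swap≡ z2 (f w) (mapV f M)) (mapV-∘ _ _ M)))
          (trans (swap≡ z1 (f y) _) (mapV-∘ _ _ M))

  αrefl : ∀ M → M =α M
  αrefl M = subst₂ _=α_ (mapV-id M (λ _ _ → refl)) (mapV-id M (λ _ _ → refl)) (αrefl' M (λ v → v))

  α-lam : ∀ y y' B → y' ∉ vars B → lam y B =α lam y' (swap y' y B)
  α-lam y y' B y'∉ = lam {z = z} (λ p → fresh-∉ l (∈-++⁺ˡ p)) (λ p → fresh-∉ l (∈-++⁺ʳ (vars (lam y B)) p))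
    (subst (swap z y B =α_) (sym e) (αrefl (swap z y B)))
    where
    l : List Var
    l = vars (lam y B) ++ vars (lam y' (swap y' y B))
    z : Var
    z = fresh l
    z∉B : z ∉ vars B
    z∉B p = fresh-∉ l (∈-++⁺ˡ (there p))
    pt : ∀ v → v ∈ vars B → swapV z y' (swapV y' y v) ≡ swapV z y v
    pt v p = by-cases (v ≟ y)
      (λ ey → trans (cong (swapV z y') (swapV-b' ey)) (trans (swapV-b z y') (sym (swapV-b' ey))))
      (λ ne → trans (cong (swapV z y') (swapV-o (λ eq → y'∉ (subst (_∈ vars B) eq p)) ne))
                   (trans (swapV-o (λ eq → z∉B (subst (_∈ vars B) eq p))
                       (λ eq → y'∉ (subst (_∈ vars B) eq p)))
                     (sym (swapV-o (λ eq → z∉B (subst (_∈ vars B) eq p)) ne))))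
    e : swap z y' (swap y' y B) ≡ swap z y B
    e = trans (trans (cong (swap z y') (swap≡ y' y B)) (trans (swap≡ z y' _) (mapV-∘ _ _ B)))
          (trans (mapV-ext B pt) (sym (swap≡ z y B)))

  α-dup1 : ∀ x y w y' B → y ≢ w → y' ≢ w → y' ∉ vars B → dup x y w B =α dup x y' w (swap y' y B)
  α-dup1 x y w y' B y≢w y'≢w y'∉ =
    dup {z1 = z1} {z2 = z2} z1≢z2 (λ p → fresh-∉ l (∈-++⁺ˡ p))
        (λ p → fresh-∉ l (∈-++⁺ʳ (vars (dup x y w B)) p))
        (λ p → fresh-∉ (z1 ∷ l) (there (∈-++⁺ˡ p)))
            (λ p → fresh-∉ (z1 ∷ l) (there (∈-++⁺ʳ (vars (dup x y w B)) p)))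
        (subst (swap z1 y (swap z2 w B) =α_) (sym e) (αrefl _))
    where
    l : List Var
    l = vars (dup x y w B) ++ vars (dup x y' w (swap y' y B))
    z1 z2 : Var
    z1 = fresh l
    z2 = fresh (z1 ∷ l)
    z1≢z2 : z1 ≢ z2
    z1≢z2 eq = fresh-≢ (z1 ∷ l) (here refl) (sym eq)
    inl : ∀ {v} → v ∈ vars (dup x y w B) → v ∈ l
    inl = ∈-++⁺ˡ
    inr : ∀ {v} → v ∈ vars (dup x y' w (swap y' y B)) → v ∈ l
    inr = ∈-++⁺ʳ (vars (dup x y w B))
    z2≢y : z2 ≢ y
    z2≢y = fresh-≢ (z1 ∷ l) (there (inl (there (here refl))))
    z2≢y' : z2 ≢ y'
    z2≢y' = fresh-≢ (z1 ∷ l) (there (inr (there (here refl))))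
    pt : ∀ v → v ∈ vars B → swapV z1 y' (swapV z2 w (swapV y' y v)) ≡ swapV z1 y (swapV z2 w v)
    pt v p = by-cases (v ≟ y) c1 (λ ny → by-cases (v ≟ w) (c2 ny) (c3 ny))
      where
      y'≢z2' : y' ≢ z2
      y'≢z2' eq = z2≢y' (sym eq)
      vy' : v ≢ y'
      vy' eq = y'∉ (subst (_∈ vars B) eq p)
      vz1 : v ≢ z1
      vz1 eq = fresh-∉ l (inl (there (there (there (subst (_∈ vars B) eq p)))))
      vz2 : v ≢ z2
      vz2 eq = fresh-∉ (z1 ∷ l) (there (inl (there (there (there (subst (_∈ vars B) eq p))))))
      c1 : v ≡ y → swapV z1 y' (swapV z2 w (swapV y' y v)) ≡ swapV z1 y (swapV z2 w v)
      c1 ey = trans (cong (λ u → swapV z1 y' (swapV z2 w u)) (swapV-b' ey))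
       (trans (cong (swapV z1 y') (swapV-o y'≢z2' y'≢w)) (trans (swapV-b z1 y')
         (sym (trans (cong (swapV z1 y) (swapV-o (λ eq → z2≢y (trans (sym eq) ey))
             (λ eq → y≢w (trans (sym ey) eq)))) (swapV-b' ey)))))
      c2 : v ≢ y → v ≡ w → swapV z1 y' (swapV z2 w (swapV y' y v)) ≡ swapV z1 y (swapV z2 w v)
      c2 ny ew = trans (cong (λ u → swapV z1 y' (swapV z2 w u)) (swapV-o vy' ny))
       (trans (cong (swapV z1 y') (swapV-b' ew)) (trans (swapV-o (λ eq → z1≢z2 (sym eq)) z2≢y')
         (sym (trans (cong (swapV z1 y) (swapV-b' ew)) (swapV-o (λ eq → z1≢z2 (sym eq)) z2≢y)))))
      c3 : v ≢ y → v ≢ w → swapV z1 y' (swapV z2 w (swapV y' y v)) ≡ swapV z1 y (swapV z2 w v)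
      c3 ny nw = trans (cong (λ u → swapV z1 y' (swapV z2 w u)) (swapV-o vy' ny))
       (trans (cong (swapV z1 y') (swapV-o vz2 nw)) (trans (swapV-o vz1 vy')
         (sym (trans (cong (swapV z1 y) (swapV-o vz2 nw)) (swapV-o vz1 ny)))))
    e : swap z1 y' (swap z2 w (swap y' y B)) ≡ swap z1 y (swap z2 w B)
    e = trans (trans (cong (λ t → swap z1 y' (swap z2 w t)) (swap≡ y' y B))
                (trans (cong (swap z1 y') (trans (swap≡ z2 w _) (mapV-∘ _ _ B)))
                    (trans (swap≡ z1 y' _) (mapV-∘ _ _ B))))
          (trans (mapV-ext B pt)
            (sym (trans (cong (swap z1 y) (swap≡ z2 w B)) (trans (swap≡ z1 y _) (mapV-∘ _ _ B)))))

  mapsw-─ : ∀ {y' y} l → y' ∉ l → map (swapV y' y) l ─ y' ≡ l ─ y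
  mapsw-─ [] _ = refl
  mapsw-─ {y'} {y} (z ∷ zs) p = by-cases (z ≟ y)
    (λ e → trans (─-yes (map (swapV y' y) zs) (swapV-b' e)) (trans (mapsw-─ zs p') (sym (─-yes zs e))))
    (λ n → trans (cong (λ u → (u ∷ map (swapV y' y) zs) ─ y') (swapV-o zy' n))
             (trans (─-no (map (swapV y' y) zs) zy') (trans (cong (z ∷_) (mapsw-─ zs p')) (sym (─-no zs n)))))
    where
    p' : y' ∉ zs
    p' q = p (there q)
    zy' : z ≢ y'
    zy' eq = p (here (sym eq))

  swmap-avoid : ∀ {y' y S} l → (∀ {b} → b ∈ l → b ∉ S) → y' ∉ S → y' ∉ l → ∀ {v} → v ∈ map (swapV y' y) l
      → v ∉ S
  swmap-avoid {y'} {y} {S} l h y'S y'l {v} q with ∈-map⁻ (swapV y' y) q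
  ... | (b , b∈ , refl) = by-cases (b ≟ y)
    (λ e → subst (_∉ S) (sym (swapV-b' e)) y'S)
    (λ n → subst (_∉ S) (sym (swapV-o (λ eq → y'l (subst (_∈ l) eq b∈)) n)) (h b∈))

  y∉swap : ∀ {y' y} l → y' ∉ l → y ∉ map (swapV y' y) l
  y∉swap {y'} {y} l p = subst (_∉ map (swapV y' y) l) (swapV-a y' y) (∉-map (swapV-inj y' y) l p)

  fv-swap : ∀ a b M → fv (swap a b M) ≡ map (swapV a b) (fv M)
  fv-swap a b M = trans (cong fv (swap≡ a b M)) (fv-mapV (swapV-inj a b) M)

  binders-swap : ∀ a b M → binders (swap a b M) ≡ map (swapV a b) (binders M)
  binders-swap a b M = trans (cong binders (swap≡ a b M)) (binders-mapV (swapV a b) M)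

  WF-swap : ∀ a b {M} → WF M → WF (swap a b M)
  WF-swap a b {M} w = subst WF (sym (swap≡ a b M)) (WF-mapV (swapV-inj a b) w)

  swap-back : ∀ a b M → mapV (swapV a b) (swap a b M) ≡ M
  swap-back a b M = trans (cong (mapV (swapV a b)) (swap≡ a b M))
      (trans (mapV-∘ _ _ M) (mapV-id M (λ v _ → swapV-inv a b v)))

  ren-back : ∀ {H M σ} a b → H ⊩ swap a b M ∶ σ → (λ v → H (swapV a b v)) ⊩ M ∶ σ
  ren-back {M = M} a b d = subst (λ t → _ ⊩ t ∶ _) (swap-back a b M) (Renamed.⊩-rename (swapBij a b) d)

  lam-rename-typing : ∀ {G y y' B σ} → y' ≢ y → y' ∉ vars B → G ⊩ lam y' (swap y' y B) ∶ σ → G ⊩ lam y B ∶ σ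
  lam-rename-typing {G} {y} {y'} {B} y'≢y y'∉ (tl {H = H} d a p) =
    tl (ren-back y' y d) (subst (_ ↭_) (sym (cong H (swapV-b y' y))) a)
       (λ v → ↭-trans (p v) (↭-reflexive (eqv v)))
    where
    Hy : H y ≡ []
    Hy = ⊩-support d y (subst (y ∉_) (sym (fv-swap y' y B)) (y∉swap (fv B) (λ q → y'∉ (fv⊆vars B q))))
    eqv : ∀ v → del y' H v ≡ del y (λ u → H (swapV y' y u)) v
    eqv v = by-cases (v ≟ y)
      (λ e → trans (del-no (λ e' → y'≢y (trans (sym e') e))) (trans (cong H e) (trans Hy (sym (del-yes e)))))
      (λ n → by-cases (v ≟ y')
        (λ e' → trans (del-yes e') (sym (trans (del-no n) (trans (cong H (swapV-a' e')) Hy))))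
        (λ n' → trans (del-no n') (sym (trans (del-no n) (cong H (swapV-o n' n))))))

  ⊩-dup-comm : ∀ {G x a b M σ} → G ⊩ dup x a b M ∶ σ → G ⊩ dup x b a M ∶ σ
  ⊩-dup-comm {G} {x} {a} {b} (td {H = H} d p) = td d (λ v → ↭-trans (p v) (eqv v))
    where
    eqv : ∀ v → contract x a b H v ↭ contract x b a H v
    eqv v = by-cases (v ≟ x)
      (λ e → ↭-trans (↭-reflexive (upd-yes e))
          (↭-trans (PP.++-comm (H a) (H b)) (↭-reflexive (sym (upd-yes e)))))
      (λ n → ↭-reflexive (trans (upd-no n) (trans (dd v) (sym (upd-no n)))))
      where
      dd : ∀ v → del b (del a H) v ≡ del a (del b H) v
      dd v = by-cases (v ≟ a)
        (λ ea → by-cases (v ≟ b) (λ eb → trans (del-yes eb) (sym (del-yes ea)))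
                              (λ nb → trans (del-no nb) (trans (del-yes ea) (sym (del-yes ea)))))
        (λ na → by-cases (v ≟ b) (λ eb → trans (del-yes eb) (sym (trans (del-no na) (del-yes eb))))
                              (λ nb → trans (del-no nb) (trans (del-no na)
                                  (sym (trans (del-no na) (del-no nb))))))

  dup-rename-typing : ∀ {G x y w y' B σ} → y' ≢ y → y' ∉ vars B → w ≢ y' → w ≢ y →
               G ⊩ dup x y' w (swap y' y B) ∶ σ → G ⊩ dup x y w B ∶ σ
  dup-rename-typing {G} {x} {y} {w} {y'} {B} y'≢y y'∉ w≢y' w≢y (td {H = H} d p) =
    td (ren-back y' y d) (λ v → ↭-trans (p v) (↭-reflexive (eqv v)))
    where
    H' : Ctx
    H' u = H (swapV y' y u)
    Hy : H y ≡ []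
    Hy = ⊩-support d y (subst (y ∉_) (sym (fv-swap y' y B)) (y∉swap (fv B) (λ q → y'∉ (fv⊆vars B q))))
    eqv : ∀ v → contract x y' w H v ≡ contract x y w H' v
    eqv v = by-cases (v ≟ x)
      (λ e → trans (upd-yes e) (trans (cong₂ _++_ (cong H (sym (swapV-b y' y)))
          (cong H (sym (swapV-o w≢y' w≢y)))) (sym (upd-yes e))))
      (λ n → trans (upd-no n) (trans (inner v) (sym (upd-no n))))
      where
      inner : ∀ v → del w (del y' H) v ≡ del w (del y H') v
      inner v = by-cases (v ≟ w) (λ e → trans (del-yes e) (sym (del-yes e)))
        (λ nw → trans (del-no nw) (trans (by-cases (v ≟ y)
            (λ e → trans (del-no (λ e' → y'≢y (trans (sym e') e)))
                (trans (cong H e) (trans Hy (sym (del-yes e)))))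
            (λ n → by-cases (v ≟ y')
              (λ e' → trans (del-yes e') (sym (trans (del-no n) (trans (cong H (swapV-a' e')) Hy))))
              (λ n' → trans (del-no n') (sym (trans (del-no n) (cong H (swapV-o n' n)))))))
          (sym (del-no nw))))

  lamR : List Var → Var → Term → Term
  lamR S y B = lam (fresh (y ∷ S ++ vars B)) (swap (fresh (y ∷ S ++ vars B)) y B)

  dupY : List Var → Var → Var → Term → Var
  dupY S y w B = fresh (y ∷ w ∷ S ++ vars B)

  dupBody : List Var → Var → Var → Term → Term
  dupBody S y w B = swap (dupY S y w B) y B

  dupW : List Var → Var → Var → Term → Var
  dupW S y w B = fresh (y ∷ w ∷ dupY S y w B ∷ S ++ vars (dupBody S y w B))

  dupR : List Var → Var → Var → Var → Term → Term
  dupR S x y w B = dup x (dupY S y w B) (dupW S y w B) (swap (dupW S y w B) w (dupBody S y w B))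

  freshen : List Var → Term → Term
  freshen S (var x) = var x
  freshen S (lam y B) = lamR S y (freshen S B)
  freshen S (app M N) = app (freshen S M) (freshen S N)
  freshen S (era x B) = era x (freshen S B)
  freshen S (dup x y w B) = dupR S x y w (freshen S B)

  module LamR (S : List Var) (y : Var) (B : Term) where
    y' : Var
    y' = fresh (y ∷ S ++ vars B)
    y'≢y : y' ≢ y
    y'≢y = fresh-≢ (y ∷ S ++ vars B) (here refl)
    y'∉S : y' ∉ S
    y'∉S p = fresh-∉ (y ∷ S ++ vars B) (there (∈-++⁺ˡ p))
    y'∉B : y' ∉ vars B
    y'∉B p = fresh-∉ (y ∷ S ++ vars B) (there (∈-++⁺ʳ S p))

    ≡ₛ-lamR : lam y B ≡ₛ lamR S y B
    ≡ₛ-lamR = α≡ (α-lam y y' B y'∉B)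

    fv-lamR : fv (lamR S y B) ≡ fv B ─ y
    fv-lamR = trans (cong (_─ y') (fv-swap y' y B)) (mapsw-─ (fv B) (λ q → y'∉B (fv⊆vars B q)))

    WF-lamR : WF B → y ∈ fv B → WF (lamR S y B)
    WF-lamR w p = lam (WF-swap y' y w) (subst (y' ∈_) (sym (fv-swap y' y B))
        (subst (_∈ map (swapV y' y) (fv B)) (swapV-b y' y) (∈-map⁺ (swapV y' y) p)))

    binders-lamR : (∀ {b} → b ∈ binders B → b ∉ S) → ∀ {b} → b ∈ binders (lamR S y B) → b ∉ S
    binders-lamR h (here refl) = y'∉S
    binders-lamR h (there q) = swmap-avoid (binders B) h y'∉S (λ r → y'∉B (binders⊆vars B r))
        (subst (_ ∈_) (binders-swap y' y B) q)

    ty-lamR : ∀ {G σ} → G ⊩ lamR S y B ∶ σ → G ⊩ lam y B ∶ σ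
    ty-lamR = lam-rename-typing y'≢y y'∉B

  module DupR (S : List Var) (x y w : Var) (B : Term) where
    y' w' : Var
    y' = dupY S y w B
    w' = dupW S y w B
    B2 B3 : Term
    B2 = dupBody S y w B
    B3 = swap w' w B2
    l1 l2 : List Var
    l1 = y ∷ w ∷ S ++ vars B
    l2 = y ∷ w ∷ y' ∷ S ++ vars B2
    y'≢y : y' ≢ y
    y'≢y = fresh-≢ l1 (here refl)
    y'≢w : y' ≢ w
    y'≢w = fresh-≢ l1 (there (here refl))
    y'∉S : y' ∉ S
    y'∉S p = fresh-∉ l1 (there (there (∈-++⁺ˡ p)))
    y'∉B : y' ∉ vars B
    y'∉B p = fresh-∉ l1 (there (there (∈-++⁺ʳ S p)))
    w'≢y : w' ≢ y
    w'≢y = fresh-≢ l2 (here refl)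
    w'≢w : w' ≢ w
    w'≢w = fresh-≢ l2 (there (here refl))
    w'≢y' : w' ≢ y'
    w'≢y' = fresh-≢ l2 (there (there (here refl)))
    w'∉S : w' ∉ S
    w'∉S p = fresh-∉ l2 (there (there (there (∈-++⁺ˡ p))))
    w'∉B2 : w' ∉ vars B2
    w'∉B2 p = fresh-∉ l2 (there (there (there (∈-++⁺ʳ S p))))

    ≡ₛ-dupR : y ≢ w → dup x y w B ≡ₛ dupR S x y w B
    ≡ₛ-dupR y≢w = trans≡ (α≡ (α-dup1 x y w y' B y≢w y'≢w y'∉B))
                   (trans≡ dup-comm (trans≡ (α≡ (α-dup1 x w y' w' B2 (λ e → y'≢w (sym e)) w'≢y' w'∉B2))
                       dup-comm))

    fvB3 : (fv B3 ─ y') ─ w' ≡ (fv B ─ y) ─ w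
    fvB3 = trans (─-comm y' w' (fv B3))
            (trans (cong (_─ y') (trans (cong (_─ w') (fv-swap w' w B2))
                (mapsw-─ (fv B2) (λ q → w'∉B2 (fv⊆vars B2 q)))))
              (trans (─-comm w y' (fv B2))
                (cong (_─ w) (trans (cong (_─ y') (fv-swap y' y B))
                    (mapsw-─ (fv B) (λ q → y'∉B (fv⊆vars B q)))))))

    fv-dupR : fv (dupR S x y w B) ≡ x ∷ ((fv B ─ y) ─ w)
    fv-dupR = cong (x ∷_) fvB3

    WF-dupR : WF B → y ∈ fv B → w ∈ fv B → y ≢ w → x ∉ (fv B ─ y) ─ w → WF (dupR S x y w B)
    WF-dupR wf yin win y≢w x∉ =
      dup (WF-swap w' w (WF-swap y' y wf)) y'in w'in (λ e → w'≢y' (sym e)) (subst (x ∉_) (sym fvB3) x∉)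
      where
      y'B2 : y' ∈ fv B2
      y'B2 = subst (y' ∈_) (sym (fv-swap y' y B))
          (subst (_∈ map (swapV y' y) (fv B)) (swapV-b y' y) (∈-map⁺ (swapV y' y) yin))
      y'in : y' ∈ fv B3
      y'in = subst (y' ∈_) (sym (fv-swap w' w B2))
          (subst (_∈ map (swapV w' w) (fv B2)) (swapV-o (λ e → w'≢y' (sym e)) y'≢w)
          (∈-map⁺ (swapV w' w) y'B2))
      wB2 : w ∈ fv B2
      wB2 = subst (w ∈_) (sym (fv-swap y' y B))
          (subst (_∈ map (swapV y' y) (fv B)) (swapV-o (λ e → y'≢w (sym e)) (λ e → y≢w (sym e)))
          (∈-map⁺ (swapV y' y) win))
      w'in : w' ∈ fv B3
      w'in = subst (w' ∈_) (sym (fv-swap w' w B2))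
          (subst (_∈ map (swapV w' w) (fv B2)) (swapV-b w' w) (∈-map⁺ (swapV w' w) wB2))

    binders-dupR : (∀ {b} → b ∈ binders B → b ∉ S) → ∀ {b} → b ∈ binders (dupR S x y w B) → b ∉ S
    binders-dupR h (here refl) = y'∉S
    binders-dupR h (there (here refl)) = w'∉S
    binders-dupR h (there (there q)) =
      swmap-avoid (binders B2) h2 w'∉S (λ r → w'∉B2 (binders⊆vars B2 r))
          (subst (_ ∈_) (binders-swap w' w B2) q)
      where
      h2 : ∀ {b} → b ∈ binders B2 → b ∉ S
      h2 r = swmap-avoid (binders B) h y'∉S (λ r' → y'∉B (binders⊆vars B r'))
          (subst (_ ∈_) (binders-swap y' y B) r)

    ty-dupR : ∀ {G σ} → y ≢ w → G ⊩ dupR S x y w B ∶ σ → G ⊩ dup x y w B ∶ σ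
    ty-dupR y≢w d = dup-rename-typing y'≢y y'∉B (λ e → y'≢w (sym e)) (λ e → y≢w (sym e))
                      (⊩-dup-comm (dup-rename-typing w'≢w w'∉B2 (λ e → w'≢y' (sym e)) y'≢w (⊩-dup-comm d)))

  freshen-fv : ∀ S T → fv (freshen S T) ≡ fv T
  freshen-fv S (var x) = refl
  freshen-fv S (lam y B) = trans (LamR.fv-lamR S y (freshen S B)) (cong (_─ y) (freshen-fv S B))
  freshen-fv S (app M N) = cong₂ _++_ (freshen-fv S M) (freshen-fv S N)
  freshen-fv S (era x B) = cong (x ∷_) (freshen-fv S B)
  freshen-fv S (dup x y w B) = trans (DupR.fv-dupR S x y w (freshen S B))
      (cong (λ l → x ∷ ((l ─ y) ─ w)) (freshen-fv S B))

  freshen-bnd : ∀ S T {b} → b ∈ binders (freshen S T) → b ∉ S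
  freshen-bnd S (var x) ()
  freshen-bnd S (lam y B) = LamR.binders-lamR S y (freshen S B) (freshen-bnd S B)
  freshen-bnd S (app M N) q with ∈-++⁻ (binders (freshen S M)) q
  ... | inj₁ r = freshen-bnd S M r
  ... | inj₂ r = freshen-bnd S N r
  freshen-bnd S (era x B) q = freshen-bnd S B q
  freshen-bnd S (dup x y w B) = DupR.binders-dupR S x y w (freshen S B) (freshen-bnd S B)

  freshen-≡ₛ : ∀ S {T} → WF T → T ≡ₛ freshen S T
  freshen-≡ₛ S var = refl≡
  freshen-≡ₛ S {lam y B} (lam w _) = trans≡ (c-lam (freshen-≡ₛ S w)) (LamR.≡ₛ-lamR S y (freshen S B))
  freshen-≡ₛ S (app w1 w2 _) = trans≡ (c-appL (freshen-≡ₛ S w1)) (c-appR (freshen-≡ₛ S w2))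
  freshen-≡ₛ S (era w _) = c-era (freshen-≡ₛ S w)
  freshen-≡ₛ S {dup x y z B} (dup w _ _ ne _) = trans≡ (c-dup (freshen-≡ₛ S w))
      (DupR.≡ₛ-dupR S x y z (freshen S B) ne)

  freshen-WF : ∀ S {T} → WF T → WF (freshen S T)
  freshen-WF S var = var
  freshen-WF S {lam y B} (lam w p) = LamR.WF-lamR S y (freshen S B) (freshen-WF S w)
      (subst (y ∈_) (sym (freshen-fv S B)) p)
  freshen-WF S {app M N} (app w1 w2 d) = app (freshen-WF S w1) (freshen-WF S w2)
      (subst₂ Disjoint (sym (freshen-fv S M)) (sym (freshen-fv S N)) d)
  freshen-WF S {era x B} (era w p) = era (freshen-WF S w) (subst (x ∉_) (sym (freshen-fv S B)) p)
  freshen-WF S {dup x y z B} (dup w p1 p2 ne p) =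
    DupR.WF-dupR S x y z (freshen S B) (freshen-WF S w) (subst (y ∈_) (sym (freshen-fv S B)) p1)
        (subst (z ∈_) (sym (freshen-fv S B)) p2) ne
      (subst (λ l → x ∉ (l ─ y) ─ z) (sym (freshen-fv S B)) p)

  freshen-typing : ∀ S {T G σ} → WF T → G ⊩ freshen S T ∶ σ → G ⊩ T ∶ σ
  freshen-Arg : ∀ S {N α K} → WF N → Arg (freshen S N) α K → Arg N α K
  freshen-typing S var d = d
  freshen-typing S {lam y B} (lam w _) d with LamR.ty-lamR S y (freshen S B) d
  ... | tl d' a p = tl (freshen-typing S w d') a p
  freshen-typing S (app w1 w2 _) (ta d a d0 p) = ta (freshen-typing S w1 d) (freshen-Arg S w2 a)
      (freshen-typing S w2 d0) p
  freshen-typing S (era w _) (te d p) = te (freshen-typing S w d) p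
  freshen-typing S {dup x y z B} (dup w _ _ ne _) d with DupR.ty-dupR S x y z (freshen S B) ne d
  ... | td d' p = td (freshen-typing S w d') p
  freshen-Arg S w (an p) = an p
  freshen-Arg S w (ac d a p) = ac (freshen-typing S w d) (freshen-Arg S w a) p

module SubstitutionToolkit where
  open NameLists
  open Renaming
  open FunctionalTyping
  open TypingUnderRenaming
  open AlphaConversion

  -- cost M x bounds the depth of the computation of M[N/x]: a hit on a
  -- duplication x <^x1_x2 M costs one plus the costs of substituting x1 and
  -- x2 in M, and the measure is 0 where x is not free.
  cost : Term → Var → ℕ
  cost (var y) x = 0
  cost (lam y M) x with y ≟ x
  ... | yes _ = 0
  ... | no _ = cost M x
  cost (app M N) x = cost M x + cost N x
  cost (era y M) x with y ≟ x
  ... | yes _ = 0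
  ... | no _ = cost M x
  cost (dup y y1 y2 M) x with y ≟ x
  ... | yes _ = suc (cost M y1 + cost M y2)
  ... | no _ with x ≟ y1
  ...   | yes _ = 0
  ...   | no _ with x ≟ y2
  ...     | yes _ = 0
  ...     | no _ = cost M x

  c-lam-no : ∀ {y x} M → y ≢ x → cost (lam y M) x ≡ cost M x
  c-lam-no {y} {x} M n with y ≟ x
  ... | yes e = ⊥-elim (n e)
  ... | no _ = refl

  c-era-yes : ∀ {y x} M → y ≡ x → cost (era y M) x ≡ 0
  c-era-yes {y} {x} M e with y ≟ x
  ... | yes _ = refl
  ... | no n = ⊥-elim (n e)

  c-era-no : ∀ {y x} M → y ≢ x → cost (era y M) x ≡ cost M x
  c-era-no {y} {x} M n with y ≟ x
  ... | yes e = ⊥-elim (n e)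
  ... | no _ = refl

  c-dup-hit : ∀ {y y1 y2 x} M → y ≡ x → cost (dup y y1 y2 M) x ≡ suc (cost M y1 + cost M y2)
  c-dup-hit {y} {y1} {y2} {x} M e with y ≟ x
  ... | yes _ = refl
  ... | no n = ⊥-elim (n e)

  c-dup-b : ∀ {y y1 y2 x} M → y ≢ x → (x ≡ y1 ⊎ x ≡ y2) → cost (dup y y1 y2 M) x ≡ 0
  c-dup-b {y} {y1} {y2} {x} M n b with y ≟ x
  ... | yes e = ⊥-elim (n e)
  ... | no _ with x ≟ y1
  ...   | yes _ = refl
  ...   | no n1 with x ≟ y2
  ...     | yes _ = refl
  ...     | no n2 with b
  ...       | inj₁ e = ⊥-elim (n1 e)
  ...       | inj₂ e = ⊥-elim (n2 e)

  c-dup-o : ∀ {y y1 y2 x} M → y ≢ x → x ≢ y1 → x ≢ y2 → cost (dup y y1 y2 M) x ≡ cost M x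
  c-dup-o {y} {y1} {y2} {x} M n n1 n2 with y ≟ x
  ... | yes e = ⊥-elim (n e)
  ... | no _ with x ≟ y1
  ...   | yes e = ⊥-elim (n1 e)
  ...   | no _ with x ≟ y2
  ...     | yes e = ⊥-elim (n2 e)
  ...     | no _ = refl

  cost-0 : ∀ T z → z ∉ fv T → cost T z ≡ 0
  cost-0 (var y) z _ = refl
  cost-0 (lam y M) z p = by-cases (y ≟ z)
    (λ e → cl e)
    (λ n → trans (c-lam-no M n) (cost-0 M z (λ q → p (─-⁺ (fv M) q (λ e → n (sym e))))))
    where
    cl : y ≡ z → cost (lam y M) z ≡ 0
    cl e with y ≟ z
    ... | yes _ = refl
    ... | no n = ⊥-elim (n e)
  cost-0 (app M N) z p rewrite cost-0 M z (λ q → p (∈-++⁺ˡ q)) | cost-0 N z (λ q → p (∈-++⁺ʳ (fv M) q)) = refl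
  cost-0 (era y M) z p = trans (c-era-no M (λ e → p (here (sym e)))) (cost-0 M z (λ q → p (there q)))
  cost-0 (dup y y1 y2 M) z p = by-cases (z ≟ y1) (λ e → c-dup-b M ny (inj₁ e))
    (λ n1 → by-cases (z ≟ y2) (λ e → c-dup-b M ny (inj₂ e))
      (λ n2 → trans (c-dup-o M ny n1 n2) (cost-0 M z
          (λ q → p (there (─-⁺ (fv M ─ y1) (─-⁺ (fv M) q n1) n2))))))
    where
    ny : y ≢ z
    ny e = p (here (sym e))

  fv-eras : ∀ l M → fv (eras l M) ≡ l ++ fv M
  fv-eras [] M = refl
  fv-eras (x ∷ l) M = cong (x ∷_) (fv-eras l M)

  binders-eras : ∀ l M → binders (eras l M) ≡ binders M
  binders-eras [] M = refl
  binders-eras (x ∷ l) M = binders-eras l M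

  WF-eras : ∀ l {M} → WF M → Unique l → Disjoint l (fv M) → WF (eras l M)
  WF-eras [] w u d = w
  WF-eras (x ∷ l) {M} w u d = era (WF-eras l w (utail u) (λ (p , q) → d (there p , q)))
    (λ p → not-in (∈-++⁻ l (subst (x ∈_) (fv-eras l M) p)))
    where
    not-in : (x ∈ l) ⊎ (x ∈ fv M) → ⊥
    not-in (inj₁ q) = uhead u q
    not-in (inj₂ q) = d (here refl , q)

  eras-inv : ∀ {G σ} l M → G ⊩ eras l M ∶ σ → G ⊩ M ∶ σ
  eras-inv [] M d = d
  eras-inv (x ∷ l) M (te d p) = ⊩-resp-≋ (≋-sym p) (eras-inv l M d)

  cost-eras : ∀ l M z → z ∉ l → cost (eras l M) z ≡ cost M z
  cost-eras [] M z _ = refl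
  cost-eras (x ∷ l) M z p = trans (c-era-no (eras l M) (λ e → p (here (sym e))))
      (cost-eras l M z (λ q → p (there q)))

  Arg-++ : ∀ {N α β K1 K2} → Arg N α K1 → Arg N β K2 → Arg N (α ++ β) (K1 ⊕ K2)
  Arg-++ {K1 = K1} {K2} (an p) b = Arg-resp-≋ (λ v → ↭-reflexive (cong (_++ K2 v) (sym (↭-empty-inv (p v)))))
      b
  Arg-++ {K1 = K1} {K2} (ac {D = D} {K = K} d a p) b =
    ac d (Arg-++ a b) (λ v → ↭-trans (PP.++⁺ʳ (K2 v) (p v)) (PP.++-assoc (D v) (K v) (K2 v)))

  p-swap23 : ∀ (A B C : Type) → (A ++ B) ++ C ↭ (A ++ C) ++ B
  p-swap23 A B C = ↭-trans (PP.++-assoc A B C)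
      (↭-trans (PP.++⁺ˡ A (PP.++-comm B C)) (↭-sym (PP.++-assoc A C B)))

  p-inter : ∀ (A B C D : Type) → (A ++ B) ++ (C ++ D) ↭ (A ++ C) ++ (B ++ D)
  p-inter A B C D = ↭-trans (PP.++-assoc A B (C ++ D)) (↭-trans (PP.++⁺ˡ A (PP.shifts B C))
                      (↭-sym (PP.++-assoc A C (B ++ D))))

  swapsFn : List Var → List Var → Var → Var
  swapsFn (v ∷ vs) (w ∷ ws) u = swapsFn vs ws (swapV v w u)
  swapsFn _ _ u = u

  swapsFn⁻¹ : List Var → List Var → Var → Var
  swapsFn⁻¹ (v ∷ vs) (w ∷ ws) u = swapV v w (swapsFn⁻¹ vs ws u)
  swapsFn⁻¹ _ _ u = u

  swapsFn-inverseˡ : ∀ vs ws u → swapsFn vs ws (swapsFn⁻¹ vs ws u) ≡ u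
  swapsFn-inverseˡ [] ws u = refl
  swapsFn-inverseˡ (v ∷ vs) [] u = refl
  swapsFn-inverseˡ (v ∷ vs) (w ∷ ws) u = trans (cong (swapsFn vs ws) (swapV-inv v w _))
      (swapsFn-inverseˡ vs ws u)

  swapsFn-inverseʳ : ∀ vs ws u → swapsFn⁻¹ vs ws (swapsFn vs ws u) ≡ u
  swapsFn-inverseʳ [] ws u = refl
  swapsFn-inverseʳ (v ∷ vs) [] u = refl
  swapsFn-inverseʳ (v ∷ vs) (w ∷ ws) u = trans (cong (swapV v w) (swapsFn-inverseʳ vs ws (swapV v w u)))
      (swapV-inv v w u)

  swapsBij : List Var → List Var → Bij
  swapsBij vs ws = record { to = swapsFn⁻¹ vs ws ; from = swapsFn vs ws ; tf = swapsFn-inverseʳ vs ws ; ft =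
      swapsFn-inverseˡ vs ws }

  swapsFn-inj : ∀ vs ws → Inj (swapsFn vs ws)
  swapsFn-inj vs ws {a} {b} eq = trans (sym (swapsFn-inverseʳ vs ws a))
      (trans (cong (swapsFn⁻¹ vs ws) eq) (swapsFn-inverseʳ vs ws b))

  swaps≡mapV : ∀ vs ws N → swaps vs ws N ≡ mapV (swapsFn vs ws) N
  swaps≡mapV [] ws N = sym (mapV-id N (λ _ _ → refl))
  swaps≡mapV (v ∷ vs) [] N = sym (mapV-id N (λ _ _ → refl))
  swaps≡mapV (v ∷ vs) (w ∷ ws) N = trans (swaps≡mapV vs ws (swap v w N))
      (trans (cong (mapV (swapsFn vs ws)) (swap≡ v w N)) (mapV-∘ _ _ N))

  swapsFn-fix : ∀ vs ws u → u ∉ vs → u ∉ ws → swapsFn vs ws u ≡ u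
  swapsFn-fix [] ws u _ _ = refl
  swapsFn-fix (v ∷ vs) [] u _ _ = refl
  swapsFn-fix (v ∷ vs) (w ∷ ws) u p q =
    trans (cong (swapsFn vs ws) (swapV-o (λ e → p (here e)) (λ e → q (here e))))
        (swapsFn-fix vs ws u (λ r → p (there r)) (λ r → q (there r)))

  swapsFn-range : ∀ vs ws → length ws ≡ length vs → Unique vs → Unique ws → Disjoint vs ws → ∀ {u} → u ∈ vs
      → swapsFn vs ws u ∈ ws
  swapsFn-range (v ∷ vs) (w ∷ ws) len uv uw dj (here refl) =
    subst (_∈ w ∷ ws) (sym (trans (cong (swapsFn vs ws) (swapV-a v w))
        (swapsFn-fix vs ws w (λ r → dj (there r , here refl)) (uhead uw)))) (here refl)
  swapsFn-range (v ∷ vs) (w ∷ ws) len uv uw dj {u} (there p) =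
    subst (_∈ w ∷ ws) (sym (cong (swapsFn vs ws)
        (swapV-o (λ e → uhead uv (subst (_∈ vs) e p)) (λ e → dj (there p , here e)))))
      (there (swapsFn-range vs ws (suc-injective len) (utail uv) (utail uw)
          (λ (a , b) → dj (there a , there b)) p))

  contractAll : List Var → List Var → List Var → Ctx → Ctx
  contractAll (v ∷ vs) (a ∷ as) (b ∷ bs) H = contract v a b (contractAll vs as bs H)
  contractAll _ _ _ H = H

  dups-inv : ∀ {G σ} vs as bs T → G ⊩ dups vs as bs T ∶ σ → Σ Ctx λ H
      → (H ⊩ T ∶ σ) × (G ≋ contractAll vs as bs H)
  dups-inv [] as bs T d = _ , d , ≋-refl
  dups-inv (v ∷ vs) [] bs T d = _ , d , ≋-refl
  dups-inv (v ∷ vs) (a ∷ as) [] T d = _ , d , ≋-refl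
  dups-inv (v ∷ vs) (a ∷ as) (b ∷ bs) T (td d p) with dups-inv vs as bs T d
  ... | (H , dT , e) = H , dT , ≋-trans p (contract-≋ e)

  record DupNames (vs : List Var) (f g : Var → Var) : Set where
    field
      uq : Unique vs
      fi : Inj f
      gi : Inj g
      fo : ∀ {a} → a ∈ vs → f a ∉ vs
      go : ∀ {a} → a ∈ vs → g a ∉ vs
      fg : ∀ {a b} → a ∈ vs → b ∈ vs → f a ≢ g b

  DupNames-tail : ∀ {u us f g} → DupNames (u ∷ us) f g → DupNames us f g
  DupNames-tail h = record { uq = utail (DupNames.uq h) ; fi = DupNames.fi h ; gi = DupNames.gi h
    ; fo = λ p q → DupNames.fo h (there p) (there q) ; go = λ p q → DupNames.go h (there p) (there q)
    ; fg = λ p q → DupNames.fg h (there p) (there q) }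

  dupsBy : List Var → (Var → Var) → (Var → Var) → Term → Term
  dupsBy vs f g T = dups vs (map f vs) (map g vs) T

  dups-fv⁻ : ∀ vs f g T {z} → z ∈ fv (dupsBy vs f g T) → z ∈ vs ⊎ (z ∈ fv T × z ∉ map f vs × z ∉ map g vs)
  dups-fv⁻ [] f g T p = inj₂ (p , (λ ()) , (λ ()))
  dups-fv⁻ (u ∷ us) f g T (here e) = inj₁ (here e)
  dups-fv⁻ (u ∷ us) f g T {z} (there q) with dups-fv⁻ us f g T (─-⊆ (fv (dupsBy us f g T)) (─-⊆ _ q))
  ... | inj₁ r = inj₁ (there r)
  ... | inj₂ (a , b , c) = inj₂ (a , nf , ng)
    where
    nf : z ∉ map f (u ∷ us)
    nf (here e) = ─-≢ (fv (dupsBy us f g T)) (─-⊆ _ q) e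
    nf (there r) = b r
    ng : z ∉ map g (u ∷ us)
    ng (here e) = ─-≢ (fv (dupsBy us f g T) ─ f u) q e
    ng (there r) = c r

  dups-fv⁺T : ∀ vs f g T {z} → z ∈ fv T → z ∉ map f vs → z ∉ map g vs → z ∈ fv (dupsBy vs f g T)
  dups-fv⁺T [] f g T p _ _ = p
  dups-fv⁺T (u ∷ us) f g T p nf ng =
    there (─-⁺ _ (─-⁺ _ (dups-fv⁺T us f g T p (λ r → nf (there r)) (λ r → ng (there r))) (λ e → nf (here e)))
        (λ e → ng (here e)))

  dups-fv⁺V : ∀ vs f g T → DupNames vs f g → ∀ {z} → z ∈ vs → z ∈ fv (dupsBy vs f g T)
  dups-fv⁺V (u ∷ us) f g T h (here e) = here e
  dups-fv⁺V (u ∷ us) f g T h {z} (there p) =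
    there (─-⁺ _ (─-⁺ _ (dups-fv⁺V us f g T (DupNames-tail h) p)
        (λ e → DupNames.fo h (here refl) (subst (_∈ u ∷ us) e (there p))))
      (λ e → DupNames.go h (here refl) (subst (_∈ u ∷ us) e (there p))))

  fu∉mapg : ∀ {u us f g} → DupNames (u ∷ us) f g → f u ∉ map g us
  fu∉mapg {u} {us} {f} {g} h q with ∈-map⁻ g q
  ... | (b , b∈ , e) = DupNames.fg h (here refl) (there b∈) e

  gu∉mapf : ∀ {u us f g} → DupNames (u ∷ us) f g → g u ∉ map f us
  gu∉mapf {u} {us} {f} {g} h q with ∈-map⁻ f q
  ... | (b , b∈ , e) = DupNames.fg h (there b∈) (here refl) (sym e)

  fu∉mapf : ∀ {u us f g} → DupNames (u ∷ us) f g → f u ∉ map f us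
  fu∉mapf {u} {us} {f} h q = uhead (DupNames.uq h) (∈-inj (DupNames.fi h) us q)

  gu∉mapg : ∀ {u us f g} → DupNames (u ∷ us) f g → g u ∉ map g us
  gu∉mapg {u} {us} {g = g} h q = uhead (DupNames.uq h) (∈-inj (DupNames.gi h) us q)

  WF-dups : ∀ vs f g {T} → DupNames vs f g → WF T → Disjoint vs (fv T) → (∀ {a} → a ∈ vs → f a ∈ fv T)
      → (∀ {a} → a ∈ vs → g a ∈ fv T) →
            WF (dupsBy vs f g T)
  WF-dups [] f g h w dj hf hg = w
  WF-dups (u ∷ us) f g {T} h w dj hf hg =
    dup (WF-dups us f g (DupNames-tail h) w (λ (a , b) → dj (there a , b)) (λ p → hf (there p))
        (λ p → hg (there p)))
        (dups-fv⁺T us f g T (hf (here refl)) (fu∉mapf h) (fu∉mapg h))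
        (dups-fv⁺T us f g T (hg (here refl)) (gu∉mapf h) (gu∉mapg h))
        (DupNames.fg h (here refl) (here refl))
        (λ q → lem (dups-fv⁻ us f g T (─-⊆ _ (─-⊆ _ q))))
    where
    lem : u ∈ us ⊎ (u ∈ fv T × u ∉ map f us × u ∉ map g us) → ⊥
    lem (inj₁ r) = uhead (DupNames.uq h) r
    lem (inj₂ (a , _)) = dj (here refl , a)

  cost-dups : ∀ vs f g T z → z ∉ vs → cost (dupsBy vs f g T) z ≤ cost T z
  cost-dups [] f g T z _ = ≤-refl
  cost-dups (u ∷ us) f g T z p = by-cases (z ≟ f u)
    (λ e → subst (_≤ cost T z) (sym (c-dup-b (dupsBy us f g T) nu (inj₁ e))) z≤n)
    (λ n1 → by-cases (z ≟ g u) (λ e → subst (_≤ cost T z) (sym (c-dup-b (dupsBy us f g T) nu (inj₂ e))) z≤n)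
      (λ n2 → subst (_≤ cost T z) (sym (c-dup-o (dupsBy us f g T) nu n1 n2))
          (cost-dups us f g T z (λ r → p (there r)))))
    where
    nu : u ≢ z
    nu e = p (here (sym e))

  binders-dups : ∀ vs f g T {b} → b ∈ binders (dupsBy vs f g T) → b ∈ map f vs ⊎ b ∈ map g vs ⊎ b ∈ binders T
  binders-dups [] f g T p = inj₂ (inj₂ p)
  binders-dups (u ∷ us) f g T (here e) = inj₁ (here e)
  binders-dups (u ∷ us) f g T (there (here e)) = inj₂ (inj₁ (here e))
  binders-dups (u ∷ us) f g T (there (there p)) with binders-dups us f g T p
  ... | inj₁ q = inj₁ (there q)
  ... | inj₂ (inj₁ q) = inj₂ (inj₁ (there q))
  ... | inj₂ (inj₂ q) = inj₂ (inj₂ q)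

  contractAll-other : ∀ vs f g H v → v ∉ vs → v ∉ map f vs → v ∉ map g vs
      → contractAll vs (map f vs) (map g vs) H v ≡ H v
  contractAll-other [] f g H v _ _ _ = refl
  contractAll-other (u ∷ us) f g H v p q r =
    trans (upd-no (λ e → p (here e))) (trans (del-no (λ e → r (here e))) (trans (del-no (λ e → q (here e)))
      (contractAll-other us f g H v (λ s → p (there s)) (λ s → q (there s)) (λ s → r (there s)))))

  contractAll-shared : ∀ vs f g H → DupNames vs f g → ∀ {v} → v ∈ vs
      → contractAll vs (map f vs) (map g vs) H v ≡ H (f v) ++ H (g v)
  contractAll-shared (u ∷ us) f g H h (here refl) =
    trans (contract-at u _ _ _) (cong₂ _++_
        (contractAll-other us f g H (f u) (λ s → DupNames.fo h (here refl) (there s)) (fu∉mapf h) (fu∉mapg h))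
                                     (contractAll-other us f g H (g u)
                                         (λ s → DupNames.go h (here refl) (there s)) (gu∉mapf h) (gu∉mapg h)))
  contractAll-shared (u ∷ us) f g H h {v} (there p) =
    trans (upd-no (λ e → uhead (DupNames.uq h) (subst (_∈ us) e p)))
      (trans (del-no (λ e → DupNames.go h (here refl) (subst (_∈ u ∷ us) e (there p))))
        (trans (del-no (λ e → DupNames.fo h (here refl) (subst (_∈ u ∷ us) e (there p))))
          (contractAll-shared us f g H (DupNames-tail h) p)))

  contractAll-copy : ∀ vs f g H → DupNames vs f g → ∀ {v} → v ∉ vs → (v ∈ map f vs ⊎ v ∈ map g vs)
      → contractAll vs (map f vs) (map g vs) H v ≡ []
  contractAll-copy [] f g H h p (inj₁ ())
  contractAll-copy [] f g H h p (inj₂ ())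
  contractAll-copy (u ∷ us) f g H h {v} p q =
    trans (upd-no (λ e → p (here e))) (by-cases (v ≟ g u) (λ e → del-yes e)
      (λ ng → trans (del-no ng) (by-cases (v ≟ f u) (λ e → del-yes e)
        (λ nf → trans (del-no nf) (contractAll-copy us f g H (DupNames-tail h) (λ s → p (there s))
            (q' nf ng q))))))
    where
    q' : v ≢ f u → v ≢ g u → (v ∈ map f (u ∷ us) ⊎ v ∈ map g (u ∷ us)) → (v ∈ map f us ⊎ v ∈ map g us)
    q' nf ng (inj₁ (here e)) = ⊥-elim (nf e)
    q' nf ng (inj₁ (there s)) = inj₁ s
    q' nf ng (inj₂ (here e)) = ⊥-elim (ng e)
    q' nf ng (inj₂ (there s)) = inj₂ s

  -- The cost of a copy is zero: it is bound by the duplication list.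
  cost-dups-0 : ∀ vs f g T z → z ∉ vs → (z ∈ map f vs ⊎ z ∈ map g vs) → cost (dupsBy vs f g T) z ≡ 0
  cost-dups-0 [] f g T z _ (inj₁ ())
  cost-dups-0 [] f g T z _ (inj₂ ())
  cost-dups-0 (u ∷ us) f g T z p q = by-cases (z ≟ f u) (λ e → c-dup-b (dupsBy us f g T) nu (inj₁ e))
    (λ n1 → by-cases (z ≟ g u) (λ e → c-dup-b (dupsBy us f g T) nu (inj₂ e))
      (λ n2 → trans (c-dup-o (dupsBy us f g T) nu n1 n2)
          (cost-dups-0 us f g T z (λ r → p (there r)) (q' n1 n2 q))))
    where
    nu : u ≢ z
    nu e = p (here (sym e))
    q' : z ≢ f u → z ≢ g u → (z ∈ map f (u ∷ us) ⊎ z ∈ map g (u ∷ us)) → (z ∈ map f us ⊎ z ∈ map g us)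
    q' n1 n2 (inj₁ (here e)) = ⊥-elim (n1 e)
    q' n1 n2 (inj₁ (there r)) = inj₁ r
    q' n1 n2 (inj₂ (here e)) = ⊥-elim (n2 e)
    q' n1 n2 (inj₂ (there r)) = inj₂ r

module SubstitutionLemma where
  open NameLists
  open Renaming
  open FunctionalTyping
  open TypingUnderRenaming
  open AlphaConversion
  open ToOfficialSystem using (unique-fv)
  open SubstitutionToolkit

  Expands : Term → Term → Var → Term → Set
  Expands M N x R = ∀ {G σ} → G ⊩ R ∶ σ → Σ Ctx λ H → Σ Type λ α → Σ Ctx λ K →
     (H ⊩ M ∶ σ) × (α ↭ H x) × Arg N α K × (G ≋ del x H ⊕ K)

  record SubstSpec (M N : Term) (x : Var) (R : Term) : Set where
    field
      wf : WF R
      fv⁻ : ∀ {z} → z ∈ fv R → (z ∈ fv M × z ≢ x) ⊎ z ∈ fv N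
      fvM : ∀ {z} → z ∈ fv M → z ≢ x → z ∈ fv R
      fvN : ∀ {z} → z ∈ fv N → z ∈ fv R
      cst : ∀ z → z ≢ x → z ∉ fv N → cost R z ≤ cost M z
      exp : Expands M N x R

  Avoids : Term → Term → Var → Set
  Avoids M N x = ∀ {z} → z ∈ fv M → z ≢ x → z ∉ fv N

  del-⊕ : ∀ x A B v → del x (A ⊕ B) v ≡ del x A v ++ del x B v
  del-⊕ x A B v = by-cases (v ≟ x) (λ e → trans (del-yes e) (sym (cong₂ _++_ (del-yes e) (del-yes e))))
    (λ n → trans (del-no n) (sym (cong₂ _++_ (del-no n) (del-no n))))

  del-ε : ∀ x v → del x ε v ≡ []
  del-ε x v = by-cases (v ≟ x) del-yes del-no

  del-del : ∀ x y H v → v ≢ y → del x (del y H) v ≡ del x H v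
  del-del x y H v ny = by-cases (v ≟ x) (λ e → trans (del-yes e) (sym (del-yes e)))
    (λ n → trans (del-no n) (trans (del-no ny) (sym (del-no n))))

  contract-del-⊕ : ∀ {x y y1 y2 H K} → y ≢ x → y1 ≢ x → y2 ≢ x → K y ≡ [] → K y1 ≡ [] → K y2 ≡ [] →
                   ∀ v → contract y y1 y2 (del x H ⊕ K) v ≡ (del x (contract y y1 y2 H) ⊕ K) v
  contract-del-⊕ {x} {y} {y1} {y2} {H} {K} y≢x y1≢x y2≢x Ky Ky1 Ky2 v = by-cases (v ≟ y) shared
      (λ v≢y → unshared v≢y (v ≟ y2) (v ≟ y1))
    where
    open ≡-Reasoning
    shared : v ≡ y → contract y y1 y2 (del x H ⊕ K) v ≡ (del x (contract y y1 y2 H) ⊕ K) v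
    shared refl = begin
      contract y y1 y2 (del x H ⊕ K) y             ≡⟨ contract-at y y1 y2 (del x H ⊕ K) ⟩
      (del x H y1 ++ K y1) ++ (del x H y2 ++ K y2) ≡⟨ cong₂ _++_ (cong₂ _++_ (del-no y1≢x) Ky1)
          (cong₂ _++_ (del-no y2≢x) Ky2) ⟩
      (H y1 ++ []) ++ (H y2 ++ [])                 ≡⟨ cong₂ _++_ (++-identityʳ (H y1)) (++-identityʳ (H y2)) ⟩
      H y1 ++ H y2                                 ≡⟨ sym (trans (del-no y≢x) (contract-at y y1 y2 H)) ⟩
      del x (contract y y1 y2 H) y                 ≡⟨ sym (++-identityʳ _) ⟩
      del x (contract y y1 y2 H) y ++ []           ≡⟨ cong (del x (contract y y1 y2 H) y ++_) (sym Ky) ⟩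
      del x (contract y y1 y2 H) y ++ K y          ∎
    unshared : v ≢ y → Dec (v ≡ y2) → Dec (v ≡ y1)
        → contract y y1 y2 (del x H ⊕ K) v ≡ (del x (contract y y1 y2 H) ⊕ K) v
    unshared v≢y (yes refl) _ =
      trans (trans (upd-no v≢y) (del-at y2 _))
          (sym (cong₂ _++_ (trans (del-no y2≢x) (trans (upd-no v≢y) (del-at y2 _))) Ky2))
    unshared v≢y (no v≢y2) (yes refl) =
      trans (trans (upd-no v≢y) (trans (del-no v≢y2) (del-at y1 _)))
        (sym (cong₂ _++_ (trans (del-no y1≢x) (trans (upd-no v≢y) (trans (del-no v≢y2) (del-at y1 _)))) Ky1))
    unshared v≢y (no v≢y2) (no v≢y1) = begin
      contract y y1 y2 (del x H ⊕ K) v    ≡⟨ trans (upd-no v≢y) (trans (del-no v≢y2) (del-no v≢y1)) ⟩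
      del x H v ++ K v                    ≡⟨ cong (_++ K v) (del-cong (v ≟ x)) ⟩
      del x (contract y y1 y2 H) v ++ K v ∎
      where
      del-cong : Dec (v ≡ x) → del x H v ≡ del x (contract y y1 y2 H) v
      del-cong (yes v≡x) = trans (del-yes v≡x) (sym (del-yes v≡x))
      del-cong (no v≢x) = trans (del-no v≢x)
          (sym (trans (del-no v≢x) (trans (upd-no v≢y) (trans (del-no v≢y2) (del-no v≢y1)))))

  Arg-expands : ∀ {P N x R β KR} → Expands P N x R → Arg R β KR →
           Σ Ctx λ KP → Σ Type λ α → Σ Ctx λ K → Arg P β KP × (α ↭ KP x) × Arg N α K × (KR ≋ del x KP ⊕ K)
  Arg-expands {x = x} ex (an p) = ε , [] , ε , an ≋-refl , ↭-refl , an ≋-refl ,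
    (λ v → ↭-trans (p v) (↭-reflexive (sym (cong (_++ []) (del-ε x v)))))
  Arg-expands {x = x} ex (ac {D = D} {K = Kr} d a p) with ex d | Arg-expands ex a
  ... | (H , α1 , K1 , dP , ax1 , ar1 , e1) | (KP' , α' , K' , aP' , ax' , ar' , e') =
    H ⊕ KP' , α1 ++ α' , K1 ⊕ K' , ac dP aP' ≋-refl , PP.++⁺ ax1 ax' , Arg-++ ar1 ar' ,
    (λ v → ↭-trans (p v) (↭-trans (PP.++⁺ (e1 v) (e' v))
             (↭-trans (p-inter (del x H v) (K1 v) (del x KP' v) (K' v))
                 (↭-reflexive (cong (_++ _) (sym (del-⊕ x H KP' v)))))))

  -- x⟨N/x⟩ = N: x gets the type of N itself.
  spec-var : ∀ {N x} → WF N → SubstSpec (var x) N x N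
  spec-var {N} {x} wN = record
    { wf = wN ; fv⁻ = inj₂ ; fvM = λ { (here refl) n → ⊥-elim (n refl) } ; fvN = λ q → q
    ; cst = λ z n z∉ → subst (_≤ 0) (sym (cost-0 N z z∉)) z≤n
    ; exp = λ {G} {σ} d → single x σ , σ ∷ [] , G , tv ≋-refl , ↭-reflexive (sym (single-yes refl)) ,
              ac d (an ≋-refl) (λ v → ↭-sym (PP.++-identityʳ (G v))) ,
              (λ v → ↭-reflexive (sym (cong (_++ G v) (dsg σ v)))) }
    where
    dsg : ∀ σ v → del x (single x σ) v ≡ []
    dsg σ v = by-cases (v ≟ x) del-yes (λ n → trans (del-no n) (single-no n))

  c-lam-yes : ∀ {y x} M → y ≡ x → cost (lam y M) x ≡ 0
  c-lam-yes {y} {x} M e with y ≟ x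
  ... | yes _ = refl
  ... | no n = ⊥-elim (n e)

  spec-lam : ∀ {y M N x R} → y ≢ x → y ∉ fv N → y ∈ fv M → SubstSpec M N x R
      → SubstSpec (lam y M) N x (lam y R)
  spec-lam {y} {M} {N} {x} {R} y≢x y∉N y∈ ih = record
    { wf = lam (SubstSpec.wf ih) (SubstSpec.fvM ih y∈ y≢x)
    ; fv⁻ = λ q → f⁻ q (SubstSpec.fv⁻ ih (─-⊆ (fv R) q))
    ; fvM = λ q n → ─-⁺ (fv R) (SubstSpec.fvM ih (─-⊆ (fv M) q) n) (─-≢ (fv M) q)
    ; fvN = λ q → ─-⁺ (fv R) (SubstSpec.fvN ih q) (λ e → y∉N (subst (_∈ fv N) e q))
    ; cst = λ z n z∉ → by-cases (y ≟ z) (λ e → subst (_≤ cost (lam y M) z) (sym (c-lam-yes R e)) z≤n)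
              (λ ne → subst₂ _≤_ (sym (c-lam-no R ne)) (sym (c-lam-no M ne)) (SubstSpec.cst ih z n z∉))
    ; exp = ex }
    where
    f⁻ : ∀ {z} → z ∈ fv R ─ y → (z ∈ fv M × z ≢ x) ⊎ z ∈ fv N → (z ∈ fv M ─ y × z ≢ x) ⊎ z ∈ fv N
    f⁻ q (inj₁ (a , b)) = inj₁ (─-⁺ (fv M) a (─-≢ (fv R) q) , b)
    f⁻ q (inj₂ c) = inj₂ c
    x≢y : x ≢ y
    x≢y e = y≢x (sym e)
    ex : Expands (lam y M) N x (lam y R)
    ex {G} (tl {H = HR} {α = α₀} d a p) with SubstSpec.exp ih d
    ... | (H , α , K , dM , hx , ar , e) =
      del y H , α , K , tl dM a' ≋-refl , ↭-trans hx (↭-reflexive (sym (del-no x≢y))) , ar , ctx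
      where
      Ky : K y ≡ []
      Ky = Arg-support ar y y∉N
      a' : α₀ ↭ H y
      a' = ↭-trans a (↭-trans (e y) (↭-reflexive (trans (cong₂ _++_ (del-no y≢x) Ky) (++-identityʳ (H y)))))
      ctx : G ≋ del x (del y H) ⊕ K
      ctx v = by-cases (v ≟ y)
        (λ ey → ↭-trans (p v) (↭-reflexive (trans (del-yes ey)
                  (sym (cong₂ _++_ (trans (del-no (λ e' → y≢x (trans (sym ey) e'))) (del-yes ey))
                      (trans (cong K ey) Ky))))))
        (λ ny → ↭-trans (p v) (↭-trans (↭-reflexive (del-no ny))
            (↭-trans (e v) (↭-reflexive (cong (_++ K v) (sym (del-del x y H v ny)))))))

  spec-appL : ∀ {M P N x R} → WF P → Disjoint (fv M) (fv P) → x ∈ fv M → Avoids (app M P) N x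
      → SubstSpec M N x R → SubstSpec (app M P) N x (app R P)
  spec-appL {M} {P} {N} {x} {R} wP dj x∈M dis ih = record
    { wf = app (SubstSpec.wf ih) wP dj'
    ; fv⁻ = f⁻
    ; fvM = λ q n → fM (∈-++⁻ (fv M) q) n
    ; fvN = λ q → ∈-++⁺ˡ (SubstSpec.fvN ih q)
    ; cst = λ z n z∉ → +-monoˡ-≤ (cost P z) (SubstSpec.cst ih z n z∉)
    ; exp = ex }
    where
    x∉P : x ∉ fv P
    x∉P q = dj (x∈M , q)
    dj' : Disjoint (fv R) (fv P)
    dj' {z} (a , b) with SubstSpec.fv⁻ ih a
    ... | inj₁ (c , _) = dj (c , b)
    ... | inj₂ c = dis (∈-++⁺ʳ (fv M) b) (λ e → x∉P (subst (_∈ fv P) e b)) c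
    f⁻ : ∀ {z} → z ∈ fv R ++ fv P → (z ∈ fv M ++ fv P × z ≢ x) ⊎ z ∈ fv N
    f⁻ q with ∈-++⁻ (fv R) q
    ... | inj₂ r = inj₁ (∈-++⁺ʳ (fv M) r , λ e → x∉P (subst (_∈ fv P) e r))
    ... | inj₁ r with SubstSpec.fv⁻ ih r
    ...   | inj₁ (a , b) = inj₁ (∈-++⁺ˡ a , b)
    ...   | inj₂ c = inj₂ c
    fM : ∀ {z} → (z ∈ fv M) ⊎ (z ∈ fv P) → z ≢ x → z ∈ fv R ++ fv P
    fM (inj₁ r) n = ∈-++⁺ˡ (SubstSpec.fvM ih r n)
    fM (inj₂ r) n = ∈-++⁺ʳ (fv R) r
    ex : Expands (app M P) N x (app R P)
    ex {G} (ta {H = HR} {K = KP} d a d0 p) with SubstSpec.exp ih d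
    ... | (H , α , K , dM , hx , ar , e) =
      H ⊕ KP , α , K , ta dM a d0 ≋-refl ,
      ↭-trans hx (↭-reflexive (sym (trans (cong (H x ++_) KPx) (++-identityʳ (H x))))) , ar , ctx
      where
      KPx : KP x ≡ []
      KPx = Arg-support a x x∉P
      ctx : G ≋ del x (H ⊕ KP) ⊕ K
      ctx v = ↭-trans (p v) (↭-trans (PP.++⁺ʳ (KP v) (e v)) (↭-trans (p-swap23 (del x H v) (K v) (KP v))
                (↭-reflexive (cong (_++ K v) (sym (by-cases (v ≟ x)
                    (λ ex' → trans (del-yes ex') (sym (trans (cong₂ _++_ (del-yes ex') (cong KP ex')) KPx)))
                    (λ n → trans (del-no n) (cong (_++ KP v) (sym (del-no n))))))))))

  spec-appR : ∀ {M P N x R} → WF M → Disjoint (fv M) (fv P) → x ∈ fv P → Avoids (app M P) N x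
      → SubstSpec P N x R → SubstSpec (app M P) N x (app M R)
  spec-appR {M} {P} {N} {x} {R} wM dj x∈P dis ih = record
    { wf = app wM (SubstSpec.wf ih) dj'
    ; fv⁻ = f⁻
    ; fvM = λ q n → fM (∈-++⁻ (fv M) q) n
    ; fvN = λ q → ∈-++⁺ʳ (fv M) (SubstSpec.fvN ih q)
    ; cst = λ z n z∉ → +-monoʳ-≤ (cost M z) (SubstSpec.cst ih z n z∉)
    ; exp = ex }
    where
    x∉M : x ∉ fv M
    x∉M q = dj (q , x∈P)
    dj' : Disjoint (fv M) (fv R)
    dj' {z} (b , a) with SubstSpec.fv⁻ ih a
    ... | inj₁ (c , _) = dj (b , c)
    ... | inj₂ c = dis (∈-++⁺ˡ b) (λ e → x∉M (subst (_∈ fv M) e b)) c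
    f⁻ : ∀ {z} → z ∈ fv M ++ fv R → (z ∈ fv M ++ fv P × z ≢ x) ⊎ z ∈ fv N
    f⁻ q with ∈-++⁻ (fv M) q
    ... | inj₁ r = inj₁ (∈-++⁺ˡ r , λ e → x∉M (subst (_∈ fv M) e r))
    ... | inj₂ r with SubstSpec.fv⁻ ih r
    ...   | inj₁ (a , b) = inj₁ (∈-++⁺ʳ (fv M) a , b)
    ...   | inj₂ c = inj₂ c
    fM : ∀ {z} → (z ∈ fv M) ⊎ (z ∈ fv P) → z ≢ x → z ∈ fv M ++ fv R
    fM (inj₁ r) n = ∈-++⁺ˡ r
    fM (inj₂ r) n = ∈-++⁺ʳ (fv M) (SubstSpec.fvM ih r n)
    ex : Expands (app M P) N x (app M R)
    ex {G} (ta {H = HM} {K = KR} d a d0 p) with Arg-expands (SubstSpec.exp ih) a | SubstSpec.exp ih d0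
    ... | (KP , α , K , aP , hx , ar , e) | (_ , _ , _ , d0' , _) =
      HM ⊕ KP , α , K , ta d aP d0' ≋-refl ,
      ↭-trans hx (↭-reflexive (sym (cong (_++ KP x) HMx))) , ar , ctx
      where
      HMx : HM x ≡ []
      HMx = ⊩-support d x x∉M
      ctx : G ≋ del x (HM ⊕ KP) ⊕ K
      ctx v = ↭-trans (p v) (↭-trans (PP.++⁺ˡ (HM v) (e v))
          (↭-trans (↭-sym (PP.++-assoc (HM v) (del x KP v) (K v)))
                (↭-reflexive (cong (_++ K v) (sym (by-cases (v ≟ x)
                    (λ ex' → trans (del-yes ex') (sym
                        (trans (cong₂ _++_ (trans (cong HM ex') HMx) (del-yes ex')) refl)))
                    (λ n → trans (del-no n) (cong (HM v ++_) (sym (del-no n))))))))))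

  spec-era : ∀ {y M N x R} → y ≢ x → y ∉ fv M → Avoids (era y M) N x → SubstSpec M N x R
      → SubstSpec (era y M) N x (era y R)
  spec-era {y} {M} {N} {x} {R} y≢x y∉M dis ih = record
    { wf = era (SubstSpec.wf ih) y∉R
    ; fv⁻ = f⁻
    ; fvM = λ { (here e) n → here e ; (there q) n → there (SubstSpec.fvM ih q n) }
    ; fvN = λ q → there (SubstSpec.fvN ih q)
    ; cst = λ z n z∉ → by-cases (y ≟ z) (λ e → subst (_≤ cost (era y M) z) (sym (c-era-yes R e)) z≤n)
              (λ ne → subst₂ _≤_ (sym (c-era-no R ne)) (sym (c-era-no M ne)) (SubstSpec.cst ih z n z∉))
    ; exp = ex }
    where
    y∉N : y ∉ fv N
    y∉N = dis (here refl) y≢x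
    y∉R : y ∉ fv R
    y∉R q with SubstSpec.fv⁻ ih q
    ... | inj₁ (a , _) = y∉M a
    ... | inj₂ b = y∉N b
    f⁻ : ∀ {z} → z ∈ y ∷ fv R → (z ∈ y ∷ fv M × z ≢ x) ⊎ z ∈ fv N
    f⁻ (here e) = inj₁ (here e , λ e' → y≢x (trans (sym e) e'))
    f⁻ (there q) with SubstSpec.fv⁻ ih q
    ... | inj₁ (a , b) = inj₁ (there a , b)
    ... | inj₂ c = inj₂ c
    ex : Expands (era y M) N x (era y R)
    ex (te d p) with SubstSpec.exp ih d
    ... | (H , α , K , dM , hx , ar , e) = H , α , K , te dM ≋-refl , hx , ar , ≋-trans p e

  -- (x ⊙ M)⟨N/x⟩ = Fv(N) ⊙ M: x gets ⊤ and N is erased.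
  spec-eraHit : ∀ {M N x} → WF M → WF N → x ∉ fv M → Avoids (era x M) N x
      → SubstSpec (era x M) N x (eras (fv N) M)
  spec-eraHit {M} {N} {x} wM wN x∉M dis = record
    { wf = WF-eras (fv N) wM (unique-fv wN) (λ (a , b) → dis (there b) (λ e → x∉M (subst (_∈ fv M) e b)) a)
    ; fv⁻ = λ q → f⁻ (∈-++⁻ (fv N) (subst (_ ∈_) (fv-eras (fv N) M) q))
    ; fvM = λ { (here e) n → ⊥-elim (n e) ; (there q) n
        → subst (_ ∈_) (sym (fv-eras (fv N) M)) (∈-++⁺ʳ (fv N) q) }
    ; fvN = λ q → subst (_ ∈_) (sym (fv-eras (fv N) M)) (∈-++⁺ˡ q)
    ; cst = λ z n z∉ → ≤-reflexive (trans (cost-eras (fv N) M z z∉) (sym (c-era-no M (λ e → n (sym e)))))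
    ; exp = ex }
    where
    f⁻ : ∀ {z} → (z ∈ fv N) ⊎ (z ∈ fv M) → (z ∈ x ∷ fv M × z ≢ x) ⊎ z ∈ fv N
    f⁻ (inj₁ q) = inj₂ q
    f⁻ (inj₂ q) = inj₁ (there q , λ e → x∉M (subst (_∈ fv M) e q))
    ex : Expands (era x M) N x (eras (fv N) M)
    ex {G} d = G , [] , ε , te dM ≋-refl , ↭-reflexive (sym Gx) , an ≋-refl ,
      (λ v → ↭-reflexive (sym (trans (++-identityʳ _)
          (by-cases (v ≟ x) (λ e → trans (del-yes e) (sym (trans (cong G e) Gx))) del-no))))
      where
      dM : G ⊩ M ∶ _
      dM = eras-inv (fv N) M d
      Gx : G x ≡ []
      Gx = ⊩-support dM x x∉M

  spec-dup : ∀ {y y1 y2 M N x R} → y ≢ x → y1 ∉ fv N → y2 ∉ fv N → y1 ∈ fv M → y2 ∈ fv M → y1 ≢ y2 →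
           y ∉ (fv M ─ y1) ─ y2 → x ≢ y1 → x ≢ y2 → Avoids (dup y y1 y2 M) N x → SubstSpec M N x R
               → SubstSpec (dup y y1 y2 M) N x (dup y y1 y2 R)
  spec-dup {y} {y1} {y2} {M} {N} {x} {R} y≢x y1∉N y2∉N y1∈ y2∈ y1≢y2 y∉ x≢y1 x≢y2 dis ih = record
    { wf = dup (SubstSpec.wf ih) (SubstSpec.fvM ih y1∈ (λ e → x≢y1 (sym e)))
        (SubstSpec.fvM ih y2∈ (λ e → x≢y2 (sym e))) y1≢y2 y∉R
    ; fv⁻ = f⁻
    ; fvM = fM
    ; fvN = λ q → there (─-⁺ (fv R ─ y1) (─-⁺ (fv R) (SubstSpec.fvN ih q) (λ e → y1∉N (subst (_∈ fv N) e q)))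
        (λ e → y2∉N (subst (_∈ fv N) e q)))
    ; cst = cs'
    ; exp = ex }
    where
    y∉N : y ∉ fv N
    y∉N = dis (here refl) y≢x
    inr : ∀ {z} → z ∈ (fv R ─ y1) ─ y2 → z ∈ fv R × z ≢ y1 × z ≢ y2
    inr q = ─-⊆ (fv R) (─-⊆ (fv R ─ y1) q) , ─-≢ (fv R) (─-⊆ (fv R ─ y1) q) , ─-≢ (fv R ─ y1) q
    inm : ∀ {z} → z ∈ fv M → z ≢ y1 → z ≢ y2 → z ∈ (fv M ─ y1) ─ y2
    inm a n1 n2 = ─-⁺ (fv M ─ y1) (─-⁺ (fv M) a n1) n2
    y∉R : y ∉ (fv R ─ y1) ─ y2
    y∉R q with inr q
    ... | (a , n1 , n2) with SubstSpec.fv⁻ ih a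
    ...   | inj₁ (b , _) = y∉ (inm b n1 n2)
    ...   | inj₂ b = y∉N b
    f⁻ : ∀ {z} → z ∈ y ∷ ((fv R ─ y1) ─ y2) → (z ∈ y ∷ ((fv M ─ y1) ─ y2) × z ≢ x) ⊎ z ∈ fv N
    f⁻ (here e) = inj₁ (here e , λ e' → y≢x (trans (sym e) e'))
    f⁻ (there q) with inr q
    ... | (a , n1 , n2) with SubstSpec.fv⁻ ih a
    ...   | inj₁ (b , n) = inj₁ (there (inm b n1 n2) , n)
    ...   | inj₂ b = inj₂ b
    fM : ∀ {z} → z ∈ y ∷ ((fv M ─ y1) ─ y2) → z ≢ x → z ∈ y ∷ ((fv R ─ y1) ─ y2)
    fM (here e) n = here e
    fM (there q) n = there (─-⁺ (fv R ─ y1)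
        (─-⁺ (fv R) (SubstSpec.fvM ih (─-⊆ (fv M) (─-⊆ (fv M ─ y1) q)) n) (─-≢ (fv M) (─-⊆ (fv M ─ y1) q)))
        (─-≢ (fv M ─ y1) q))
    cs' : ∀ z → z ≢ x → z ∉ fv N → cost (dup y y1 y2 R) z ≤ cost (dup y y1 y2 M) z
    cs' z n z∉ = by-cases (y ≟ z)
      (λ e → subst₂ _≤_ (sym (c-dup-hit R e)) (sym (c-dup-hit M e))
               (s≤s (+-mono-≤ (SubstSpec.cst ih y1 (λ e' → x≢y1 (sym e')) y1∉N)
                   (SubstSpec.cst ih y2 (λ e' → x≢y2 (sym e')) y2∉N))))
      (λ ne → by-cases (z ≟ y1) (λ e → subst (_≤ _) (sym (c-dup-b R ne (inj₁ e))) z≤n)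
        (λ n1 → by-cases (z ≟ y2) (λ e → subst (_≤ _) (sym (c-dup-b R ne (inj₂ e))) z≤n)
          (λ n2 → subst₂ _≤_ (sym (c-dup-o R ne n1 n2)) (sym (c-dup-o M ne n1 n2))
              (SubstSpec.cst ih z n z∉))))
    ex : Expands (dup y y1 y2 M) N x (dup y y1 y2 R)
    ex {G} (td {H = HR} d p) with SubstSpec.exp ih d
    ... | (H , α , K , dM , hx , ar , e) =
      contract y y1 y2 H , α , K , td dM ≋-refl ,
      ↭-trans hx (↭-reflexive (sym (trans (upd-no (λ e' → y≢x (sym e')))
          (trans (del-no x≢y2) (del-no x≢y1))))) , ar , ctx
      where
      Ky1 : K y1 ≡ []
      Ky1 = Arg-support ar y1 y1∉N
      Ky2 : K y2 ≡ []
      Ky2 = Arg-support ar y2 y2∉N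
      Ky : K y ≡ []
      Ky = Arg-support ar y y∉N
      ctx : G ≋ del x (contract y y1 y2 H) ⊕ K
      ctx = ≋-trans p (≋-trans (contract-≋ e) (λ v → ↭-reflexive
              (contract-del-⊕ y≢x (λ e' → x≢y1 (sym e')) (λ e' → x≢y2 (sym e')) Ky Ky1 Ky2 v)))

  -- (x <^x1_x2 M)⟨N/x⟩: substitute two fresh copies N1, N2 of N for x1 and
  -- x2, then share each free name of N between its two copies.  The copies use
  -- the fresh names W1, W2; the typing of x is the intersection of those of
  -- x1 and x2, and the typings of N1, N2 are renamed back to typings of N.
  module DupHit {x x1 x2 : Var} {M N : Term} (W1 W2 : List Var) (len1 : length W1 ≡ length (fv N))
      (len2 : length W2 ≡ length (fv N))
             (uq : Unique (W1 ++ W2)) (dj : Disjoint (W1 ++ W2) (x ∷ x1 ∷ x2 ∷ (vars M ++ vars N)))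
             (wM : WF M) (wN : WF N) where
    V : List Var
    V = fv N
    c1 c2 : Var → Var
    c1 = swapsFn V W1
    c2 = swapsFn V W2
    N1 N2 : Term
    N1 = swaps V W1 N
    N2 = swaps V W2 N
    eqN1 : N1 ≡ mapV c1 N
    eqN1 = swaps≡mapV V W1 N
    eqN2 : N2 ≡ mapV c2 N
    eqN2 = swaps≡mapV V W2 N
    fvN1 : fv N1 ≡ map c1 V
    fvN1 = trans (cong fv eqN1) (fv-mapV (swapsFn-inj V W1) N)
    fvN2 : fv N2 ≡ map c2 V
    fvN2 = trans (cong fv eqN2) (fv-mapV (swapsFn-inj V W2) N)
    uV : Unique V
    uV = unique-fv wN
    uW1 : Unique W1
    uW1 = unique-++ˡ W1 uq
    uW2 : Unique W2
    uW2 = unique-++ʳ W1 uq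
    dW : Disjoint W1 W2
    dW = unique-++-disjoint W1 uq
    W1∉ : ∀ {z} → z ∈ W1 → z ∉ x ∷ x1 ∷ x2 ∷ (vars M ++ vars N)
    W1∉ p q = dj (∈-++⁺ˡ p , q)
    W2∉ : ∀ {z} → z ∈ W2 → z ∉ x ∷ x1 ∷ x2 ∷ (vars M ++ vars N)
    W2∉ p q = dj (∈-++⁺ʳ W1 p , q)
    inVars : ∀ {z} → z ∈ vars M → z ∈ x ∷ x1 ∷ x2 ∷ (vars M ++ vars N)
    inVars p = there (there (there (∈-++⁺ˡ p)))
    inVarsN : ∀ {z} → z ∈ vars N → z ∈ x ∷ x1 ∷ x2 ∷ (vars M ++ vars N)
    inVarsN p = there (there (there (∈-++⁺ʳ (vars M) p)))
    djV1 : Disjoint V W1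
    djV1 (a , b) = W1∉ b (inVarsN (fv⊆vars N a))
    djV2 : Disjoint V W2
    djV2 (a , b) = W2∉ b (inVarsN (fv⊆vars N a))
    c1V : ∀ {v} → v ∈ V → c1 v ∈ W1
    c1V = swapsFn-range V W1 len1 uV uW1 djV1
    c2V : ∀ {v} → v ∈ V → c2 v ∈ W2
    c2V = swapsFn-range V W2 len2 uV uW2 djV2
    mapW1 : ∀ {z} → z ∈ map c1 V → z ∈ W1
    mapW1 p with ∈-map⁻ c1 p
    ... | (v , v∈ , refl) = c1V v∈
    mapW2 : ∀ {z} → z ∈ map c2 V → z ∈ W2
    mapW2 p with ∈-map⁻ c2 p
    ... | (v , v∈ , refl) = c2V v∈
    inN1 : ∀ {z} → z ∈ fv N1 → z ∈ W1
    inN1 p = mapW1 (subst (_ ∈_) fvN1 p)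
    inN2 : ∀ {z} → z ∈ fv N2 → z ∈ W2
    inN2 p = mapW2 (subst (_ ∈_) fvN2 p)
    copiesDistinct : DupNames V c1 c2
    copiesDistinct = record { uq = uV ; fi = swapsFn-inj V W1 ; gi = swapsFn-inj V W2
      ; fo = λ p q → djV1 (q , c1V p) ; go = λ p q → djV2 (q , c2V p)
      ; fg = λ p q e → dW (c1V p , subst (_∈ W2) (sym e) (c2V q)) }
    wN1 : WF N1
    wN1 = subst WF (sym eqN1) (WF-mapV (swapsFn-inj V W1) wN)
    wN2 : WF N2
    wN2 = subst WF (sym eqN2) (WF-mapV (swapsFn-inj V W2) wN)
    dis1 : Avoids M N1 x1
    dis1 zM _ zN1 = W1∉ (inN1 zN1) (inVars (fv⊆vars M zM))
    module FirstCopy {R1 : Term} (ih1 : SubstSpec M N1 x1 R1) where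
      dis2 : Avoids R1 N2 x2
      dis2 {z} zR1 _ zN2 with SubstSpec.fv⁻ ih1 zR1
      ... | inj₁ (a , _) = W2∉ (inN2 zN2) (inVars (fv⊆vars M a))
      ... | inj₂ b = dW (inN1 b , inN2 zN2)
      x2R1 : x2 ∈ fv M → x1 ≢ x2 → x2 ∈ fv R1
      x2R1 p n = SubstSpec.fvM ih1 p (λ e → n (sym e))
    module BothCopies {R1 R2 : Term} (ih1 : SubstSpec M N1 x1 R1) (ih2 : SubstSpec R1 N2 x2 R2)
                   (x1∈ : x1 ∈ fv M) (x2∈ : x2 ∈ fv M) (x1≢x2 : x1 ≢ x2) (x∉ : x ∉ (fv M ─ x1) ─ x2)
                   (dis : Avoids (dup x x1 x2 M) N x) where
      R : Term
      R = dupsBy V c1 c2 R2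
      inm : ∀ {z} → z ∈ fv M → z ≢ x1 → z ≢ x2 → z ∈ (fv M ─ x1) ─ x2
      inm a n1 n2 = ─-⁺ (fv M ─ x1) (─-⁺ (fv M) a n1) n2
      W1nM : ∀ {z} → z ∈ W1 → z ∉ fv M
      W1nM p q = W1∉ p (inVars (fv⊆vars M q))
      W2nM : ∀ {z} → z ∈ W2 → z ∉ fv M
      W2nM p q = W2∉ p (inVars (fv⊆vars M q))
      disjV : Disjoint V (fv R2)
      disjV {z} (zV , zR2) with SubstSpec.fv⁻ ih2 zR2
      ... | inj₂ b = djV2 (zV , inN2 b)
      ... | inj₁ (b , n2) with SubstSpec.fv⁻ ih1 b
      ...   | inj₂ c = djV1 (zV , inN1 c)
      ...   | inj₁ (c , n1) = dis (there (inm c n1 n2))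
          (λ e → x∉ (subst (_∈ (fv M ─ x1) ─ x2) e (inm c n1 n2))) zV
      hf : ∀ {a} → a ∈ V → c1 a ∈ fv R2
      hf {a} p = SubstSpec.fvM ih2 (SubstSpec.fvN ih1 (subst (c1 a ∈_) (sym fvN1) (∈-map⁺ c1 p)))
          (λ e → W1∉ (c1V p) (there (there (here e))))
      hg : ∀ {a} → a ∈ V → c2 a ∈ fv R2
      hg {a} p = SubstSpec.fvN ih2 (subst (c2 a ∈_) (sym fvN2) (∈-map⁺ c2 p))
      f⁻ : ∀ {z} → z ∈ fv R → (z ∈ fv (dup x x1 x2 M) × z ≢ x) ⊎ z ∈ V
      f⁻ q with dups-fv⁻ V c1 c2 R2 q
      ... | inj₁ zV = inj₂ zV
      ... | inj₂ (a , nf , ng) with SubstSpec.fv⁻ ih2 a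
      ...   | inj₂ b = ⊥-elim (ng (subst (_ ∈_) fvN2 b))
      ...   | inj₁ (b , n2) with SubstSpec.fv⁻ ih1 b
      ...     | inj₂ c = ⊥-elim (nf (subst (_ ∈_) fvN1 c))
      ...     | inj₁ (c , n1) = inj₁ (there (inm c n1 n2) , λ e
          → x∉ (subst (_∈ (fv M ─ x1) ─ x2) e (inm c n1 n2)))
      fM : ∀ {z} → z ∈ fv (dup x x1 x2 M) → z ≢ x → z ∈ fv R
      fM (here e) n = ⊥-elim (n e)
      fM {z} (there q) n =
        dups-fv⁺T V c1 c2 R2 (SubstSpec.fvM ih2 (SubstSpec.fvM ih1 c n1) n2) (λ r → W1nM (mapW1 r) c)
            (λ r → W2nM (mapW2 r) c)
        where
        c : z ∈ fv M
        c = ─-⊆ (fv M) (─-⊆ (fv M ─ x1) q)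
        n1 : z ≢ x1
        n1 = ─-≢ (fv M) (─-⊆ (fv M ─ x1) q)
        n2 : z ≢ x2
        n2 = ─-≢ (fv M ─ x1) q
      notR : ∀ {z} → z ≢ x → z ∉ V → (z ≡ x1 ⊎ z ≡ x2) → z ∉ fv R
      notR n nV b q with f⁻ q
      ... | inj₂ zV = nV zV
      ... | inj₁ (here e , _) = n e
      ... | inj₁ (there r , _) with b
      ...   | inj₁ e = ─-≢ (fv M) (─-⊆ (fv M ─ x1) r) e
      ...   | inj₂ e = ─-≢ (fv M ─ x1) r e
      cst' : ∀ z → z ≢ x → z ∉ V → cost R z ≤ cost (dup x x1 x2 M) z
      cst' z n z∉ = by-cases (z ≟ x1) (λ e → subst (_≤ _) (sym (cost-0 R z (notR n z∉ (inj₁ e)))) z≤n)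
        (λ n1 → by-cases (z ≟ x2) (λ e → subst (_≤ _) (sym (cost-0 R z (notR n z∉ (inj₂ e)))) z≤n)
          (λ n2 → subst (_ ≤_) (sym (c-dup-o M (λ e → n (sym e)) n1 n2))
            (by-cases (z ∈? map c1 V) (λ r → subst (_≤ _) (sym (cost-dups-0 V c1 c2 R2 z z∉ (inj₁ r))) z≤n)
              (λ r1 → by-cases (z ∈? map c2 V) (λ r
                  → subst (_≤ _) (sym (cost-dups-0 V c1 c2 R2 z z∉ (inj₂ r))) z≤n)
                (λ r2 → ≤-trans (cost-dups V c1 c2 R2 z z∉)
                   (≤-trans (SubstSpec.cst ih2 z n2 (λ s → r2 (subst (_ ∈_) fvN2 s)))
                       (SubstSpec.cst ih1 z n1 (λ s → r1 (subst (_ ∈_) fvN1 s)))))))))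
      back1 : mapV (swapsFn⁻¹ V W1) (mapV c1 N) ≡ N
      back1 = trans (mapV-∘ _ _ N) (mapV-id N (λ v _ → swapsFn-inverseʳ V W1 v))
      back2 : mapV (swapsFn⁻¹ V W2) (mapV c2 N) ≡ N
      back2 = trans (mapV-∘ _ _ N) (mapV-id N (λ v _ → swapsFn-inverseʳ V W2 v))
      argB1 : ∀ {α K} → Arg N1 α K → Arg N α (λ v → K (c1 v))
      argB1 {α} {K} a = subst (λ t → Arg t α (λ v → K (c1 v))) back1
          (Renamed.Arg-rename (swapsBij V W1) (subst (λ t → Arg t α K) eqN1 a))
      argB2 : ∀ {α K} → Arg N2 α K → Arg N α (λ v → K (c2 v))
      argB2 {α} {K} a = subst (λ t → Arg t α (λ v → K (c2 v))) back2
          (Renamed.Arg-rename (swapsBij V W2) (subst (λ t → Arg t α K) eqN2 a))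
      x2nN1 : x2 ∉ fv N1
      x2nN1 p = W1∉ (inN1 p) (there (there (here refl)))
      ex : Expands (dup x x1 x2 M) N x R
      ex {G} d with dups-inv V (map c1 V) (map c2 V) R2 d
      ... | (H2 , dR2 , eG) with SubstSpec.exp ih2 dR2
      ...   | (H1 , α2 , K2 , dR1 , hx2 , ar2 , e2) with SubstSpec.exp ih1 dR1
      ...     | (H0 , α1 , K1 , dM , hx1 , ar1 , e1) =
        contract x x1 x2 H0 , α1 ++ α2 , (λ v → K1 (c1 v)) ⊕ (λ v → K2 (c2 v)) , td dM ≋-refl , hxx ,
        Arg-++ (argB1 ar1) (argB2 ar2) , ctx
        where
        K1x2 : K1 x2 ≡ []
        K1x2 = Arg-support ar1 x2 x2nN1
        hxx : α1 ++ α2 ↭ contract x x1 x2 H0 x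
        hxx = ↭-trans (PP.++⁺ hx1 (↭-trans hx2
            (↭-trans (e1 x2) (↭-reflexive (trans (cong₂ _++_ (del-no (λ e → x1≢x2 (sym e))) K1x2)
            (++-identityʳ _))))))
                (↭-reflexive (sym (contract-at x x1 x2 H0)))
        H0W : ∀ {a} → a ∈ W1 ⊎ a ∈ W2 → H0 a ≡ []
        H0W (inj₁ p) = ⊩-support dM _ (W1nM p)
        H0W (inj₂ p) = ⊩-support dM _ (W2nM p)
        Wx : ∀ {a} → a ∈ W1 ⊎ a ∈ W2 → a ∉ x ∷ x1 ∷ x2 ∷ (vars M ++ vars N)
        Wx (inj₁ p) = W1∉ p
        Wx (inj₂ p) = W2∉ p
        K1n : ∀ v → v ∉ V → K1 (c1 v) ≡ []
        K1n v nV = Arg-support ar1 (c1 v) (λ q → nV (∈-inj (swapsFn-inj V W1) V (subst (c1 v ∈_) fvN1 q)))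
        K2n : ∀ v → v ∉ V → K2 (c2 v) ≡ []
        K2n v nV = Arg-support ar2 (c2 v) (λ q → nV (∈-inj (swapsFn-inj V W2) V (subst (c2 v ∈_) fvN2 q)))
        delD-W : ∀ {v} → v ∈ W1 ⊎ v ∈ W2 → del x (contract x x1 x2 H0) v ≡ []
        delD-W p = trans (del-no (λ e → Wx p (here e))) (trans (upd-no (λ e → Wx p (here e)))
                     (trans (del-no (λ e → Wx p (there (there (here e)))))
                         (trans (del-no (λ e → Wx p (there (here e)))) (H0W p))))
        delD-V : ∀ {v} → v ∈ V → del x (contract x x1 x2 H0) v ≡ []
        delD-V {v} vV = by-cases (v ≟ x) del-yes (λ nx → trans (del-no nx) (trans (upd-no nx)
          (by-cases (v ≟ x2) del-yes (λ n2 → trans (del-no n2)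
              (by-cases (v ≟ x1) del-yes (λ n1 → trans (del-no n1)
            (⊩-support dM v (λ q → dis (there (inm q n1 n2)) nx vV))))))))
        ctx : G ≋ del x (contract x x1 x2 H0) ⊕ ((λ v → K1 (c1 v)) ⊕ (λ v → K2 (c2 v)))
        ctx v = by-cases (v ∈? V) caseV (λ nV → by-cases (v ∈? map c1 V) (λ r → caseW nV (inj₁ r))
                   (λ r1 → by-cases (v ∈? map c2 V) (λ r → caseW nV (inj₂ r)) (caseO nV r1)))
          where
          -- The three kinds of names in the context: free names of N (shared between
          -- the copies), names of the copies W1, W2, and all other names.
          caseV : v ∈ V → G v ↭ del x (contract x x1 x2 H0) v ++ (K1 (c1 v) ++ K2 (c2 v))
          caseV vV = ↭-trans (eG v) (↭-trans (↭-reflexive (contractAll-shared V c1 c2 H2 copiesDistinct vV))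
                       (↭-trans (PP.++⁺ H2a H2b) (↭-reflexive (sym (cong (_++ _) (delD-V vV))))))
            where
            a b : Var
            a = c1 v
            b = c2 v
            aW : a ∈ W1
            aW = c1V vV
            bW : b ∈ W2
            bW = c2V vV
            H2a : H2 a ↭ K1 a
            H2a = ↭-trans (e2 a) (↭-trans (↭-reflexive
                (trans (cong₂ _++_ (del-no (λ e → W1∉ aW (there (there (here e)))))
                     (Arg-support ar2 a (λ q → dW (aW , inN2 q)))) (++-identityʳ _)))
                    (↭-trans (e1 a) (↭-reflexive (cong (_++ K1 a)
                        (trans (del-no (λ e → W1∉ aW (there (here e)))) (H0W (inj₁ aW)))))))
            H2b : H2 b ↭ K2 b
            H2b = ↭-trans (e2 b) (↭-trans (↭-reflexive
                (cong (_++ K2 b) (del-no (λ e → W2∉ bW (there (there (here e)))))))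
                    (PP.++⁺ʳ (K2 b) (↭-trans (e1 b)
                        (↭-reflexive (cong₂ _++_ (trans (del-no (λ e → W2∉ bW (there (here e))))
                        (H0W (inj₂ bW)))
                        (Arg-support ar1 b (λ q → dW (inN1 q , bW))))))))
          caseW : v ∉ V → v ∈ map c1 V ⊎ v ∈ map c2 V
              → G v ↭ del x (contract x x1 x2 H0) v ++ (K1 (c1 v) ++ K2 (c2 v))
          caseW nV r = ↭-trans (eG v) (↭-reflexive (trans (contractAll-copy V c1 c2 H2 copiesDistinct nV r)
                        (sym (trans (cong₂ _++_ (delD-W (w r)) (cong₂ _++_ (K1n v nV) (K2n v nV))) refl))))
            where
            w : v ∈ map c1 V ⊎ v ∈ map c2 V → v ∈ W1 ⊎ v ∈ W2
            w (inj₁ q) = inj₁ (mapW1 q)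
            w (inj₂ q) = inj₂ (mapW2 q)
          caseO : v ∉ V → v ∉ map c1 V → v ∉ map c2 V
              → G v ↭ del x (contract x x1 x2 H0) v ++ (K1 (c1 v) ++ K2 (c2 v))
          caseO nV r1 r2 = ↭-trans (goal) (↭-reflexive
              (sym (cong (del x (contract x x1 x2 H0) v ++_) (cong₂ _++_ (K1n v nV) (K2n v nV)))))
            where
            K2v : K2 v ≡ []
            K2v = Arg-support ar2 v (λ q → r2 (subst (_ ∈_) fvN2 q))
            K1v : K1 v ≡ []
            K1v = Arg-support ar1 v (λ q → r1 (subst (_ ∈_) fvN1 q))
            goal : G v ↭ del x (contract x x1 x2 H0) v ++ []
            goal = by-cases (v ≟ x)
              (λ ex' → ↭-reflexive (trans (⊩-support d v (notx ex')) (sym (cong (_++ []) (del-yes ex')))))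
              (λ nx → ↭-trans (eG v) (↭-trans (↭-reflexive
                  (trans (contractAll-other V c1 c2 H2 v nV r1 r2) refl))
                (↭-trans (e2 v) (↭-trans (↭-reflexive (trans (cong (del x2 H1 v ++_) K2v) (++-identityʳ _)))
                  (↭-trans (inner) (↭-reflexive (sym
                      (trans (++-identityʳ _) (trans (del-no nx) (upd-no nx))))))))))
              where
              notx : v ≡ x → v ∉ fv R
              notx e q with f⁻ q
              ... | inj₁ (_ , n) = n e
              ... | inj₂ zV = nV zV
              inner : del x2 H1 v ↭ del x2 (del x1 H0) v
              inner = by-cases (v ≟ x2) (λ e → ↭-reflexive (trans (del-yes e) (sym (del-yes e))))
                (λ n2 → ↭-trans (↭-reflexive (del-no n2))
                    (↭-trans (e1 v) (↭-reflexive (trans (cong (del x1 H0 v ++_) K1v)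
                   (trans (++-identityʳ _) (sym (del-no n2)))))))
      spec-dupHit : SubstSpec (dup x x1 x2 M) N x R
      spec-dupHit = record
        { wf = WF-dups V c1 c2 copiesDistinct (SubstSpec.wf ih2) disjV hf hg
        ; fv⁻ = f⁻ ; fvM = fM ; fvN = dups-fv⁺V V c1 c2 R2 copiesDistinct ; cst = cst' ; exp = ex }

  substSpec : ∀ {M N x R} → M ⟨ N / x ⟩⇒ R → WF M → WF N → x ∈ fv M → Avoids M N x → SubstSpec M N x R
  substSpec s-var wM wN x∈ dis = spec-var wN
  substSpec {N = N} (s-lam {y} {M} y≢x y∉N d) (lam w y∈) wN x∈ dis = spec-lam y≢x y∉N y∈
      (substSpec d w wN (─-⊆ (fv M) x∈) dis')
    where
    dis' : Avoids M N _
    dis' {z} zM n = by-cases (z ≟ y) (λ e → subst (_∉ fv N) (sym e) y∉N) (λ ne → dis (─-⁺ (fv M) zM ne) n)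
  substSpec (s-appL x∈M d) (app wM wP dj) wN x∈ dis = spec-appL wP dj x∈M dis
      (substSpec d wM wN x∈M (λ zM n → dis (∈-++⁺ˡ zM) n))
  substSpec (s-appR {M} x∈P d) (app wM wP dj) wN x∈ dis = spec-appR wM dj x∈P dis
      (substSpec d wP wN x∈P (λ zP n → dis (∈-++⁺ʳ (fv M) zP) n))
  substSpec (s-era y≢x d) (era w y∉M) wN (here e) dis = ⊥-elim (y≢x (sym e))
  substSpec (s-era y≢x d) (era w y∉M) wN (there x∈M) dis = spec-era y≢x y∉M dis
      (substSpec d w wN x∈M (λ zM n → dis (there zM) n))
  substSpec s-eraHit (era w x∉M) wN x∈ dis = spec-eraHit w wN x∉M dis
  substSpec (s-dup y≢x y1∉N y2∉N d) (dup w y1∈ y2∈ y1≢y2 y∉) wN (here e) dis = ⊥-elim (y≢x (sym e))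
  substSpec {N = N} {x} (s-dup {y} {y1} {y2} {M} y≢x y1∉N y2∉N d) (dup w y1∈ y2∈ y1≢y2 y∉) wN (there q) dis =
    spec-dup y≢x y1∉N y2∉N y1∈ y2∈ y1≢y2 y∉ x≢y1 x≢y2 dis (substSpec d w wN x∈M dis')
    where
    x∈M : x ∈ fv M
    x∈M = ─-⊆ (fv M) (─-⊆ (fv M ─ y1) q)
    x≢y1 : x ≢ y1
    x≢y1 = ─-≢ (fv M) (─-⊆ (fv M ─ y1) q)
    x≢y2 : x ≢ y2
    x≢y2 = ─-≢ (fv M ─ y1) q
    dis' : Avoids M N x
    dis' {z} zM n = by-cases (z ≟ y1) (λ e → subst (_∉ fv N) (sym e) y1∉N)
      (λ n1 → by-cases (z ≟ y2) (λ e → subst (_∉ fv N) (sym e) y2∉N)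
        (λ n2 → dis (there (─-⁺ (fv M ─ y1) (─-⁺ (fv M) zM n1) n2)) n))
  substSpec {N = N} (s-dupHit {x} {x1} {x2} {M} {.N} {R1} {R2} W1 W2 len1 len2 uq dj d1 d2)
      (dup wM x1∈ x2∈ x1≢x2 x∉) wN x∈ dis =
    subst (SubstSpec (dup x x1 x2 M) N x) (sym eqR) (BothCopies.spec-dupHit ih1 ih2 x1∈ x2∈ x1≢x2 x∉ dis)
    where
    open DupHit {x} {x1} {x2} {M} {N} W1 W2 len1 len2 uq dj wM wN
    ih1 : SubstSpec M N1 x1 R1
    ih1 = substSpec d1 wM wN1 x1∈ dis1
    ih2 : SubstSpec R1 N2 x2 R2
    ih2 = substSpec d2 (SubstSpec.wf ih1) wN2 (FirstCopy.x2R1 ih1 x2∈ x1≢x2) (FirstCopy.dis2 ih1)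
    eqR : dups (fv N) (fv N1) (fv N2) R2 ≡ dupsBy V c1 c2 R2
    eqR = cong₂ (λ a b → dups V a b R2) fvN1 fvN2

module SubstitutionExists where
  open NameLists
  open AlphaConversion
  open SubstitutionToolkit
  open SubstitutionLemma

  -- By recursion on the cost measure we
  -- construct R with M⟨N/x⟩⇒R whenever the binders of M are fresh for N; the
  -- duplication rule needs fresh copies of Fv(N), whose binders in turn must
  -- avoid a given list A, hence the extra parameter A.  Combined with freshen
  -- this yields a substitution result for every well-formed M up to α.

  interval : ℕ → ℕ → List ℕ
  interval b zero = []
  interval b (suc k) = b ∷ interval (suc b) k

  interval-length : ∀ b k → length (interval b k) ≡ k
  interval-length b zero = refl
  interval-length b (suc k) = cong suc (interval-length (suc b) k)

  interval-≥ : ∀ b k {v} → v ∈ interval b k → b ≤ v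
  interval-≥ b (suc k) (here refl) = ≤-refl
  interval-≥ b (suc k) (there p) = ≤-trans (n≤1+n b) (interval-≥ (suc b) k p)

  interval-< : ∀ b k {v} → v ∈ interval b k → v < b + k
  interval-< b (suc k) (here refl) = subst (b <_) (sym (+-suc b k)) (s≤s (m≤m+n b k))
  interval-< b (suc k) {v} (there p) = subst (v <_) (sym (+-suc b k)) (interval-< (suc b) k p)

  interval-unique : ∀ b k → Unique (interval b k)
  interval-unique b zero = []
  interval-unique b (suc k) = ucons (λ p → <-irrefl refl (interval-≥ (suc b) k p)) (interval-unique (suc b) k)

  record FreshPair (k : ℕ) (S : List Var) : Set where
    field
      W1 W2 : List Var
      length1 : length W1 ≡ k
      length2 : length W2 ≡ k
      unique : Unique (W1 ++ W2)
      avoids : Disjoint (W1 ++ W2) S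

  freshPair : ∀ k S → FreshPair k S
  freshPair k S = record
    { W1 = interval b k ; W2 = interval (b + k) k
    ; length1 = interval-length b k ; length2 = interval-length (b + k) k
    ; unique = UP.++⁺ (interval-unique b k) (interval-unique (b + k) k)
                 (λ (p , q) → <-irrefl refl (<-≤-trans (interval-< b k p) (interval-≥ (b + k) k q)))
    ; avoids = λ (p , q) → above-maxOf-∉ S (above p) q }
    where
    b : ℕ
    b = fresh S
    above : ∀ {v} → v ∈ interval b k ++ interval (b + k) k → b ≤ v
    above p with ∈-++⁻ (interval b k) p
    ... | inj₁ q = interval-≥ b k q
    ... | inj₂ q = ≤-trans (m≤m+n b k) (interval-≥ (b + k) k q)

  BindersFrom : Term → Term → List Var → Term → Set
  BindersFrom M N A R = ∀ {b} → b ∈ binders R → b ∈ binders M ⊎ b ∈ binders N ⊎ b ∉ A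

  SubstResult : Term → Term → Var → List Var → Set
  SubstResult M N x A = Σ Term λ R → (M ⟨ N / x ⟩⇒ R) × BindersFrom M N A R

  binders-swaps : ∀ V W N → Disjoint W (vars N) → length W ≡ length V → Unique V → Unique W → Disjoint V W →
              ∀ {b} → b ∈ binders (swaps V W N) → b ∈ binders N ⊎ b ∈ W
  binders-swaps V W N dWN len uV uW dVW {b} p with ∈-map⁻ (swapsFn V W)
      (subst (b ∈_) (trans (cong binders (swaps≡mapV V W N)) (binders-mapV (swapsFn V W) N)) p)
  ... | (b' , b'∈ , refl) = by-cases (b' ∈? V) (λ q → inj₂ (swapsFn-range V W len uV uW dVW q))
    (λ q → inj₁ (subst (_∈ binders N) (sym (swapsFn-fix V W b' q (λ r → dWN (r , binders⊆vars N b'∈)))) b'∈))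

  substitute : ∀ (n : ℕ) (M : Term) {N x} (A : List Var) → WF M → WF N → x ∈ fv M →
               Avoids M N x → Disjoint (binders M) (fv N) → cost M x ≤ n → SubstResult M N x A
  substituteEra : ∀ (n : ℕ) y B {N x} (A : List Var) → Dec (y ≡ x) → WF (era y B) → WF N →
                  x ∈ fv (era y B) → Avoids (era y B) N x → Disjoint (binders B) (fv N) →
                  cost (era y B) x ≤ n → SubstResult (era y B) N x A
  substituteDup : ∀ (n : ℕ) y y1 y2 B {N x} (A : List Var) → Dec (y ≡ x) → WF (dup y y1 y2 B) → WF N →
                  x ∈ fv (dup y y1 y2 B) → Avoids (dup y y1 y2 B) N x →
                  Disjoint (binders (dup y y1 y2 B)) (fv N) → cost (dup y y1 y2 B) x ≤ n →
                  SubstResult (dup y y1 y2 B) N x A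

  substitute n (var y) A wM wN (here refl) dis bd c = _ , s-var , λ q → inj₂ (inj₁ q)
  substitute n (lam y B) {N} {x} A (lam w y∈) wN x∈ dis bd c with substitute n B A w wN (─-⊆ (fv B) x∈) dis'
      (λ (p , q) → bd (there p , q)) c'
    where
    y≢x : y ≢ x
    y≢x e = ─-≢ (fv B) x∈ (sym e)
    dis' : Avoids B N x
    dis' {z} zB n' = by-cases (z ≟ y) (λ e → λ q → bd (here e , q)) (λ ne → dis (─-⁺ (fv B) zB ne) n')
    c' : cost B x ≤ n
    c' = subst (_≤ n) (c-lam-no B y≢x) c
  ... | (R , d , bp) = lam y R , s-lam (λ e → ─-≢ (fv B) x∈ (sym e)) (λ q → bd (here refl , q)) d , bp'
    where
    bp' : BindersFrom (lam y B) N A (lam y R)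
    bp' (here e) = inj₁ (here e)
    bp' (there q) with bp q
    ... | inj₁ r = inj₁ (there r)
    ... | inj₂ r = inj₂ r
  substitute n (app P Q) {N} {x} A (app wP wQ dj) wN x∈ dis bd c with x ∈? fv P
  ... | yes xP with substitute n P A wP wN xP (λ zP n' → dis (∈-++⁺ˡ zP) n') (λ (p , q) → bd (∈-++⁺ˡ p , q))
      (≤-trans (m≤m+n (cost P x) (cost Q x)) c)
  ...   | (R , d , bp) = app R Q , s-appL xP d , bp'
    where
    bp' : BindersFrom (app P Q) N A (app R Q)
    bp' q with ∈-++⁻ (binders R) q
    ... | inj₂ r = inj₁ (∈-++⁺ʳ (binders P) r)
    ... | inj₁ r with bp r
    ...   | inj₁ s = inj₁ (∈-++⁺ˡ s)
    ...   | inj₂ s = inj₂ s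
  substitute n (app P Q) {N} {x} A (app wP wQ dj) wN x∈ dis bd c | no nP with ∈-++⁻ (fv P) x∈
  ... | inj₁ xP = ⊥-elim (nP xP)
  ... | inj₂ xQ with substitute n Q A wQ wN xQ (λ zQ n' → dis (∈-++⁺ʳ (fv P) zQ) n')
      (λ (p , q) → bd (∈-++⁺ʳ (binders P) p , q)) (≤-trans (m≤n+m (cost Q x) (cost P x)) c)
  ...   | (R , d , bp) = app P R , s-appR xQ d , bp'
    where
    bp' : BindersFrom (app P Q) N A (app P R)
    bp' q with ∈-++⁻ (binders P) q
    ... | inj₁ r = inj₁ (∈-++⁺ˡ r)
    ... | inj₂ r with bp r
    ...   | inj₁ s = inj₁ (∈-++⁺ʳ (binders P) s)
    ...   | inj₂ s = inj₂ s
  substitute n (era y B) {x = x} A wM wN x∈ dis bd c = substituteEra n y B A (y ≟ x) wM wN x∈ dis bd c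
  substitute n (dup y y1 y2 B) {x = x} A wM wN x∈ dis bd c = substituteDup n y y1 y2 B A (y ≟ x) wM wN x∈ dis
      bd c

  substituteEra n y B {N} A (yes refl) (era w x∉) wN x∈ dis bd c = eras (fv N) B , s-eraHit , λ q
      → inj₁ (subst (_ ∈_) (binders-eras (fv N) B) q)
  substituteEra n y B A (no ne) (era w y∉) wN (here e) dis bd c = ⊥-elim (ne (sym e))
  substituteEra n y B {N} {x} A (no ne) (era w y∉) wN (there x∈) dis bd c
    with substitute n B A w wN x∈ (λ zB n' → dis (there zB) n') bd (subst (_≤ n) (c-era-no B ne) c)
  ... | (R , d , bp) = era y R , s-era ne d , bp

  substituteDup n y y1 y2 B A (no ne) (dup w y1∈ y2∈ y1≢y2 y∉) wN (here e) dis bd c = ⊥-elim (ne (sym e))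
  substituteDup n y y1 y2 B {N} {x} A (no ne) (dup w y1∈ y2∈ y1≢y2 y∉) wN (there q) dis bd c
    with substitute n B A w wN x∈B dis' (λ (p , r) → bd (there (there p) , r))
        (subst (_≤ n) (c-dup-o B ne (λ e → x≢y1 e) (λ e → x≢y2 e)) c)
    where
    x∈B : x ∈ fv B
    x∈B = ─-⊆ (fv B) (─-⊆ (fv B ─ y1) q)
    x≢y1 : x ≢ y1
    x≢y1 = ─-≢ (fv B) (─-⊆ (fv B ─ y1) q)
    x≢y2 : x ≢ y2
    x≢y2 = ─-≢ (fv B ─ y1) q
    dis' : Avoids B N x
    dis' {z} zB n' = by-cases (z ≟ y1) (λ e r → bd (here e , r))
      (λ n1 → by-cases (z ≟ y2) (λ e r → bd (there (here e) , r))
        (λ n2 → dis (there (─-⁺ (fv B ─ y1) (─-⁺ (fv B) zB n1) n2)) n'))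
  ... | (R , d , bp) = dup y y1 y2 R , s-dup ne (λ r → bd (here refl , r)) (λ r → bd (there (here refl) , r))
      d , bp'
    where
    bp' : BindersFrom (dup y y1 y2 B) N A (dup y y1 y2 R)
    bp' (here e) = inj₁ (here e)
    bp' (there (here e)) = inj₁ (there (here e))
    bp' (there (there r)) with bp r
    ... | inj₁ s = inj₁ (there (there s))
    ... | inj₂ s = inj₂ s
  substituteDup zero y y1 y2 B A (yes refl) wM wN x∈ dis bd c = ⊥-elim
      (no-fuel (subst (_≤ 0) (c-dup-hit {y} {y1} {y2} B refl) c))
    where
    no-fuel : ∀ {k} → suc k ≤ 0 → ⊥
    no-fuel ()
  substituteDup (suc n) x x1 x2 B {N} A (yes refl) (dup wB x1∈ x2∈ x1≢x2 x∉) wN x∈ dis bd c =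
    dups (fv N) (fv N1) (fv N2) R2 , s-dupHit W1 W2 len1 len2 uq dj d1 d2 , bp
    where
    fresh-names : FreshPair (length (fv N)) (A ++ x ∷ x1 ∷ x2 ∷ (vars B ++ vars N))
    fresh-names = freshPair (length (fv N)) (A ++ x ∷ x1 ∷ x2 ∷ (vars B ++ vars N))
    open FreshPair fresh-names renaming (length1 to len1; length2 to len2; unique to uq)
    dj : Disjoint (W1 ++ W2) (x ∷ x1 ∷ x2 ∷ (vars B ++ vars N))
    dj (p , q) = avoids (p , ∈-++⁺ʳ A q)
    open DupHit {x} {x1} {x2} {B} {N} W1 W2 len1 len2 uq dj wB wN
    cle : suc (cost B x1 + cost B x2) ≤ suc n
    cle = subst (_≤ suc n) (c-dup-hit {x} {x1} {x2} B refl) c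
    c1le : cost B x1 ≤ n
    c1le = ≤-trans (m≤m+n (cost B x1) (cost B x2)) (≤-pred cle)
    c2le : cost B x2 ≤ n
    c2le = ≤-trans (m≤n+m (cost B x2) (cost B x1)) (≤-pred cle)
    bd1 : Disjoint (binders B) (fv N1)
    bd1 (p , q) = W1∉ (inN1 q) (inVars (binders⊆vars B p))
    res1 : SubstResult B N1 x1 (W2 ++ A)
    res1 = substitute n B (W2 ++ A) wB wN1 x1∈ dis1 bd1 c1le
    R1 : Term
    R1 = proj₁ res1
    d1 : B ⟨ N1 / x1 ⟩⇒ R1
    d1 = proj₁ (proj₂ res1)
    bp1 : BindersFrom B N1 (W2 ++ A) R1
    bp1 = proj₂ (proj₂ res1)
    ih1 : SubstSpec B N1 x1 R1
    ih1 = substSpec d1 wB wN1 x1∈ dis1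
    djW1N : Disjoint W1 (vars N)
    djW1N (p , q) = W1∉ p (inVarsN q)
    djW2N : Disjoint W2 (vars N)
    djW2N (p , q) = W2∉ p (inVarsN q)
    bd2 : Disjoint (binders R1) (fv N2)
    bd2 {b} (p , q) with bp1 p
    ... | inj₁ r = W2∉ (inN2 q) (inVars (binders⊆vars B r))
    ... | inj₂ (inj₂ r) = r (∈-++⁺ˡ (inN2 q))
    ... | inj₂ (inj₁ r) with binders-swaps V W1 N djW1N len1 uV uW1 djV1 r
    ...   | inj₁ s = W2∉ (inN2 q) (inVarsN (binders⊆vars N s))
    ...   | inj₂ s = dW (s , inN2 q)
    x2nN1' : x2 ∉ fv N1
    x2nN1' p = W1∉ (inN1 p) (there (there (here refl)))
    c2le' : cost R1 x2 ≤ n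
    c2le' = ≤-trans (SubstSpec.cst ih1 x2 (λ e → x1≢x2 (sym e)) x2nN1') c2le
    res2 : SubstResult R1 N2 x2 A
    res2 = substitute n R1 A (SubstSpec.wf ih1) wN2 (FirstCopy.x2R1 ih1 x2∈ x1≢x2) (FirstCopy.dis2 ih1) bd2
        c2le'
    R2 : Term
    R2 = proj₁ res2
    d2 : R1 ⟨ N2 / x2 ⟩⇒ R2
    d2 = proj₁ (proj₂ res2)
    bp2 : BindersFrom R1 N2 A R2
    bp2 = proj₂ (proj₂ res2)
    eqR : dups V (fv N1) (fv N2) R2 ≡ dupsBy V c1 c2 R2
    eqR = cong₂ (λ a b → dups V a b R2) fvN1 fvN2
    nA1 : ∀ {b} → b ∈ W1 → b ∉ A
    nA1 p r = avoids (∈-++⁺ˡ p , ∈-++⁺ˡ r)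
    nA2 : ∀ {b} → b ∈ W2 → b ∉ A
    nA2 p r = avoids (∈-++⁺ʳ W1 p , ∈-++⁺ˡ r)
    fromR1 : ∀ {b} → b ∈ binders B ⊎ b ∈ binders N1 ⊎ b ∉ W2 ++ A
        → b ∈ binders (dup x x1 x2 B) ⊎ b ∈ binders N ⊎ b ∉ A
    fromR1 = [ (λ s → inj₁ (there (there s))) ,
               [ (λ s → [ (λ t → inj₂ (inj₁ t)) , (λ t → inj₂ (inj₂ (nA1 t))) ]′
                   (binders-swaps V W1 N djW1N len1 uV uW1 djV1 s)) ,
                 (λ s → inj₂ (inj₂ (λ t → s (∈-++⁺ʳ W2 t)))) ]′ ]′
    fromR2 : ∀ {b} → b ∈ binders R1 ⊎ b ∈ binders N2 ⊎ b ∉ A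
        → b ∈ binders (dup x x1 x2 B) ⊎ b ∈ binders N ⊎ b ∉ A
    fromR2 = [ (λ r → fromR1 (bp1 r)) ,
               [ (λ r → [ (λ t → inj₂ (inj₁ t)) , (λ t → inj₂ (inj₂ (nA2 t))) ]′
                   (binders-swaps V W2 N djW2N len2 uV uW2 djV2 r)) ,
                 (λ r → inj₂ (inj₂ r)) ]′ ]′
    bp : BindersFrom (dup x x1 x2 B) N A (dups V (fv N1) (fv N2) R2)
    bp {b} p = [ (λ q → inj₂ (inj₂ (nA1 (mapW1 q)))) , [ (λ q → inj₂ (inj₂ (nA2 (mapW2 q)))) ,
        (λ q → fromR2 (bp2 q)) ]′ ]′
                 (binders-dups V c1 c2 R2 (subst (λ t → b ∈ binders t) eqR p))

  record Substitution (M N : Term) (x : Var) : Set where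
    field
      result : Term
      reduces : freshen (fv N) M ⟨ N / x ⟩⇒ result
      spec : SubstSpec (freshen (fv N) M) N x result

  substitution : ∀ {M N x} → WF M → WF N → x ∈ fv M → Avoids M N x → Substitution M N x
  substitution {M} {N} {x} wM wN x∈ dis = record
    { result = proj₁ res ; reduces = proj₁ (proj₂ res) ; spec = substSpec (proj₁ (proj₂ res)) wM' wN x∈' dis'
        }
    where
    M' : Term
    M' = freshen (fv N) M
    wM' : WF M'
    wM' = freshen-WF (fv N) wM
    x∈' : x ∈ fv M'
    x∈' = subst (x ∈_) (sym (freshen-fv (fv N) M)) x∈
    dis' : Avoids M' N x
    dis' zM = dis (subst (_ ∈_) (freshen-fv (fv N) M) zM)
    binders-fresh : Disjoint (binders M') (fv N)
    binders-fresh (p , q) = freshen-bnd (fv N) M p q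
    res : SubstResult M' N x []
    res = substitute (cost M' x) M' [] wM' wN x∈' dis' binders-fresh ≤-refl

module HeadSteps where
  open NameLists
  open FunctionalTyping
  open AlphaConversion
  open SubstitutionToolkit
  open SubstitutionLemma
  open SubstitutionExists

  Typeable : Term → Set
  Typeable T = Σ Ctx λ G → Σ Strict λ σ → G ⊩ T ∶ σ

  record Step (T : Term) : Set where
    field
      T' : Term
      st : T ⟶ T'
      wf : WF T'
      fv⊆ : ∀ {z} → z ∈ fv T' → z ∈ fv T
      fv⊇ : ∀ {z} → z ∈ fv T → z ∈ fv T'
      ex : ∀ {G σ} → G ⊩ T' ∶ σ → G ⊩ T ∶ σ

  data LamHeaded : Term → Set where
    nlam : ∀ {x M} → LamHeaded (lam x M)
    nera : ∀ {x M} → LamHeaded M → LamHeaded (era x M)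
    ndup : ∀ {x y z M} → LamHeaded M → LamHeaded (dup x y z M)
    napp : ∀ {M N} → LamHeaded M → LamHeaded (app M N)

  data VarHeaded : Term → Set where
    fvar : ∀ {x} → VarHeaded (var x)
    fera : ∀ {x M} → VarHeaded M → VarHeaded (era x M)
    fdup : ∀ {x y z M} → VarHeaded M → VarHeaded (dup x y z M)
    fapp : ∀ {M N} → VarHeaded M → VarHeaded (app M N)

  headShape : ∀ M → VarHeaded M ⊎ LamHeaded M
  headShape (var x) = inj₁ fvar
  headShape (lam x M) = inj₂ nlam
  headShape (app M N) with headShape M
  ... | inj₁ f = inj₁ (fapp f)
  ... | inj₂ n = inj₂ (napp n)
  headShape (era x M) with headShape M
  ... | inj₁ f = inj₁ (fera f)
  ... | inj₂ n = inj₂ (nera n)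
  headShape (dup x y z M) with headShape M
  ... | inj₁ f = inj₁ (fdup f)
  ... | inj₂ n = inj₂ (ndup n)

  var-lam-headed : ∀ {M} → VarHeaded M → LamHeaded M → ⊥
  var-lam-headed (fera f) (nera n) = var-lam-headed f n
  var-lam-headed (fdup f) (ndup n) = var-lam-headed f n
  var-lam-headed (fapp f) (napp n) = var-lam-headed f n

  βStep : ∀ x B Q → WF (app (lam x B) Q) → Typeable Q → Step (app (lam x B) Q)
  βStep x B Q (app (lam wB x∈) wQ dj) (GQ , τQ , dQ) = record
    { T' = result ; st = equiv (c-appL (c-lam (freshen-≡ₛ (fv Q) wB))) (β reduces) refl≡ ; wf = SubstSpec.wf
        spec
    ; fv⊆ = f⊆ ; fv⊇ = f⊇ ; ex = ex' }
    where
    open Substitution (substitution wB wQ x∈ (λ zB n zQ → dj (─-⁺ (fv B) zB n , zQ)))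
    f⊆ : ∀ {z} → z ∈ fv result → z ∈ fv (app (lam x B) Q)
    f⊆ q with SubstSpec.fv⁻ spec q
    ... | inj₁ (a , n) = ∈-++⁺ˡ (─-⁺ (fv B) (subst (_ ∈_) (freshen-fv (fv Q) B) a) n)
    ... | inj₂ b = ∈-++⁺ʳ (fv B ─ x) b
    f⊇ : ∀ {z} → z ∈ fv (app (lam x B) Q) → z ∈ fv result
    f⊇ q with ∈-++⁻ (fv B ─ x) q
    ... | inj₁ a = SubstSpec.fvM spec (subst (_ ∈_) (sym (freshen-fv (fv Q) B)) (─-⊆ (fv B) a)) (─-≢ (fv B) a)
    ... | inj₂ b = SubstSpec.fvN spec b
    ex' : ∀ {G σ} → G ⊩ result ∶ σ → G ⊩ app (lam x B) Q ∶ σ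
    ex' d' with SubstSpec.exp spec d'
    ... | (H , α , K , dM , hx , ar , e) = ta (tl (freshen-typing (fv Q) wB dM) hx ≋-refl) ar dQ e

  ωStep : ∀ y B Q → WF (app (era y B) Q) → Step (app (era y B) Q)
  ωStep y B Q (app (era wB y∉) wQ dj) = record
    { T' = era y (app B Q) ; st = ω-appL
    ; wf = era (app wB wQ (λ (p , q) → dj (there p , q))) (λ q → y∉' (∈-++⁻ (fv B) q))
    ; fv⊆ = f0
    ; fv⊇ = λ q → f2 (∈-++⁻ (y ∷ fv B) q)
    ; ex = λ { (te (ta d a d0 p') p) → ta (te d ≋-refl) a d0 (≋-trans p p') } }
    where
    y∉' : (y ∈ fv B) ⊎ (y ∈ fv Q) → ⊥
    y∉' (inj₁ q) = y∉ q
    y∉' (inj₂ q) = dj (here refl , q)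
    f1 : ∀ {z} → (z ∈ fv B) ⊎ (z ∈ fv Q) → z ∈ (y ∷ fv B) ++ fv Q
    f1 (inj₁ q) = there (∈-++⁺ˡ q)
    f1 (inj₂ q) = ∈-++⁺ʳ (y ∷ fv B) q
    f0 : ∀ {z} → z ∈ y ∷ (fv B ++ fv Q) → z ∈ (y ∷ fv B) ++ fv Q
    f0 (here e) = here e
    f0 (there q) = f1 (∈-++⁻ (fv B) q)
    f2 : ∀ {z} → (z ∈ y ∷ fv B) ⊎ (z ∈ fv Q) → z ∈ y ∷ (fv B ++ fv Q)
    f2 (inj₁ (here e)) = here e
    f2 (inj₁ (there q)) = there (∈-++⁺ˡ q)
    f2 (inj₂ q) = there (∈-++⁺ʳ (fv B) q)

  appLStep : ∀ {P Q} → WF (app P Q) → Step P → Step (app P Q)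
  appLStep {P} {Q} (app wP wQ dj) s = record
    { T' = app (Step.T' s) Q ; st = c-appL (Step.st s)
    ; wf = app (Step.wf s) wQ (λ (p , q) → dj (Step.fv⊆ s p , q))
    ; fv⊆ = λ q → f1 (∈-++⁻ (fv (Step.T' s)) q)
    ; fv⊇ = λ q → f2 (∈-++⁻ (fv P) q)
    ; ex = λ { (ta d a d0 p) → ta (Step.ex s d) a d0 p } }
    where
    f1 : ∀ {z} → (z ∈ fv (Step.T' s)) ⊎ (z ∈ fv Q) → z ∈ fv P ++ fv Q
    f1 (inj₁ q) = ∈-++⁺ˡ (Step.fv⊆ s q)
    f1 (inj₂ q) = ∈-++⁺ʳ (fv P) q
    f2 : ∀ {z} → (z ∈ fv P) ⊎ (z ∈ fv Q) → z ∈ fv (Step.T' s) ++ fv Q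
    f2 (inj₁ q) = ∈-++⁺ˡ (Step.fv⊇ s q)
    f2 (inj₂ q) = ∈-++⁺ʳ (fv (Step.T' s)) q

  dupBodyStep : ∀ {y y1 y2 B} → WF (dup y y1 y2 B) → Step B → Step (dup y y1 y2 B)
  dupBodyStep {y} {y1} {y2} {B} (dup wB y1∈ y2∈ ne y∉) s = record
    { T' = dup y y1 y2 (Step.T' s) ; st = c-dup (Step.st s)
    ; wf = dup (Step.wf s) (Step.fv⊇ s y1∈) (Step.fv⊇ s y2∈) ne
        (λ q → y∉ (─⊆⊆ (fv (Step.T' s)) (fv B) (Step.fv⊆ s) q))
    ; fv⊆ = λ { (here e) → here e ; (there q) → there (─⊆⊆ (fv (Step.T' s)) (fv B) (Step.fv⊆ s) q) }
    ; fv⊇ = λ { (here e) → here e ; (there q) → there (─⊆⊆ (fv B) (fv (Step.T' s)) (Step.fv⊇ s) q) }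
    ; ex = λ { (td d p) → td (Step.ex s d) p } }

  -- x <^y1_y2 (λw.B) → λw'.(x <^y1_y2 B') after renaming the binder away from x.
  γLamStep : ∀ y y1 y2 w B → WF (dup y y1 y2 (lam w B)) → Step (dup y y1 y2 (lam w B))
  γLamStep y y1 y2 w B (dup wL y1∈ y2∈ y1≢y2 y∉) = record
    { T' = lam w' (dup y y1 y2 B'') ; st = equiv (c-dup (freshen-≡ₛ S wL)) (γ-lam w'≢y) refl≡
    ; wf = lam (dup wB'' y1B y2B y1≢y2 y∉'') w'in
    ; fv⊆ = f⊆ ; fv⊇ = f⊇ ; ex = ex' }
    where
    S : List Var
    S = y ∷ []
    B0 : Term
    B0 = freshen S B
    w' : Var
    w' = fresh (w ∷ S ++ vars B0)
    B'' L' : Term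
    B'' = swap w' w B0
    L' = lam w' B''
    wL' : WF L'
    wL' = freshen-WF S wL
    wB'' : WF B''
    wB'' with wL'
    ... | lam q _ = q
    w'B : w' ∈ fv B''
    w'B with wL'
    ... | lam _ q = q
    fvL : fv B'' ─ w' ≡ fv B ─ w
    fvL = freshen-fv S (lam w B)
    w'≢y : w' ≢ y
    w'≢y e = freshen-bnd S (lam w B) (here refl) (here e)
    toL : ∀ {z} → z ∈ fv B'' → z ≢ w' → z ∈ fv B ─ w
    toL p n = subst (_ ∈_) fvL (─-⁺ (fv B'') p n)
    fromL : ∀ {z} → z ∈ fv B ─ w → z ∈ fv B'' × z ≢ w'
    fromL p = let q = subst (_ ∈_) (sym fvL) p in ─-⊆ (fv B'') q , ─-≢ (fv B'') q
    y1B : y1 ∈ fv B''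
    y1B = proj₁ (fromL y1∈)
    y2B : y2 ∈ fv B''
    y2B = proj₁ (fromL y2∈)
    y1≢w' : y1 ≢ w'
    y1≢w' = proj₂ (fromL y1∈)
    y2≢w' : y2 ≢ w'
    y2≢w' = proj₂ (fromL y2∈)
    y∉'' : y ∉ (fv B'' ─ y1) ─ y2
    y∉'' q = y∉ (─-⁺ ((fv B ─ w) ─ y1) (─-⁺ (fv B ─ w)
        (toL (─-⊆ (fv B'') (─-⊆ (fv B'' ─ y1) q)) (λ e → w'≢y (sym e)))
                    (─-≢ (fv B'') (─-⊆ (fv B'' ─ y1) q))) (─-≢ (fv B'' ─ y1) q))
    w'in : w' ∈ fv (dup y y1 y2 B'')
    w'in = there (─-⁺ (fv B'' ─ y1) (─-⁺ (fv B'') w'B (λ e → y1≢w' (sym e))) (λ e → y2≢w' (sym e)))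
    f⊆ : ∀ {z} → z ∈ (y ∷ ((fv B'' ─ y1) ─ y2)) ─ w' → z ∈ y ∷ (((fv B ─ w) ─ y1) ─ y2)
    f⊆ q with ─-⊆ (y ∷ ((fv B'' ─ y1) ─ y2)) q
    ... | here e = here e
    ... | there r = there (─-⁺ ((fv B ─ w) ─ y1)
        (─-⁺ (fv B ─ w) (toL (─-⊆ (fv B'') (─-⊆ (fv B'' ─ y1) r)) (─-≢ (y ∷ ((fv B'' ─ y1) ─ y2)) q))
                    (─-≢ (fv B'') (─-⊆ (fv B'' ─ y1) r))) (─-≢ (fv B'' ─ y1) r))
    f⊇ : ∀ {z} → z ∈ y ∷ (((fv B ─ w) ─ y1) ─ y2) → z ∈ (y ∷ ((fv B'' ─ y1) ─ y2)) ─ w'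
    f⊇ (here refl) = ─-⁺ (y ∷ ((fv B'' ─ y1) ─ y2)) (here refl) (λ e → w'≢y (sym e))
    f⊇ (there r) = ─-⁺ (y ∷ ((fv B'' ─ y1) ─ y2))
       (there (─-⁺ (fv B'' ─ y1) (─-⁺ (fv B'') (proj₁ (fromL a)) (─-≢ (fv B ─ w) (─-⊆ ((fv B ─ w) ─ y1) r)))
           (─-≢ ((fv B ─ w) ─ y1) r)))
       (proj₂ (fromL a))
      where a = ─-⊆ (fv B ─ w) (─-⊆ ((fv B ─ w) ─ y1) r)
    ex' : ∀ {G σ} → G ⊩ lam w' (dup y y1 y2 B'') ∶ σ → G ⊩ dup y y1 y2 (lam w B) ∶ σ
    ex' {G} (tl {H = H} {α = α} (td {H = H'} dB p') a p) =
      td (freshen-typing S wL (tl dB a' ≋-refl)) ctx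
      where
      a' : α ↭ H' w'
      a' = ↭-trans a (↭-trans (p' w') (↭-reflexive
          (trans (upd-no w'≢y) (trans (del-no (λ e → y2≢w' (sym e))) (del-no (λ e → y1≢w' (sym e)))))))
      ctx : G ≋ contract y y1 y2 (del w' H')
      ctx = ≋-trans p (≋-trans (del-≋ p')
          (λ v → ↭-reflexive (del-contract H' (λ e → w'≢y (sym e)) y1≢w' y2≢w' v)))

  γωStep : ∀ y y1 y2 w B → w ≢ y1 → w ≢ y2 → WF (dup y y1 y2 (era w B)) → Step (dup y y1 y2 (era w B))
  γωStep y y1 y2 w B w≢y1 w≢y2 (dup (era wB w∉B) y1∈ y2∈ y1≢y2 y∉) = record
    { T' = era w (dup y y1 y2 B) ; st = γω w≢y1 w≢y2
    ; wf = era (dup wB (inB y1∈ (λ e → w≢y1 (sym e))) (inB y2∈ (λ e → w≢y2 (sym e))) y1≢y2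
        (λ q → y∉ (lift q))) w∉
    ; fv⊆ = f⊆ ; fv⊇ = f⊇ ; ex = λ { (te (td d p') p) → td (te d ≋-refl) (≋-trans p p') } }
    where
    inB : ∀ {z} → z ∈ w ∷ fv B → z ≢ w → z ∈ fv B
    inB (here e) n = ⊥-elim (n e)
    inB (there q) n = q
    lift : ∀ {z} → z ∈ (fv B ─ y1) ─ y2 → z ∈ ((w ∷ fv B) ─ y1) ─ y2
    lift = ─⊆⊆ (fv B) (w ∷ fv B) there
    wIn : w ∈ ((w ∷ fv B) ─ y1) ─ y2
    wIn = ─-⁺ ((w ∷ fv B) ─ y1) (─-⁺ (w ∷ fv B) (here refl) w≢y1) w≢y2
    w∉ : w ∉ y ∷ ((fv B ─ y1) ─ y2)
    w∉ (here e) = y∉ (subst (_∈ ((w ∷ fv B) ─ y1) ─ y2) e wIn)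
    w∉ (there q) = w∉B (─-⊆ (fv B) (─-⊆ (fv B ─ y1) q))
    f⊆ : ∀ {z} → z ∈ w ∷ y ∷ ((fv B ─ y1) ─ y2) → z ∈ y ∷ (((w ∷ fv B) ─ y1) ─ y2)
    f⊆ (here refl) = there wIn
    f⊆ (there (here e)) = here e
    f⊆ (there (there q)) = there (lift q)
    f⊇ : ∀ {z} → z ∈ y ∷ (((w ∷ fv B) ─ y1) ─ y2) → z ∈ w ∷ y ∷ ((fv B ─ y1) ─ y2)
    f⊇ (here e) = there (here e)
    f⊇ (there q) with ─-⊆ (w ∷ fv B) (─-⊆ ((w ∷ fv B) ─ y1) q)
    ... | here e = here e
    ... | there r = there (there (─-⁺ (fv B ─ y1) (─-⁺ (fv B) r (─-≢ (w ∷ fv B) (─-⊆ ((w ∷ fv B) ─ y1) q)))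
        (─-≢ ((w ∷ fv B) ─ y1) q)))

  Arg-var : ∀ {y α K} → Arg (var y) α K → (K y ↭ α) × (∀ v → v ≢ y → K v ≡ [])
  Arg-var (an p) = ↭-trans (p _) ↭-refl , (λ v _ → ↭-empty-inv (p v))
  Arg-var {y} (ac {τ = τ} (tv q) a p) with Arg-var a
  ... | (k1 , k2) = ↭-trans (p y) (PP.++⁺ (↭-trans (q y) (↭-reflexive (single-yes refl))) k1) ,
                    (λ v n → ↭-empty-inv (↭-trans (p v)
                        (↭-reflexive (cong₂ _++_ (↭-empty-inv (↭-trans (q v) (↭-reflexive (single-no n))))
                        (k2 v n)))))

  γωHitStep : ∀ y a b B → WF (dup y a b (era a B)) → Step (dup y a b (era a B))
  γωHitStep y a b B (dup (era wB a∉B) a∈ b∈ a≢b y∉) = record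
    { T' = R ; st = equiv (c-dup (c-era (freshen-≡ₛ S wB))) (γω-hit reduces) refl≡ ; wf = SubstSpec.wf ih
    ; fv⊆ = f⊆ ; fv⊇ = f⊇ ; ex = ex' }
    where
    S : List Var
    S = y ∷ []
    inB : ∀ {z} → z ∈ a ∷ fv B → z ≢ a → z ∈ fv B
    inB (here e) n = ⊥-elim (n e)
    inB (there q) n = q
    inRest : ∀ {z} → z ∈ fv B → z ≢ b → z ∈ ((a ∷ fv B) ─ a) ─ b
    inRest q n = ─-⁺ ((a ∷ fv B) ─ a) (─-⁺ (a ∷ fv B) (there q) (λ e → a∉B (subst (_∈ fv B) e q))) n
    dis : Avoids B (var y) b
    dis zB n (here e) = y∉ (subst (_∈ ((a ∷ fv B) ─ a) ─ b) e (inRest zB n))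
    open Substitution (substitution wB var (inB b∈ (λ e → a≢b (sym e))) dis)
      renaming (result to R; spec to ih)
    toB : ∀ {z} → z ∈ fv (freshen S B) → z ∈ fv B
    toB = subst (_ ∈_) (freshen-fv S B)
    frB : ∀ {z} → z ∈ fv B → z ∈ fv (freshen S B)
    frB = subst (_ ∈_) (sym (freshen-fv S B))
    f⊆ : ∀ {z} → z ∈ fv R → z ∈ y ∷ (((a ∷ fv B) ─ a) ─ b)
    f⊆ q with SubstSpec.fv⁻ ih q
    ... | inj₁ (r , n) = there (inRest (toB r) n)
    ... | inj₂ (here e) = here e
    f⊇ : ∀ {z} → z ∈ y ∷ (((a ∷ fv B) ─ a) ─ b) → z ∈ fv R
    f⊇ (here refl) = SubstSpec.fvN ih (here refl)
    f⊇ (there q) = SubstSpec.fvM ih (frB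
        (inB (─-⊆ (a ∷ fv B) (─-⊆ ((a ∷ fv B) ─ a) q)) (─-≢ (a ∷ fv B) (─-⊆ ((a ∷ fv B) ─ a) q))))
        (─-≢ ((a ∷ fv B) ─ a) q)
    ex' : ∀ {G σ} → G ⊩ R ∶ σ → G ⊩ dup y a b (era a B) ∶ σ
    ex' {G} d' with SubstSpec.exp ih d'
    ... | (H , α , K , dB , hx , ar , e) = td (te (freshen-typing S wB dB) ≋-refl) ctx
      where
      Ha : H a ≡ []
      Ha = ⊩-support dB a (λ q → a∉B (toB q))
      Hy : y ≢ b → H y ≡ []
      Hy n = ⊩-support dB y (λ q → y∉ (inRest (toB q) n))
      ctx : G ≋ contract y a b H
      ctx v = by-cases (v ≟ y)
        (λ ey → ↭-trans (e v) (↭-trans (↭-reflexive (cong (_++ K v) (dby ey)))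
            (↭-trans (↭-trans (↭-reflexive (cong K ey)) (proj₁ (Arg-var ar)))
                  (↭-trans hx (↭-reflexive (sym (trans (upd-yes ey) (cong (_++ H b) Ha))))))))
        (λ ny → ↭-trans (e v) (↭-reflexive (trans (cong (del b H v ++_) (proj₂ (Arg-var ar) v ny))
                  (trans (++-identityʳ _) (sym (trans (upd-no ny)
                      (by-cases (v ≟ b) (λ eb → trans (del-yes eb) (sym (del-yes eb)))
                     (λ nb → trans (del-no nb) (trans
                         (by-cases (v ≟ a) (λ ea → trans (del-yes ea) (sym (trans (cong H ea) Ha))) del-no)
                         (sym (del-no nb)))))))))))
        where
        dby : v ≡ y → del b H v ≡ []
        dby ey = by-cases (v ≟ b) del-yes (λ nb
            → trans (del-no nb) (trans (cong H ey) (Hy (λ e' → nb (trans ey e')))))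

  -- The symmetric case y <^a_b (b ⊙ B) is reduced through dup-comm.
  WF-dup-comm : ∀ {y a b M} → WF (dup y a b M) → WF (dup y b a M)
  WF-dup-comm {y} {a} {b} {M} (dup w a∈ b∈ ne y∉) = dup w b∈ a∈ (λ e → ne (sym e))
      (subst (y ∉_) (─-comm a b (fv M)) y∉)

  commStep : ∀ {y a b M} → Step (dup y b a M) → Step (dup y a b M)
  commStep {y} {a} {b} {M} s = record
    { T' = Step.T' s ; st = equiv dup-comm (Step.st s) refl≡ ; wf = Step.wf s
    ; fv⊆ = λ {z} q → subst (z ∈_) (cong (y ∷_) (─-comm b a (fv M))) (Step.fv⊆ s q)
    ; fv⊇ = λ {z} q → Step.fv⊇ s (subst (z ∈_) (cong (y ∷_) (─-comm a b (fv M))) q)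
    ; ex = λ d → ⊩-dup-comm (Step.ex s d) }

  headStepApp : ∀ P Q → LamHeaded P → WF (app P Q) → Typeable P → Typeable Q → Step (app P Q)
  headStepDup : ∀ y y1 y2 B → LamHeaded B → WF (dup y y1 y2 B) → Typeable (dup y y1 y2 B)
      → Step (dup y y1 y2 B)
  headStepDupEra : ∀ y y1 y2 w B → Dec (w ≡ y1) → Dec (w ≡ y2) → WF (dup y y1 y2 (era w B))
      → Step (dup y y1 y2 (era w B))

  headStepApp (lam x B) Q nlam w tP tQ = βStep x B Q w tQ
  headStepApp (era y B) Q (nera _) w tP tQ = ωStep y B Q w
  headStepApp (dup y y1 y2 B) Q (ndup nf) (app wP wQ dj) tP tQ = appLStep (app wP wQ dj)
      (headStepDup y y1 y2 B nf wP tP)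
  headStepApp (app P1 P2) Q (napp nf) (app wP wQ dj) (G , σ , ta d a d0 p) tQ =
    appLStep (app wP wQ dj) (headStepApp P1 P2 nf wP (_ , _ , d) (_ , _ , d0))

  headStepDup y y1 y2 (lam w B) nlam wD tD = γLamStep y y1 y2 w B wD
  headStepDup y y1 y2 (era w B) (nera _) wD tD = headStepDupEra y y1 y2 w B (w ≟ y1) (w ≟ y2) wD
  headStepDup y y1 y2 (dup a b c B) (ndup nf) (dup wB p1 p2 ne p) (G , σ , td d q) =
    dupBodyStep (dup wB p1 p2 ne p) (headStepDup a b c B nf wB (_ , _ , d))
  headStepDup y y1 y2 (app B1 B2) (napp nf) (dup wB p1 p2 ne p) (G , σ , td (ta d a d0 q') q) =
    dupBodyStep (dup wB p1 p2 ne p) (headStepApp B1 B2 nf wB (_ , _ , d) (_ , _ , d0))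

  headStepDupEra y y1 y2 .y1 B (yes refl) _ wD = γωHitStep y y1 y2 B wD
  headStepDupEra y y1 y2 .y2 B (no n1) (yes refl) wD = commStep (γωHitStep y y2 y1 B (WF-dup-comm wD))
  headStepDupEra y y1 y2 w B (no n1) (no n2) wD = γωStep y y1 y2 w B n1 n2 wD

module Typability where
  open FunctionalTyping
  open HeadSteps

  infix 4 _⊑_
  data _⊑_ : Term → Term → Set where
    ⊑refl : ∀ {M} → M ⊑ M
    ⊑lam : ∀ {x P M} → lam x P ⊑ M → P ⊑ M
    ⊑appL : ∀ {P Q M} → app P Q ⊑ M → P ⊑ M
    ⊑appR : ∀ {P Q M} → app P Q ⊑ M → Q ⊑ M
    ⊑era : ∀ {x P M} → era x P ⊑ M → P ⊑ M
    ⊑dup : ∀ {x y z P M} → dup x y z P ⊑ M → P ⊑ M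

  liftStep : ∀ {P M P'} → P ⊑ M → P ⟶ P' → Σ Term λ M' → (M ⟶ M') × (P' ⊑ M')
  liftStep ⊑refl r = _ , r , ⊑refl
  liftStep (⊑lam s) r with liftStep s (c-lam r)
  ... | (M' , r' , s') = M' , r' , ⊑lam s'
  liftStep (⊑appL s) r with liftStep s (c-appL r)
  ... | (M' , r' , s') = M' , r' , ⊑appL s'
  liftStep (⊑appR s) r with liftStep s (c-appR r)
  ... | (M' , r' , s') = M' , r' , ⊑appR s'
  liftStep (⊑era s) r with liftStep s (c-era r)
  ... | (M' , r' , s') = M' , r' , ⊑era s'
  liftStep (⊑dup s) r with liftStep s (c-dup r)
  ... | (M' , r' , s') = M' , r' , ⊑dup s'

  TypeableFlexibly : Term → Set
  TypeableFlexibly M = Σ Ctx λ G → Σ Strict λ σ → (G ⊩ M ∶ σ) × (VarHeaded M → ∀ ρ → Σ Ctx λ G' → G' ⊩ M ∶ ρ)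

  subterms-typeable : ∀ {M} → SN M → ∀ P → P ⊑ M → WF P → TypeableFlexibly P
  subterms-typeable s (var x) sub w = single x (atom 0) , atom 0 , tv ≋-refl , λ _ ρ → single x ρ , tv ≋-refl
  subterms-typeable s (lam x B) sub (lam wB _) with subterms-typeable s B (⊑lam sub) wB
  ... | (H , σ , d , _) = del x H , (H x ⇒ σ) , tl d ↭-refl ≋-refl , λ ()
  subterms-typeable s (era x B) sub (era wB _) with subterms-typeable s B (⊑era sub) wB
  ... | (H , σ , d , fl) = H , σ , te d ≋-refl , λ
      { (fera f) ρ → proj₁ (fl f ρ) , te (proj₂ (fl f ρ)) ≋-refl }
  subterms-typeable s (dup x y z B) sub (dup wB _ _ _ _) with subterms-typeable s B (⊑dup sub) wB
  ... | (H , σ , d , fl) = contract x y z H , σ , td d ≋-refl , λ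
      { (fdup f) ρ → contract x y z (proj₁ (fl f ρ)) , td (proj₂ (fl f ρ)) ≋-refl }
  subterms-typeable (sn h) (app P Q) sub (app wP wQ dj) with subterms-typeable (sn h) P (⊑appL sub) wP |
      subterms-typeable (sn h) Q (⊑appR sub) wQ | headShape P
  ... | (GP , σP , dP , flP) | (GQ , τQ , dQ , _) | inj₁ f =
    _ , atom 0 , proj₂ (at-any-type (atom 0)) , λ _ ρ → at-any-type ρ
    where
    at-any-type : ∀ ρ → Σ Ctx λ G' → G' ⊩ app P Q ∶ ρ
    at-any-type ρ with flP f ((τQ ∷ []) ⇒ ρ)
    ... | (G' , d') = _ , ta d' (ac dQ (an ≋-refl) ≋-refl) dQ ≋-refl
  ... | (GP , σP , dP , flP) | (GQ , τQ , dQ , _) | inj₂ nf with headStepApp P Q nf (app wP wQ dj)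
      (GP , σP , dP) (GQ , τQ , dQ)
  ...   | stp with liftStep sub (Step.st stp)
  ...     | (M' , r' , sub') with subterms-typeable (h r') (Step.T' stp) sub' (Step.wf stp)
  ...       | (G , σ , d , _) = G , σ , Step.ex stp d , λ { (fapp f) → ⊥-elim (var-lam-headed f nf) }

open ToOfficialSystem using (basisOn; ⊩⇒⊢)
open Typability using (⊑refl; subterms-typeable)

mainTheorem2 : (M : Term) → WF M → SN M → ∃[ Γ ] ∃[ σ ] (Γ ⊢ M ∶ σ)
mainTheorem2 M wf normalising with subterms-typeable normalising M ⊑refl wf
... | (G , σ , derivation , _) = basisOn G (fv M) , σ , ⊩⇒⊢ wf derivation
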